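{- Let $n$ be a product of primes each of which is congruent to $1$ modulo $6$, and let $\xi$ be a primitive element of $\mathbb{F}_{2^n}$. Suppose that for every integer $t>1$ there are $N_t/18$ pairs $(a_i,b_i)$, $i=1,\dots,N_t/18$, of elements of $\mathbb{Z}_{2^n-1}$ such that $$\mathrm{Cos}(t)=\dot\bigcup_i\big(C\Gamma(a_i)\,\dot\cup\,C\Gamma(b_i)\,\dot\cup\,C\Gamma(a_i+b_i)\big)$$ (all unions disjoint). Then there is a partition of $\mathbb{Z}_{2^n-1}\setminus\{0\}$ into $18$-element subsets of the form $\Gamma(a)\,\dot\cup\,\Gamma(b)\,\dot\cup\,\Gamma(c)$ with $a+b+c=0$, and there is a balanced triangle design in $\mathbb{F}_{2^n}$ (as an $\mathbb{F}_2$-space) invariant under the action of $\mathbb{F}_{2^n}^*$ (by multiplication) and under the action of $\mathrm{Aut}(\mathbb{F}_{2^n})$.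
   Context: Elements of $\mathbb{Z}_{2^n-1}$ are exponents of $\xi$. For nonzero $k$, $\mathrm{Z}(k)$ is defined by $1+\xi^k=\xi^{\mathrm{Z}(k)}$ and $\Gamma(k)=\{k,\mathrm{Z}(k),\mathrm{Z}(-k),-\mathrm{Z}(-k),-\mathrm{Z}(k),-k\}$. $C(k)=\{2^ik: i\ge0\}\subseteq\mathbb{Z}_{2^n-1}$ is the $2$-cyclotomic class of $k$, $C\Gamma(k)=\bigcup_{s\in\Gamma(k)}C(s)$, $\mathrm{Cos}(t)$ is the union of all $2$-cyclotomic classes of size $t$, and $N_t$ is the number of such classes (for such $n$, $N_t$ is divisible by $18$ for $t>1$). A triangle is a set $\{\langle a,b\rangle,\langle b,c\rangle,\langle c,a\rangle\}$ of $2$-dimensional $\mathbb{F}_2$-subspaces with $a,b,c$ linearly independent; a triangle design is a set of triangles such that every $2$-dimensional subspace belongs to exactly one of them; it is balanced if every nonzero vector lies in a $2$-subspace of the same number of its triangles. -}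

module Defs where

open import Level using (Level; _⊔_)
open import Data.Nat using (ℕ; zero; suc; _∸_; _^_; _<_; NonZero)
open import Data.Nat.DivMod using (_mod_; _%_)
open import Data.Fin using (Fin; toℕ) renaming (zero to f0; suc to fs)
open import Data.Fin.Properties using (any?) renaming (_≟_ to _≟F_)
open import Data.List using (List; []; _∷_; map; upTo; length; filter; deduplicate; _++_)
open import Data.List.Relation.Unary.All using (All; all?)
open import Data.List.Membership.Propositional using (_∈_)
open import Data.Fin.Base using () renaming (_≤_ to _≤F_)
open import Data.Fin.Properties using () renaming (_≤?_ to _≤?F_)
open import Data.List.Relation.Unary.Unique.Propositional using (Unique)
open import Data.Vec.Functional using () renaming (map to vmap)
open import Data.Product using (Σ; ∃; _×_; _,_; proj₁; proj₂)
open import Data.Sum using (_⊎_)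
open import Relation.Nullary using (¬_; Dec)
open import Relation.Nullary.Decidable using (_×-dec_; _⊎-dec_)
open import Relation.Binary using (Decidable)
open import Relation.Binary.PropositionalEquality using (_≡_; _≢_)
open import Algebra.Bundles using (CommutativeRing)
import Data.Nat as N

DisjCover : ∀ {a b} {A : Set a} (I : Set b) → (I → A → Set) → (A → Set) → Set (a ⊔ b)
DisjCover {A = A} I P S =
  (∀ (s : A) → S s → ∃ λ i → P i s)
  × (∀ i (s : A) → P i s → S s)
  × (∀ i j (s : A) → P i s → P j s → i ≡ j)

-- Arithmetic in ℤ_m (m = 2^n - 1), elements represented by Fin m.
-- Z is the Zech logarithm (supplied as a function, pinned down by its
-- defining property in the statement).

module ZM (m : ℕ) .{{_ : NonZero m}} (Z : Fin m → Fin m) where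

  _⊕_ : Fin m → Fin m → Fin m
  a ⊕ b = (toℕ a N.+ toℕ b) mod m

  ⊖_ : Fin m → Fin m
  ⊖ a = (m ∸ toℕ a) mod m

  ΓList : Fin m → List (Fin m)
  ΓList k = k ∷ Z k ∷ Z (⊖ k) ∷ ⊖ (Z (⊖ k)) ∷ ⊖ (Z k) ∷ ⊖ k ∷ []

  -- C(k) = {2^i k : i ≥ 0}; the indices i < m already give every element
  CList : Fin m → List (Fin m)
  CList k = map (λ i → (2 ^ i N.* toℕ k) mod m) (upTo m)

  size : Fin m → ℕ
  size k = length (deduplicate _≟F_ (CList k))

  isRep : Fin m → Set
  isRep k = All (λ s → k ≤F s) (CList k)

  isRep? : ∀ k → Dec (isRep k)
  isRep? k = all? (λ s → k ≤?F s) (CList k)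

  Nt : ℕ → ℕ
  Nt t = length (filter (λ k → (size k N.≟ t) ×-dec isRep? k) (Data.List.allFin m))
    where import Data.List

  Cos : ℕ → Fin m → Set
  Cos t s = size s ≡ t

  CΓ : Fin m → Fin m → Set
  CΓ k s = ∃ λ r → r ∈ ΓList k × s ∈ CList r

  pieceOf : Fin m × Fin m → Fin 3 → Fin m
  pieceOf (a , b) f0 = a
  pieceOf (a , b) (fs f0) = b
  pieceOf (a , b) (fs (fs f0)) = a ⊕ b

  PairHypothesis : Set
  PairHypothesis = ∀ t → 1 < t →
    Σ (Fin (Nt t N./ 18) → Fin m × Fin m) λ pr →
      DisjCover (Fin (Nt t N./ 18) × Fin 3)
                (λ ij s → CΓ (pieceOf (pr (proj₁ ij)) (proj₂ ij)) s)
                (Cos t)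

  block : Fin m × Fin m × Fin m → List (Fin m)
  block (a , b , c) = ΓList a ++ ΓList b ++ ΓList c

  GammaPartition : Set
  GammaPartition = Σ ℕ λ K → Σ (Fin K → Fin m × Fin m × Fin m) λ tr →
      (∀ i → let (a , b , c) = tr i in (toℕ a N.+ toℕ b N.+ toℕ c) % m ≡ 0)
    × (∀ i → Unique (block (tr i)))     -- 18 distinct elements: the union is disjoint
    × DisjCover (Fin K) (λ i s → s ∈ block (tr i)) (λ s → toℕ s ≢ 0)

module FieldDefs {c ℓ} (R : CommutativeRing c ℓ) where
  open CommutativeRing R

  pow : Carrier → ℕ → Carrier
  pow x zero = 1#
  pow x (suc k) = x * pow x k

  -- R is (a presentation of) the field F_{2^n} and ξ is a primitive element:
  -- R has exactly 2^n elements 0, ξ^0, ..., ξ^{2^n-2}, and ξ^{2^n-1} = 1.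
  record IsPrimitiveField (n : ℕ) (ξ : Carrier) : Set (c ⊔ ℓ) where
    field
      nontrivial : ¬ (0# ≈ 1#)
      order      : pow ξ (2 ^ n ∸ 1) ≈ 1#
      injective  : ∀ i j → i < 2 ^ n ∸ 1 → j < 2 ^ n ∸ 1 → pow ξ i ≈ pow ξ j → i ≡ j
      surjective : ∀ x → x ≈ 0# ⊎ (∃ λ k → k < 2 ^ n ∸ 1 × x ≈ pow ξ k)
      decEq      : Decidable _≈_

  IsZech : (m : ℕ) → Carrier → (Fin m → Fin m) → Set ℓ
  IsZech m ξ Z = ∀ k → toℕ k ≢ 0 → 1# + pow ξ (toℕ k) ≈ pow ξ (toℕ (Z k))

  Span : Carrier → Carrier → Carrier → Set ℓ
  Span u w x = x ≈ 0# ⊎ x ≈ u ⊎ x ≈ w ⊎ x ≈ u + w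

  SameSub : Carrier × Carrier → Carrier × Carrier → Set (c ⊔ ℓ)
  SameSub (u , w) (u' , w') = ∀ x → (Span u w x → Span u' w' x) × (Span u' w' x → Span u w x)

  Indep2 : Carrier → Carrier → Set ℓ
  Indep2 u w = ¬ (u ≈ 0#) × ¬ (w ≈ 0#) × ¬ (u + w ≈ 0#)

  Indep3 : Carrier × Carrier × Carrier → Set ℓ
  Indep3 (a , b , c) = ¬ (a ≈ 0#) × ¬ (b ≈ 0#) × ¬ (c ≈ 0#) × ¬ (a + b ≈ 0#)
                     × ¬ (b + c ≈ 0#) × ¬ (a + c ≈ 0#) × ¬ (a + b + c ≈ 0#)

  subsOf : Carrier × Carrier × Carrier → Fin 3 → Carrier × Carrier
  subsOf (a , b , c) f0 = (a , b)
  subsOf (a , b , c) (fs f0) = (b , c)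
  subsOf (a , b , c) (fs (fs f0)) = (c , a)

  InTri : Carrier × Carrier → Carrier × Carrier × Carrier → Set (c ⊔ ℓ)
  InTri uw T = ∃ λ j → SameSub uw (subsOf T j)

  SameTri : Carrier × Carrier × Carrier → Carrier × Carrier × Carrier → Set (c ⊔ ℓ)
  SameTri T T' = (∀ j → InTri (subsOf T j) T') × (∀ j → InTri (subsOf T' j) T)

  IsTriangleDesign : (K : ℕ) → (Fin K → Carrier × Carrier × Carrier) → Set (c ⊔ ℓ)
  IsTriangleDesign K D =
      (∀ i → Indep3 (D i))
    × (∀ u w → Indep2 u w → ∃ λ i → InTri (u , w) (D i))
    × (∀ u w → Indep2 u w → ∀ i j → InTri (u , w) (D i) → InTri (u , w) (D j) → i ≡ j)

  Covers : Carrier × Carrier × Carrier → Carrier → Set ℓ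
  Covers T v = ∃ λ j → Span (proj₁ (subsOf T j)) (proj₂ (subsOf T j)) v

  module _ (_≟_ : Decidable _≈_) where
    Covers? : ∀ T v → Dec (Covers T v)
    Covers? T v = any? λ j → (v ≟ 0#) ⊎-dec ((v ≟ proj₁ (subsOf T j))
                     ⊎-dec ((v ≟ proj₂ (subsOf T j))
                     ⊎-dec (v ≟ (proj₁ (subsOf T j) + proj₂ (subsOf T j)))))

    countCover : (K : ℕ) → (Fin K → Carrier × Carrier × Carrier) → Carrier → ℕ
    countCover K D v = length (filter (λ i → Covers? (D i) v) (Data.List.allFin K))
      where import Data.List

    IsBalanced : (K : ℕ) → (Fin K → Carrier × Carrier × Carrier) → Set (c ⊔ ℓ)
    IsBalanced K D = ∃ λ r → ∀ v → ¬ (v ≈ 0#) → countCover K D v ≡ r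

  mapTri : (Carrier → Carrier) → Carrier × Carrier × Carrier → Carrier × Carrier × Carrier
  mapTri f (a , b , c) = (f a , f b , f c)

  Invariant : (Carrier → Carrier) → (K : ℕ) → (Fin K → Carrier × Carrier × Carrier) → Set (c ⊔ ℓ)
  Invariant f K D = (∀ i → ∃ λ j → SameTri (mapTri f (D i)) (D j))
                  × (∀ j → ∃ λ i → SameTri (mapTri f (D i)) (D j))

  record IsAutomorphism (σ : Carrier → Carrier) : Set (c ⊔ ℓ) where
    field
      cong-σ : ∀ {x y} → x ≈ y → σ x ≈ σ y
      +-hom  : ∀ x y → σ (x + y) ≈ σ x + σ y
      *-hom  : ∀ x y → σ (x * y) ≈ σ x * σ y
      1-hom  : σ 1# ≈ 1#
      inj    : ∀ {x y} → σ x ≈ σ y → x ≈ y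
      surj   : ∀ y → ∃ λ x → σ x ≈ y

  DesignConclusion : Decidable _≈_ → Set (c ⊔ ℓ)
  DesignConclusion _≟_ = Σ ℕ λ K → Σ (Fin K → Carrier × Carrier × Carrier) λ D →
      IsTriangleDesign K D
    × IsBalanced _≟_ K D
    × (∀ λ' → ¬ (λ' ≈ 0#) → Invariant (λ' *_) K D)
    × (∀ σ → IsAutomorphism σ → Invariant σ K D)

module Submission where

-- Writing nonzero field elements as powers ξᵏ identifies 𝔽*₂ₙ with ℤ_m (m = 2ⁿ − 1); addition becomes
-- the Zech logarithm Z, and the Frobenius x ↦ x² becomes k ↦ 2k. For odd n no element has order 3, so
-- Z and negation generate a group of order 6 acting freely on exponents with orbits Γ(k), and this
-- action commutes with Frobenius. In the hypothesis every CΓ(a) of a class size t ∣ n is a union of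
-- t Frobenius translates of Γ(a); since t is prime to 6, a translate of Γ(a) meets Γ(a) only if it is Γ(a).
-- Hence the triples (2ᵖa, 2ᵖb, −2ᵖ(a + b)) give the partition into Γ-blocks with sum 0. Each such
-- triple (a, b, c) and rotation λ give the triangle ξ^λ, ξ^(λ+a), ξ^(λ+a+b) with sides ⟨ξᵖ, ξ^(p+x)⟩,
-- x ∈ {a, b, c}; as the side ⟨ξᵖ, ξ^(p+k)⟩ determines k up to Γ(k), and p once k is fixed, every
-- 2-subspace lies on exactly one triangle. Multiplication by ξᵏ rotates λ, which also makes the design
-- balanced, and every automorphism is a Frobenius power, which permutes the triples.

open import Defs
open import Level using (Level)
open import Data.Nat using (ℕ; _<_; _∸_; _^_; _%_; NonZero)
open import Data.Nat.Divisibility using (_∣_)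
open import Data.Nat.Primality using (Prime)
open import Data.Fin using (Fin)
open import Data.Product using (_×_)
open import Relation.Binary.PropositionalEquality using (_≡_)
open import Algebra.Bundles using (CommutativeRing)
import Data.Nat as ℕ
import Data.Nat.Properties as ℕ
open import Data.Product using (_,_)
import Relation.Binary.PropositionalEquality as ≡

module ModularArithmetic (m : ℕ) .{{m≢0 : NonZero m}} where

  open import Data.Nat
  open import Data.Nat.Properties
  open import Data.Nat.DivMod
  open import Data.Fin using (Fin; toℕ)
  open import Data.Fin.Properties using (toℕ-fromℕ<; toℕ-injective; toℕ<n)
  open import Data.Product using (_,_)
  open import Relation.Binary.PropositionalEquality
  open import Relation.Binary.Bundles using (Setoid)
  import Relation.Binary.Construct.On as On
  import Relation.Binary.Reasoning.Setoid as SetoidReasoning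
  open import Algebra.Bundles using (AbelianGroup)
  open import Algebra.Structures {A = Fin m} _≡_ using (IsAbelianGroup)

  infix 4 _≋_
  _≋_ : ℕ → ℕ → Set
  x ≋ y = x % m ≡ y % m

  ≋-setoid : Setoid _ _
  ≋-setoid = On.setoid {B = ℕ} (setoid ℕ) (_% m)

  module ≋-Reasoning = SetoidReasoning ≋-setoid

  +-cong-≋ : ∀ {x x′ y y′} → x ≋ x′ → y ≋ y′ → x + y ≋ x′ + y′
  +-cong-≋ {x} {x′} {y} {y′} p q = begin
    (x + y) % m           ≡⟨ %-distribˡ-+ x y m ⟩
    (x % m + y % m) % m   ≡⟨ cong₂ (λ a b → (a + b) % m) p q ⟩
    (x′ % m + y′ % m) % m ≡⟨ %-distribˡ-+ x′ y′ m ⟨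
    (x′ + y′) % m         ∎ where open ≡-Reasoning

  *-cong-≋ : ∀ {x x′ y y′} → x ≋ x′ → y ≋ y′ → x * y ≋ x′ * y′
  *-cong-≋ {x} {x′} {y} {y′} p q = begin
    (x * y) % m             ≡⟨ %-distribˡ-* x y m ⟩
    (x % m * (y % m)) % m   ≡⟨ cong₂ (λ a b → (a * b) % m) p q ⟩
    (x′ % m * (y′ % m)) % m ≡⟨ %-distribˡ-* x′ y′ m ⟨
    (x′ * y′) % m           ∎ where open ≡-Reasoning

  0<m : 0 < m
  0<m = >-nonZero⁻¹ m

  m≋0 : m ≋ 0
  m≋0 = trans (n%n≡0 m) (sym (m<n⇒m%n≡m 0<m))

  *m≋0 : ∀ k → k * m ≋ 0
  *m≋0 k = trans (m*n%n≡0 k m) (sym (m<n⇒m%n≡m 0<m))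

  ⟦_⟧ : ℕ → Fin m
  ⟦ x ⟧ = x mod m

  toℕ-⟦⟧ : ∀ x → toℕ ⟦ x ⟧ ≋ x
  toℕ-⟦⟧ x = trans (cong (_% m) (toℕ-fromℕ< (m%n<n x m))) (m%n%n≡m%n x m)

  toℕ%m : (a : Fin m) → toℕ a % m ≡ toℕ a
  toℕ%m a = m<n⇒m%n≡m (toℕ<n a)

  ≋⇒≡ : {a b : Fin m} → toℕ a ≋ toℕ b → a ≡ b
  ≋⇒≡ {a} {b} p = toℕ-injective (trans (sym (toℕ%m a)) (trans p (toℕ%m b)))

  0ₘ : Fin m
  0ₘ = ⟦ 0 ⟧

  toℕ-0ₘ : toℕ 0ₘ ≡ 0
  toℕ-0ₘ = trans (toℕ-fromℕ< (m%n<n 0 m)) (m<n⇒m%n≡m 0<m)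

  -- _⊕_ and ⊖_ unfold to ZM._⊕_ and ZM.⊖_ of Defs; φ p, multiplication by 2ᵖ, is the Frobenius
  -- action on exponents of ξ.
  infixl 6 _⊕_
  _⊕_ : Fin m → Fin m → Fin m
  a ⊕ b = ⟦ toℕ a + toℕ b ⟧

  ⊖_ : Fin m → Fin m
  ⊖ a = ⟦ m ∸ toℕ a ⟧

  φ : ℕ → Fin m → Fin m
  φ p a = ⟦ 2 ^ p * toℕ a ⟧

  toℕ-⊕ : ∀ a b → toℕ (a ⊕ b) ≋ toℕ a + toℕ b
  toℕ-⊕ a b = toℕ-⟦⟧ (toℕ a + toℕ b)

  toℕ-φ : ∀ p a → toℕ (φ p a) ≋ 2 ^ p * toℕ a
  toℕ-φ p a = toℕ-⟦⟧ (2 ^ p * toℕ a)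

  ⊕-comm : ∀ a b → a ⊕ b ≡ b ⊕ a
  ⊕-comm a b = cong ⟦_⟧ (+-comm (toℕ a) (toℕ b))

  ⊕-assoc : ∀ a b c → a ⊕ b ⊕ c ≡ a ⊕ (b ⊕ c)
  ⊕-assoc a b c = ≋⇒≡ (begin
    toℕ (a ⊕ b ⊕ c)             ≈⟨ toℕ-⊕ (a ⊕ b) c ⟩
    toℕ (a ⊕ b) + toℕ c         ≈⟨ +-cong-≋ (toℕ-⊕ a b) refl ⟩
    toℕ a + toℕ b + toℕ c       ≡⟨ +-assoc (toℕ a) (toℕ b) (toℕ c) ⟩
    toℕ a + (toℕ b + toℕ c)     ≈⟨ +-cong-≋ {toℕ a} refl (toℕ-⊕ b c) ⟨
    toℕ a + toℕ (b ⊕ c)         ≈⟨ toℕ-⊕ a (b ⊕ c) ⟨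
    toℕ (a ⊕ (b ⊕ c))           ∎)
    where open ≋-Reasoning

  ⊕-identityʳ : ∀ a → a ⊕ 0ₘ ≡ a
  ⊕-identityʳ a = ≋⇒≡ (begin
    toℕ (a ⊕ 0ₘ)      ≈⟨ toℕ-⊕ a 0ₘ ⟩
    toℕ a + toℕ 0ₘ    ≡⟨ cong (toℕ a +_) toℕ-0ₘ ⟩
    toℕ a + 0         ≡⟨ +-identityʳ (toℕ a) ⟩
    toℕ a             ∎)
    where open ≋-Reasoning

  ⊕-identityˡ : ∀ a → 0ₘ ⊕ a ≡ a
  ⊕-identityˡ a = trans (⊕-comm 0ₘ a) (⊕-identityʳ a)

  ⊖-inverseˡ : ∀ a → ⊖ a ⊕ a ≡ 0ₘ
  ⊖-inverseˡ a = ≋⇒≡ (begin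
    toℕ (⊖ a ⊕ a)             ≈⟨ toℕ-⊕ (⊖ a) a ⟩
    toℕ (⊖ a) + toℕ a         ≈⟨ +-cong-≋ (toℕ-⟦⟧ (m ∸ toℕ a)) refl ⟩
    m ∸ toℕ a + toℕ a         ≡⟨ m∸n+n≡m (<⇒≤ (toℕ<n a)) ⟩
    m                         ≈⟨ m≋0 ⟩
    0                         ≡⟨ toℕ-0ₘ ⟨
    toℕ 0ₘ                    ∎)
    where open ≋-Reasoning

  ⊖-inverseʳ : ∀ a → a ⊕ ⊖ a ≡ 0ₘ
  ⊖-inverseʳ a = trans (⊕-comm a (⊖ a)) (⊖-inverseˡ a)

  ⊕-isAbelianGroup : IsAbelianGroup _⊕_ 0ₘ ⊖_
  ⊕-isAbelianGroup = record
    { isGroup = record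
      { isMonoid = record
        { isSemigroup = record
          { isMagma = record { isEquivalence = isEquivalence ; ∙-cong = cong₂ _⊕_ }
          ; assoc = ⊕-assoc }
        ; identity = ⊕-identityˡ , ⊕-identityʳ }
      ; inverse = ⊖-inverseˡ , ⊖-inverseʳ
      ; ⁻¹-cong = cong ⊖_ }
    ; comm = ⊕-comm }

  ⊕-abelianGroup : AbelianGroup _ _
  ⊕-abelianGroup = record { isAbelianGroup = ⊕-isAbelianGroup }

  open import Algebra.Properties.AbelianGroup ⊕-abelianGroup public
    using ()
    renaming ( ⁻¹-involutive to ⊖-involutive ; ⁻¹-injective to ⊖-injective
             ; ∙-cancelˡ to ⊕-cancelˡ ; ∙-cancelʳ to ⊕-cancelʳ
             ; inverseˡ-unique to ⊖-unique ; ε⁻¹≈ε to ⊖-0ₘ ; ⁻¹-∙-comm to ⊖-⊕-distrib )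

  ⊕-solveʳ : ∀ {a y b} → a ⊕ y ≡ b → y ≡ b ⊕ ⊖ a
  ⊕-solveʳ {a} {y} {b} a⊕y≡b = begin
    y                 ≡⟨ ⊕-identityˡ y ⟨
    0ₘ ⊕ y            ≡⟨ cong (_⊕ y) (⊖-inverseˡ a) ⟨
    ⊖ a ⊕ a ⊕ y       ≡⟨ ⊕-assoc (⊖ a) a y ⟩
    ⊖ a ⊕ (a ⊕ y)     ≡⟨ cong (⊖ a ⊕_) a⊕y≡b ⟩
    ⊖ a ⊕ b           ≡⟨ ⊕-comm (⊖ a) b ⟩
    b ⊕ ⊖ a           ∎
    where open ≡-Reasoning

  ⊖-cancelʳ : ∀ a b → a ⊕ ⊖ b ⊕ b ≡ a
  ⊖-cancelʳ a b = trans (⊕-assoc a (⊖ b) b) (trans (cong (a ⊕_) (⊖-inverseˡ b)) (⊕-identityʳ a))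

  ⊕-⊖-cancel : ∀ a b → a ⊕ (b ⊕ ⊖ a) ≡ b
  ⊕-⊖-cancel a b = trans (sym (⊕-assoc a b (⊖ a))) (trans (cong (_⊕ ⊖ a) (⊕-comm a b))
    (trans (⊕-assoc b a (⊖ a)) (trans (cong (b ⊕_) (⊖-inverseʳ a)) (⊕-identityʳ b))))

  φ-⊕ : ∀ p a b → φ p (a ⊕ b) ≡ φ p a ⊕ φ p b
  φ-⊕ p a b = ≋⇒≡ (begin
    toℕ (φ p (a ⊕ b))                   ≈⟨ toℕ-φ p (a ⊕ b) ⟩
    2 ^ p * toℕ (a ⊕ b)                 ≈⟨ *-cong-≋ {2 ^ p} refl (toℕ-⊕ a b) ⟩
    2 ^ p * (toℕ a + toℕ b)             ≡⟨ *-distribˡ-+ (2 ^ p) (toℕ a) (toℕ b) ⟩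
    2 ^ p * toℕ a + 2 ^ p * toℕ b       ≈⟨ +-cong-≋ (toℕ-φ p a) (toℕ-φ p b) ⟨
    toℕ (φ p a) + toℕ (φ p b)           ≈⟨ toℕ-⊕ (φ p a) (φ p b) ⟨
    toℕ (φ p a ⊕ φ p b)                 ∎)
    where open ≋-Reasoning

  φ-0ₘ : ∀ p → φ p 0ₘ ≡ 0ₘ
  φ-0ₘ p = ⊕-cancelˡ (φ p 0ₘ) _ _ (begin
    φ p 0ₘ ⊕ φ p 0ₘ  ≡⟨ φ-⊕ p 0ₘ 0ₘ ⟨
    φ p (0ₘ ⊕ 0ₘ)    ≡⟨ cong (φ p) (⊕-identityʳ 0ₘ) ⟩
    φ p 0ₘ           ≡⟨ ⊕-identityʳ (φ p 0ₘ) ⟨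
    φ p 0ₘ ⊕ 0ₘ      ∎)
    where open ≡-Reasoning

  φ-⊖ : ∀ p a → φ p (⊖ a) ≡ ⊖ φ p a
  φ-⊖ p a = ⊖-unique _ _ (trans (sym (φ-⊕ p (⊖ a) a)) (trans (cong (φ p) (⊖-inverseˡ a)) (φ-0ₘ p)))

  φ-zero : ∀ a → φ 0 a ≡ a
  φ-zero a = ≋⇒≡ (trans (toℕ-φ 0 a) (cong (_% m) (+-identityʳ (toℕ a))))

  φ-φ : ∀ p q a → φ p (φ q a) ≡ φ (p + q) a
  φ-φ p q a = ≋⇒≡ (begin
    toℕ (φ p (φ q a))         ≈⟨ toℕ-φ p (φ q a) ⟩
    2 ^ p * toℕ (φ q a)       ≈⟨ *-cong-≋ {2 ^ p} refl (toℕ-φ q a) ⟩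
    2 ^ p * (2 ^ q * toℕ a)   ≡⟨ *-assoc (2 ^ p) (2 ^ q) (toℕ a) ⟨
    2 ^ p * 2 ^ q * toℕ a     ≡⟨ cong (_* toℕ a) (^-distribˡ-+-* 2 p q) ⟨
    2 ^ (p + q) * toℕ a       ≈⟨ toℕ-φ (p + q) a ⟨
    toℕ (φ (p + q) a)         ∎)
    where open ≋-Reasoning

  φ-cong-≋ : ∀ {p q} a → 2 ^ p ≋ 2 ^ q → φ p a ≡ φ q a
  φ-cong-≋ {p} {q} a 2^p≋2^q = ≋⇒≡ (begin
    toℕ (φ p a)      ≈⟨ toℕ-φ p a ⟩
    2 ^ p * toℕ a    ≈⟨ *-cong-≋ 2^p≋2^q refl ⟩
    2 ^ q * toℕ a    ≈⟨ toℕ-φ q a ⟨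
    toℕ (φ q a)      ∎)
    where open ≋-Reasoning

  ⊕-self : ∀ a → a ⊕ a ≡ φ 1 a
  ⊕-self a = cong ⟦_⟧ (cong (toℕ a +_) (sym (+-identityʳ (toℕ a))))

  Nonzero : Fin m → Set
  Nonzero a = toℕ a ≢ 0

  Nonzero⇒≢0ₘ : ∀ {a} → Nonzero a → a ≢ 0ₘ
  Nonzero⇒≢0ₘ a≢0 refl = a≢0 toℕ-0ₘ

  ≢0ₘ⇒Nonzero : ∀ {a} → a ≢ 0ₘ → Nonzero a
  ≢0ₘ⇒Nonzero a≢0ₘ toℕa≡0 = a≢0ₘ (toℕ-injective (trans toℕa≡0 (sym toℕ-0ₘ)))

  ⊖-nonzero : ∀ {a} → Nonzero a → Nonzero (⊖ a)
  ⊖-nonzero {a} a≢0 = ≢0ₘ⇒Nonzero λ ⊖a≡0ₘ →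
    Nonzero⇒≢0ₘ a≢0 (trans (sym (⊖-involutive a)) (trans (cong ⊖_ ⊖a≡0ₘ) ⊖-0ₘ))

module ListFacts where

  open import Data.Nat using (suc; _≤_; z≤n; s≤s)
  open import Data.Nat.Properties using (≤-antisym)
  open import Data.Fin using () renaming (zero to fzero; suc to fsuc)
  open import Data.List using (List; []; _∷_; _++_; length; lookup; map; filter; allFin)
  open import Data.List.Properties using (length-map; map-tabulate; tabulate-lookup)
  open import Data.List.Membership.Propositional using (_∈_)
  open import Data.List.Membership.Propositional.Properties
    using (∈-map⁺; ∈-map⁻; ∈-filter⁺; ∈-filter⁻; ∈-lookup; ∈-++⁺ʳ)
  open import Data.List.Relation.Binary.Subset.Propositional using (_⊆_)
  open import Data.List.Relation.Unary.Any using (here; there)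
  import Data.List.Relation.Unary.All as All
  open import Data.List.Relation.Unary.AllPairs using (_∷_)
  open import Data.List.Relation.Unary.Unique.Propositional using (Unique)
  import Data.List.Relation.Unary.Unique.Propositional.Properties as Unique
  open import Data.Product using (∃; _×_; _,_)
  open import Data.Empty using (⊥; ⊥-elim)
  open import Function.Definitions using (Injective)
  open import Relation.Nullary using (yes; no)
  open import Relation.Unary using (Pred; Decidable)
  open import Relation.Binary.PropositionalEquality

  module _ {a} {A : Set a} where

    private
      remove : (xs : List A) {x : A} → x ∈ xs → List A
      remove (_ ∷ ys) (here _)  = ys
      remove (y ∷ ys) (there p) = y ∷ remove ys p

      length-remove : (xs : List A) {x : A} (p : x ∈ xs) → suc (length (remove xs p)) ≡ length xs
      length-remove (_ ∷ _)  (here _)  = refl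
      length-remove (_ ∷ ys) (there p) = cong suc (length-remove ys p)

      ∈-remove : (xs : List A) {x z : A} (p : x ∈ xs) → z ∈ xs → z ≢ x → z ∈ remove xs p
      ∈-remove (_ ∷ _)  (here refl) (here refl) z≢x = ⊥-elim (z≢x refl)
      ∈-remove (_ ∷ _)  (here refl) (there q)   _   = q
      ∈-remove (_ ∷ _)  (there p)   (here refl) _   = here refl
      ∈-remove (_ ∷ ys) (there p)   (there q)   z≢x = there (∈-remove ys p q z≢x)

    Unique-⊆⇒length≤ : ∀ {xs : List A} (ys : List A) → Unique xs → xs ⊆ ys → length xs ≤ length ys
    Unique-⊆⇒length≤ {[]}     ys _          _   = z≤n
    Unique-⊆⇒length≤ {x ∷ xs} ys (x∉ ∷ !xs) sub =
      subst (suc (length xs) ≤_) (length-remove ys x∈ys)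
        (s≤s (Unique-⊆⇒length≤ (remove ys x∈ys) !xs
          (λ z∈ → ∈-remove ys x∈ys (sub (there z∈)) λ { refl → All.lookup x∉ z∈ refl })))
      where x∈ys = sub (here refl)

    Unique-⊆⊇⇒length≡ : ∀ {xs ys : List A} → Unique xs → Unique ys → xs ⊆ ys → ys ⊆ xs →
                        length xs ≡ length ys
    Unique-⊆⊇⇒length≡ {xs} {ys} !xs !ys xs⊆ys ys⊆xs =
      ≤-antisym (Unique-⊆⇒length≤ ys !xs xs⊆ys) (Unique-⊆⇒length≤ xs !ys ys⊆xs)

    lookup-injective : ∀ {xs : List A} → Unique xs → Injective _≡_ _≡_ (lookup xs)
    lookup-injective {_ ∷ _}  _          {fzero}  {fzero}  _  = refl
    lookup-injective {_ ∷ xs} (x∉ ∷ _)   {fzero}  {fsuc j} eq = ⊥-elim (All.lookup x∉ (∈-lookup {xs = xs} j) eq)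
    lookup-injective {_ ∷ xs} (x∉ ∷ _)   {fsuc i} {fzero}  eq = ⊥-elim (All.lookup x∉ (∈-lookup {xs = xs} i) (sym eq))
    lookup-injective {_ ∷ _}  (_ ∷ !xs)  {fsuc i} {fsuc j} eq = cong fsuc (lookup-injective !xs eq)

    Unique-++-disjoint : ∀ {xs ys : List A} {z} → Unique (xs ++ ys) → z ∈ xs → z ∈ ys → ⊥
    Unique-++-disjoint {_ ∷ xs} (x∉ ∷ _) (here refl) z∈ys = All.lookup x∉ (∈-++⁺ʳ xs z∈ys) refl
    Unique-++-disjoint {_ ∷ _}  (_ ∷ !xs) (there z∈xs) z∈ys = Unique-++-disjoint !xs z∈xs z∈ys

    Unique-++ʳ : ∀ (xs : List A) {ys} → Unique (xs ++ ys) → Unique ys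
    Unique-++ʳ []       !ys        = !ys
    Unique-++ʳ (_ ∷ xs) (_ ∷ !xs) = Unique-++ʳ xs !xs

  module _ {a b p} {A : Set a} {B : Set b} {P : Pred B p} (P? : Decidable P) (f : A → B) where

    length-filter-map : ∀ xs → length (filter P? (map f xs)) ≡ length (filter (λ x → P? (f x)) xs)
    length-filter-map []       = refl
    length-filter-map (x ∷ xs) with P? (f x)
    ... | yes _ = cong suc (length-filter-map xs)
    ... | no _  = length-filter-map xs

  length-filter-lookup : ∀ {a p} {A : Set a} {P : Pred A p} (P? : Decidable P) (xs : List A) →
    length (filter (λ i → P? (lookup xs i)) (allFin (length xs))) ≡ length (filter P? xs)
  length-filter-lookup P? xs = trans (sym (length-filter-map P? (lookup xs) (allFin (length xs))))
    (cong (λ ys → length (filter P? ys)) (trans (map-tabulate (λ i → i) (lookup xs)) (tabulate-lookup xs)))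

  module _ {a p} {A : Set a} {P : Pred A p} (P? : Decidable P) (f : A → A) where

    length-filter-permute : ∀ xs → Unique xs → Injective _≡_ _≡_ f → (∀ {x} → x ∈ xs → f x ∈ xs) →
      (∀ {y} → y ∈ xs → ∃ λ x → x ∈ xs × f x ≡ y) →
      length (filter (λ x → P? (f x)) xs) ≡ length (filter P? xs)
    length-filter-permute xs !xs f-inj f-into f-onto =
      trans (sym (length-map f (filter (λ x → P? (f x)) xs)))
        (Unique-⊆⊇⇒length≡ (Unique.map⁺ f-inj (Unique.filter⁺ (λ x → P? (f x)) !xs)) (Unique.filter⁺ P? !xs) to from)
      where
      to : map f (filter (λ x → P? (f x)) xs) ⊆ filter P? xs
      to z∈ with ∈-map⁻ f z∈
      ... | x , x∈ , refl with ∈-filter⁻ (λ x → P? (f x)) {xs = xs} x∈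
      ...   | x∈xs , Pfx = ∈-filter⁺ P? (f-into x∈xs) Pfx
      from : filter P? xs ⊆ map f (filter (λ x → P? (f x)) xs)
      from z∈ with ∈-filter⁻ P? {xs = xs} z∈
      ... | z∈xs , Pz with f-onto z∈xs
      ...   | x , x∈xs , refl = ∈-map⁺ f (∈-filter⁺ (λ x → P? (f x)) x∈xs Pz)

module NatFacts where

  open import Data.Nat hiding (parity)
  open import Data.Nat.Properties
  open import Data.Nat.Induction using (<-rec)
  open import Data.Product using (Σ; ∃; _,_)
  open import Data.Sum using (_⊎_; inj₁; inj₂)
  open import Relation.Binary.PropositionalEquality
  open import Data.Nat.Divisibility using (_∣_; divides; ∣-trans)
  open import Data.Nat.Coprimality using (Coprime; coprime-divisor)
  open import Data.Nat.Primality using (Prime; prime?; prime[2]; prime⇒irreducible)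
  open import Data.Empty using (⊥-elim)
  open import Relation.Nullary.Decidable using (toWitness)

  even-or-odd : ∀ k → ∃ λ h → k ≡ 2 * h ⊎ k ≡ 1 + 2 * h
  even-or-odd zero = 0 , inj₁ refl
  even-or-odd (suc k) with even-or-odd k
  ... | h , inj₁ k≡2h   = h , inj₂ (cong suc k≡2h)
  ... | h , inj₂ k≡1+2h = suc h , inj₁ (trans (cong suc k≡1+2h) (sym (*-suc 2 h)))

  odd-part : ∀ k → 0 < k → Σ ℕ λ r → Σ ℕ λ o → k ≡ 2 ^ r * (1 + 2 * o)
  odd-part = <-rec _ step
    where
    step : ∀ k → (∀ {j} → j < k → 0 < j → Σ ℕ λ r → Σ ℕ λ o → j ≡ 2 ^ r * (1 + 2 * o)) →
           0 < k → Σ ℕ λ r → Σ ℕ λ o → k ≡ 2 ^ r * (1 + 2 * o)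
    step k rec 0<k with even-or-odd k
    ... | h , inj₂ k≡1+2h = 0 , h , trans k≡1+2h (sym (+-identityʳ _))
    ... | h , inj₁ k≡2h with rec h<k 0<h
      where
      0<h : 0 < h
      0<h = n≢0⇒n>0 λ { refl → <⇒≢ 0<k (sym k≡2h) }
      h<k : h < k
      h<k = subst (h <_) (sym k≡2h) (subst (h <_) (cong (h +_) (sym (+-identityʳ h))) (m<m+n h 0<h))
    ...   | r , o , h≡ = suc r , o , trans k≡2h (trans (cong (2 *_) h≡) (sym (*-assoc 2 (2 ^ r) _)))

  n<2^n : ∀ k → k < 2 ^ k
  n<2^n zero    = s≤s z≤n
  n<2^n (suc k) = subst (suc k <_) (cong (2 ^ k +_) (sym (+-identityʳ (2 ^ k))))
    (+-mono-≤-< (m^n>0 2 k) (n<2^n k))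

  2^k∸1-odd : ∀ k → 0 < k → Σ ℕ λ j → 2 ^ k ∸ 1 ≡ 1 + 2 * j
  2^k∸1-odd (suc k) _ = 2 ^ k ∸ 1 , suc-injective (begin
    suc (2 ^ suc k ∸ 1)              ≡⟨ +-∸-assoc 1 (m^n>0 2 (suc k)) ⟨
    2 ^ suc k                        ≡⟨ cong (2 *_) (m∸n+n≡m {2 ^ k} {1} (m^n>0 2 k)) ⟨
    2 * (2 ^ k ∸ 1 + 1)              ≡⟨ *-distribˡ-+ 2 (2 ^ k ∸ 1) 1 ⟩
    2 * (2 ^ k ∸ 1) + 2              ≡⟨ +-comm _ 2 ⟩
    suc (1 + 2 * (2 ^ k ∸ 1))        ∎)
    where open ≡-Reasoning

  module _ {n : ℕ} (primes≡1[6] : ∀ p → Prime p → p ∣ n → p % 6 ≡ 1) where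

    odd-of-primes≡1[6] : Σ ℕ λ q → n ≡ 1 + 2 * q
    odd-of-primes≡1[6] with even-or-odd n
    ... | h , inj₂ n≡1+2h = h , n≡1+2h
    ... | h , inj₁ n≡2h with () ← primes≡1[6] 2 prime[2] (divides h (trans n≡2h (*-comm 2 h)))

    divisor-coprime-to-6 : ∀ {t d} → t ∣ n → t ∣ 6 * d → t ∣ d
    divisor-coprime-to-6 {t} {d} t∣n t∣6d =
      coprime-divisor (coprime-to 3 (toWitness {a? = prime? 3} _) λ ())
        (coprime-divisor (coprime-to 2 prime[2] λ ()) (subst (t ∣_) (*-assoc 2 3 d) t∣6d))
      where
      coprime-to : ∀ p → Prime p → p % 6 ≢ 1 → Coprime t p
      coprime-to p p-prime p%6≢1 (i∣t , i∣p) with prime⇒irreducible p-prime i∣p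
      ... | inj₁ i≡1   = i≡1
      ... | inj₂ refl  = ⊥-elim (p%6≢1 (primes≡1[6] p p-prime (∣-trans i∣t t∣n)))

module CyclotomicClasses (n m : ℕ) .{{m≢0 : NonZero m}} (m≡2^n∸1 : m ≡ 2 ^ n ∸ 1) (0<n : 0 < n) where

  open import Data.Nat
  open import Data.Nat.Properties
  open import Data.Nat.DivMod
  open import Data.Nat.Tactic.RingSolver using (solve-∀)
  open import Data.Nat.Divisibility using (_∣_; m%n≡0⇒n∣m; ∣⇒≤)
  open import Data.Fin using (Fin; toℕ) renaming (_≟_ to _≟F_)
  open import Data.List using (List; map; upTo; length; deduplicate; applyUpTo)
  open import Data.List.Properties using (length-applyUpTo)
  open import Data.List.Membership.Propositional using (_∈_)
  open import Data.List.Membership.Propositional.Properties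
    using (∈-map⁺; ∈-map⁻; ∈-upTo⁺; ∈-deduplicate⁺; ∈-deduplicate⁻; ∈-applyUpTo⁺; ∈-applyUpTo⁻)
  open import Data.List.Relation.Unary.Unique.Propositional using (Unique)
  import Data.List.Relation.Unary.Unique.Propositional.Properties as Unique
  import Data.List.Relation.Unary.Unique.DecPropositional.Properties as DecUnique
  open import Data.Product using (Σ; ∃; _×_; _,_; proj₁; proj₂)
  open import Data.Empty using (⊥-elim)
  open import Relation.Nullary using (¬_; yes; no)
  open import Relation.Unary using (Decidable)
  open import Relation.Binary.PropositionalEquality
  open ModularArithmetic m
  open ListFacts
  open NatFacts using (n<2^n)

  instance
    n≢0 : NonZero n
    n≢0 = >-nonZero 0<n

  2^n≡1+m : 2 ^ n ≡ suc m
  2^n≡1+m = trans (sym (m∸n+n≡m (m^n>0 2 n))) (trans (+-comm (2 ^ n ∸ 1) 1) (cong suc (sym m≡2^n∸1)))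

  2^[k*n]≋1 : ∀ k → 2 ^ (k * n) ≋ 1
  2^[k*n]≋1 zero    = refl
  2^[k*n]≋1 (suc k) = begin
    2 ^ (n + k * n)       ≡⟨ ^-distribˡ-+-* 2 n (k * n) ⟩
    2 ^ n * 2 ^ (k * n)   ≡⟨ cong (_* 2 ^ (k * n)) 2^n≡1+m ⟩
    suc m * 2 ^ (k * n)   ≈⟨ *-cong-≋ (+-cong-≋ {1} refl m≋0) (2^[k*n]≋1 k) ⟩
    1                     ∎
    where open ≋-Reasoning

  φ-*n : ∀ k a → φ (k * n) a ≡ a
  φ-*n k a = trans (φ-cong-≋ {k * n} {0} a (2^[k*n]≋1 k)) (φ-zero a)

  φ-n : ∀ a → φ n a ≡ a
  φ-n a = trans (cong (λ e → φ e a) (sym (*-identityˡ n))) (φ-*n 1 a)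

  φ-%n : ∀ p a → φ p a ≡ φ (p % n) a
  φ-%n p a = begin
    φ p a                         ≡⟨ cong (λ e → φ e a) (m≡m%n+[m/n]*n p n) ⟩
    φ (p % n + p / n * n) a       ≡⟨ φ-φ (p % n) (p / n * n) a ⟨
    φ (p % n) (φ (p / n * n) a)   ≡⟨ cong (φ (p % n)) (φ-*n (p / n) a) ⟩
    φ (p % n) a                   ∎
    where open ≡-Reasoning

  inverse-exponent : ℕ → ℕ
  inverse-exponent p = p * n ∸ p

  φ-inverseˡ : ∀ p a → φ (inverse-exponent p) (φ p a) ≡ a
  φ-inverseˡ p a = begin
    φ (p * n ∸ p) (φ p a)   ≡⟨ φ-φ (p * n ∸ p) p a ⟩
    φ (p * n ∸ p + p) a     ≡⟨ cong (λ e → φ e a) (m∸n+n≡m (m≤m*n p n)) ⟩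
    φ (p * n) a             ≡⟨ φ-*n p a ⟩
    a                       ∎
    where open ≡-Reasoning

  φ-inverseʳ : ∀ p a → φ p (φ (inverse-exponent p) a) ≡ a
  φ-inverseʳ p a = begin
    φ p (φ (p * n ∸ p) a)   ≡⟨ φ-φ p (p * n ∸ p) a ⟩
    φ (p + (p * n ∸ p)) a   ≡⟨ cong (λ e → φ e a) (m+[n∸m]≡n (m≤m*n p n)) ⟩
    φ (p * n) a             ≡⟨ φ-*n p a ⟩
    a                       ∎
    where open ≡-Reasoning

  φ-injective : ∀ p {a b} → φ p a ≡ φ p b → a ≡ b
  φ-injective p {a} {b} eq = trans (sym (φ-inverseˡ p a)) (trans (cong (φ (inverse-exponent p)) eq) (φ-inverseˡ p b))

  φ-nonzero : ∀ p {a} → Nonzero a → Nonzero (φ p a)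
  φ-nonzero p a≢0 = ≢0ₘ⇒Nonzero λ φa≡0ₘ → Nonzero⇒≢0ₘ a≢0 (φ-injective p (trans φa≡0ₘ (sym (φ-0ₘ p))))

  ⊕-self≡0ₘ⇒≡0ₘ : ∀ {a} → a ⊕ a ≡ 0ₘ → a ≡ 0ₘ
  ⊕-self≡0ₘ⇒≡0ₘ {a} a⊕a≡0ₘ = φ-injective 1 (trans (sym (⊕-self a)) (trans a⊕a≡0ₘ (sym (φ-0ₘ 1))))

  private
    4^j≡1+3w : ∀ j → ∃ λ w → 4 ^ j ≡ 1 + 3 * w
    4^j≡1+3w zero = 0 , refl
    4^j≡1+3w (suc j) with 4^j≡1+3w j
    ... | w , eq = 1 + 4 * w , trans (cong (4 *_) eq) (4[1+3w]≡1+3[1+4w] w)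
      where
      4[1+3w]≡1+3[1+4w] : ∀ w → 4 * (1 + 3 * w) ≡ 1 + 3 * (1 + 4 * w)
      4[1+3w]≡1+3[1+4w] = solve-∀

  -- For odd n the inverse of 3 modulo m is w = (2ⁿ⁺¹ − 1)/3, as 3w = 2m + 1.
  ⊕-triple≡0ₘ⇒≡0ₘ : ∀ q → n ≡ 1 + 2 * q → ∀ {a} → a ⊕ a ⊕ a ≡ 0ₘ → a ≡ 0ₘ
  ⊕-triple≡0ₘ⇒≡0ₘ q n≡1+2q {a} 3a≡0ₘ = ≋⇒≡ (begin
    toℕ a                       ≡⟨ *-identityˡ (toℕ a) ⟨
    1 * toℕ a                   ≈⟨ *-cong-≋ 3w≋1 refl ⟨
    3 * w * toℕ a               ≡⟨ cong (_* toℕ a) (*-comm 3 w) ⟩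
    w * 3 * toℕ a               ≡⟨ *-assoc w 3 (toℕ a) ⟩
    w * (3 * toℕ a)             ≈⟨ *-cong-≋ {w} refl toℕ-3a ⟨
    w * toℕ (a ⊕ a ⊕ a)         ≡⟨ cong (λ z → w * toℕ z) 3a≡0ₘ ⟩
    w * toℕ 0ₘ                  ≡⟨ cong (w *_) toℕ-0ₘ ⟩
    w * 0                       ≡⟨ *-zeroʳ w ⟩
    0                           ≡⟨ toℕ-0ₘ ⟨
    toℕ 0ₘ                      ∎)
    where
    open ≋-Reasoning
    w = proj₁ (4^j≡1+3w (1 + q))
    4^[1+q]≡2[1+m] : 4 ^ (1 + q) ≡ 2 * suc m
    4^[1+q]≡2[1+m] = trans (^-*-assoc 2 2 (1 + q))
      (trans (cong (2 ^_) (trans (*-distribˡ-+ 2 1 q) (cong suc (sym n≡1+2q)))) (cong (2 *_) 2^n≡1+m))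
    3w≋1 : 3 * w ≋ 1
    3w≋1 = begin
      3 * w          ≡⟨ suc-injective (trans (sym (proj₂ (4^j≡1+3w (1 + q)))) (trans 4^[1+q]≡2[1+m] (2[1+m]≡2+2m m))) ⟩
      1 + 2 * m      ≈⟨ +-cong-≋ {1} refl (*-cong-≋ {2} refl m≋0) ⟩
      1              ∎
      where
      2[1+m]≡2+2m : ∀ m → 2 * suc m ≡ suc (1 + 2 * m)
      2[1+m]≡2+2m = solve-∀
    toℕ-3a : toℕ (a ⊕ a ⊕ a) ≋ 3 * toℕ a
    toℕ-3a = begin
      toℕ (a ⊕ a ⊕ a)         ≈⟨ toℕ-⊕ (a ⊕ a) a ⟩
      toℕ (a ⊕ a) + toℕ a     ≈⟨ +-cong-≋ (toℕ-⊕ a a) refl ⟩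
      toℕ a + toℕ a + toℕ a   ≡⟨ x+x+x≡3x (toℕ a) ⟩
      3 * toℕ a               ∎
      where
      x+x+x≡3x : ∀ x → x + x + x ≡ 3 * x
      x+x+x≡3x = solve-∀

  n≤m : n ≤ m
  n≤m = subst (n ≤_) (sym m≡2^n∸1) (<⇒≤pred (n<2^n n))

  -- CList and size agree definitionally with ZM.CList and ZM.size, which do not use the Zech logarithm.
  CList : Fin m → List (Fin m)
  CList k = map (λ i → φ i k) (upTo m)

  size : Fin m → ℕ
  size k = length (deduplicate _≟F_ (CList k))

  ∈-CList⁻ : ∀ {y r} → y ∈ CList r → ∃ λ p → y ≡ φ p r
  ∈-CList⁻ {r = r} y∈ with ∈-map⁻ (λ i → φ i r) y∈
  ... | p , _ , y≡ = p , y≡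

  ∈-CList⁺ : ∀ p r → φ p r ∈ CList r
  ∈-CList⁺ p r = subst (_∈ CList r) (sym (φ-%n p r))
    (∈-map⁺ (λ i → φ i r) (∈-upTo⁺ (<-≤-trans (m%n<n p n) n≤m)))

  private
    search-least : (Q : ℕ → Set) → Decidable Q → ∀ N → Q N →
                   Σ ℕ λ p → Q p × p ≤ N × (∀ j → j < p → ¬ Q j)
    search-least Q Q? N QN with Q? 0
    ... | yes Q0 = 0 , Q0 , z≤n , λ _ ()
    search-least Q Q? zero    QN | no ¬Q0 = ⊥-elim (¬Q0 QN)
    search-least Q Q? (suc N) QN | no ¬Q0 with search-least (λ k → Q (suc k)) (λ k → Q? (suc k)) N QN
    ... | p , Qp , p≤N , minimal = suc p , Qp , s≤s p≤N , minimal′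
      where
      minimal′ : ∀ j → j < suc p → ¬ Q j
      minimal′ zero    _         = ¬Q0
      minimal′ (suc j) (s≤s j<p) = minimal j j<p

  module _ (y : Fin m) where

    private
      least-period = search-least (λ k → φ (suc k) y ≡ y) (λ k → φ (suc k) y ≟F y) (n ∸ 1)
        (subst (λ e → φ e y ≡ y) (sym (suc-pred n)) (φ-n y))

    period : ℕ
    period = suc (proj₁ least-period)

    instance
      period≢0 : NonZero period
      period≢0 = _

    φ-period : φ period y ≡ y
    φ-period = proj₁ (proj₂ least-period)

    period-minimal : ∀ j → 0 < j → j < period → φ j y ≢ y
    period-minimal (suc j) _ (s≤s j<p) = proj₂ (proj₂ (proj₂ least-period)) j j<p

    φ-*period : ∀ k → φ (k * period) y ≡ y
    φ-*period zero    = φ-zero y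
    φ-*period (suc k) = trans (sym (φ-φ period (k * period) y)) (trans (cong (φ period) (φ-*period k)) φ-period)

    φ-%period : ∀ e → φ e y ≡ φ (e % period) y
    φ-%period e = begin
      φ e y                                     ≡⟨ cong (λ d → φ d y) (m≡m%n+[m/n]*n e period) ⟩
      φ (e % period + e / period * period) y    ≡⟨ φ-φ (e % period) (e / period * period) y ⟨
      φ (e % period) (φ (e / period * period) y) ≡⟨ cong (φ (e % period)) (φ-*period (e / period)) ⟩
      φ (e % period) y                          ∎
      where open ≡-Reasoning

    φ-fixed⇒period∣ : ∀ e → φ e y ≡ y → period ∣ e
    φ-fixed⇒period∣ e φey≡y with e % period in eq
    ... | zero  = m%n≡0⇒n∣m e period eq
    ... | suc r = ⊥-elim (period-minimal (suc r) (s≤s z≤n) (subst (_< period) eq (m%n<n e period))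
                    (trans (cong (λ d → φ d y) (sym eq)) (trans (sym (φ-%period e)) φey≡y)))

    private
      orbit : List (Fin m)
      orbit = applyUpTo (λ i → φ i y) period

      orbit-unique : Unique orbit
      orbit-unique = Unique.applyUpTo⁺₁ (λ i → φ i y) period distinct
        where
        distinct : ∀ {i j} → i < j → j < period → φ i y ≢ φ j y
        distinct {i} {j} i<j j<p φiy≡φjy = period-minimal (j ∸ i) (m<n⇒0<n∸m i<j) (≤-<-trans (m∸n≤m j i) j<p)
          (φ-injective i (trans (φ-φ i (j ∸ i) y) (trans (cong (λ d → φ d y) (m+[n∸m]≡n (<⇒≤ i<j))) (sym φiy≡φjy))))

      CList⊆orbit : ∀ {z} → z ∈ CList y → z ∈ orbit
      CList⊆orbit z∈ with ∈-CList⁻ z∈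
      ... | i , refl = subst (_∈ orbit) (sym (φ-%period i)) (∈-applyUpTo⁺ (λ i → φ i y) (m%n<n i period))

      orbit⊆CList : ∀ {z} → z ∈ orbit → z ∈ CList y
      orbit⊆CList z∈ with ∈-applyUpTo⁻ (λ i → φ i y) z∈
      ... | i , _ , refl = ∈-CList⁺ i y

    size≡period : size y ≡ period
    size≡period = trans
      (Unique-⊆⊇⇒length≡ (DecUnique.deduplicate-! _≟F_ (CList y)) orbit-unique
        (λ z∈ → CList⊆orbit (∈-deduplicate⁻ _≟F_ (CList y) z∈))
        (λ z∈ → ∈-deduplicate⁺ _≟F_ (orbit⊆CList z∈)))
      (length-applyUpTo (λ i → φ i y) period)

  φ-fixed⇒size∣ : ∀ y e → φ e y ≡ y → size y ∣ e
  φ-fixed⇒size∣ y e φey≡y = subst (_∣ e) (sym (size≡period y)) (φ-fixed⇒period∣ y e φey≡y)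

  size∣⇒φ-fixed : ∀ y e → size y ∣ e → φ e y ≡ y
  size∣⇒φ-fixed y e size∣e =
    subst (λ d → φ d y ≡ y) (sym (_∣_.equality period∣e)) (φ-*period y (_∣_.quotient period∣e))
    where period∣e = subst (_∣ e) (size≡period y) size∣e

  size∣n : ∀ y → size y ∣ n
  size∣n y = φ-fixed⇒size∣ y n (φ-n y)

  size-0ₘ≤1 : size 0ₘ ≤ 1
  size-0ₘ≤1 = ∣⇒≤ (φ-fixed⇒size∣ 0ₘ 1 (φ-0ₘ 1))

  1<size : ∀ y → y ≢ 0ₘ → 1 < size y
  1<size y y≢0ₘ = subst (1 <_) (sym (size≡period y)) (≤∧≢⇒< (s≤s z≤n) period≢1)
    where
    period≢1 : 1 ≢ period y
    period≢1 1≡period = y≢0ₘ (⊕-cancelˡ y y 0ₘ (begin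
      y ⊕ y     ≡⟨ ⊕-self y ⟩
      φ 1 y     ≡⟨ subst (λ d → φ d y ≡ y) (sym 1≡period) (φ-period y) ⟩
      y         ≡⟨ ⊕-identityʳ y ⟨
      y ⊕ 0ₘ    ∎))
      where open ≡-Reasoning

  φ-fixed-transfer : ∀ {x y} d → size x ≡ size y → φ d x ≡ x → φ d y ≡ y
  φ-fixed-transfer {x} {y} d sx≡sy φdx≡x = size∣⇒φ-fixed y d (subst (_∣ d) sx≡sy (φ-fixed⇒size∣ x d φdx≡x))

module RingLemmas {c ℓ} (R : CommutativeRing c ℓ) where

  open import Data.Nat as ℕ using (ℕ; zero; suc)
  import Data.Nat.Properties as ℕ
  open import Data.Fin using (toℕ)
  open import Data.Product using (_×_; _,_; proj₁; proj₂)
  open import Data.Empty using (⊥-elim)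
  open import Relation.Nullary using (¬_)
  open import Data.Sum using (inj₁; inj₂)
  open import Relation.Binary.PropositionalEquality as ≡ using (_≡_)
  open import Defs
  import Tactic.RingSolver.Core.AlmostCommutativeRing as ACR
  open import Data.Maybe using (nothing)

  open CommutativeRing R
  open FieldDefs R using (pow; Span; SameSub; Indep2)
  open import Relation.Binary.Reasoning.Setoid setoid
  open import Algebra.Properties.Semiring.Sum semiring public using (sum; sum-cong-≋; ∑-distrib-+; *-distribˡ-sum; sum-replicate)
  open import Algebra.Properties.Semiring.Mult semiring public using (×-homo-+) renaming (_×_ to _·_)
  open import Tactic.RingSolver.NonReflective (ACR.fromCommutativeRing R (λ _ → nothing)) public
    using (solve; _⊜_) renaming (_⊕_ to _:+_; _⊗_ to _:*_)

  pow-cong : ∀ {x y} k → x ≈ y → pow x k ≈ pow y k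
  pow-cong zero    _   = refl
  pow-cong (suc k) x≈y = *-cong x≈y (pow-cong k x≈y)

  pow-+ : ∀ x i j → pow x (i ℕ.+ j) ≈ pow x i * pow x j
  pow-+ x zero    j = sym (*-identityˡ _)
  pow-+ x (suc i) j = trans (*-cong refl (pow-+ x i j)) (sym (*-assoc _ _ _))

  pow-* : ∀ x i j → pow x (i ℕ.* j) ≈ pow (pow x j) i
  pow-* x zero    j = refl
  pow-* x (suc i) j = trans (pow-+ x j (i ℕ.* j)) (*-cong refl (pow-* x i j))

  pow-1# : ∀ k → pow 1# k ≈ 1#
  pow-1# zero    = refl
  pow-1# (suc k) = trans (*-identityˡ _) (pow-1# k)

  pow-0# : ∀ {k} → 0 ℕ.< k → pow 0# k ≈ 0#
  pow-0# {suc k} _ = zeroˡ _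

  x+y≈x⇒y≈0 : ∀ {x y} → x + y ≈ x → y ≈ 0#
  x+y≈x⇒y≈0 {x} {y} x+y≈x = begin
    y              ≈⟨ +-identityˡ y ⟨
    0# + y         ≈⟨ +-cong (-‿inverseˡ x) refl ⟨
    (- x + x) + y  ≈⟨ +-assoc _ _ _ ⟩
    - x + (x + y)  ≈⟨ +-cong refl x+y≈x ⟩
    - x + x        ≈⟨ -‿inverseˡ x ⟩
    0#             ∎

  span-resp : ∀ {u w x u′ w′ x′} → u ≈ u′ → w ≈ w′ → x ≈ x′ → Span u w x → Span u′ w′ x′
  span-resp _   _   x≈x′ (inj₁ x≈0)                = inj₁ (trans (sym x≈x′) x≈0)
  span-resp u≈u′ _   x≈x′ (inj₂ (inj₁ x≈u))        = inj₂ (inj₁ (trans (sym x≈x′) (trans x≈u u≈u′)))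
  span-resp _   w≈w′ x≈x′ (inj₂ (inj₂ (inj₁ x≈w))) = inj₂ (inj₂ (inj₁ (trans (sym x≈x′) (trans x≈w w≈w′))))
  span-resp u≈u′ w≈w′ x≈x′ (inj₂ (inj₂ (inj₂ x≈u+w))) =
    inj₂ (inj₂ (inj₂ (trans (sym x≈x′) (trans x≈u+w (+-cong u≈u′ w≈w′)))))

  span-scale : ∀ s {u w x} → Span u w x → Span (s * u) (s * w) (s * x)
  span-scale s (inj₁ x≈0)                 = inj₁ (trans (*-cong refl x≈0) (zeroʳ s))
  span-scale s (inj₂ (inj₁ x≈u))          = inj₂ (inj₁ (*-cong refl x≈u))
  span-scale s (inj₂ (inj₂ (inj₁ x≈w)))   = inj₂ (inj₂ (inj₁ (*-cong refl x≈w)))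
  span-scale s (inj₂ (inj₂ (inj₂ x≈u+w))) = inj₂ (inj₂ (inj₂ (trans (*-cong refl x≈u+w) (distribˡ s _ _))))

  sameSub-≈ : ∀ {u w u′ w′} → u ≈ u′ → w ≈ w′ → SameSub (u , w) (u′ , w′)
  sameSub-≈ u≈u′ w≈w′ x = span-resp u≈u′ w≈w′ refl , span-resp (sym u≈u′) (sym w≈w′) refl

  sameSub-sym : ∀ {u w u′ w′} → SameSub (u , w) (u′ , w′) → SameSub (u′ , w′) (u , w)
  sameSub-sym same x = let (to , from) = same x in from , to

  sameSub-trans : ∀ {u w u′ w′ u″ w″} → SameSub (u , w) (u′ , w′) → SameSub (u′ , w′) (u″ , w″) →
                  SameSub (u , w) (u″ , w″)
  sameSub-trans same₁ same₂ x =
    let (to₁ , from₁) = same₁ x ; (to₂ , from₂) = same₂ x in (λ s → to₂ (to₁ s)) , (λ s → from₁ (from₂ s))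

  module Characteristic2 (1+1≈0 : 1# + 1# ≈ 0#) where

    x+x≈0 : ∀ x → x + x ≈ 0#
    x+x≈0 x = begin
      x + x              ≈⟨ +-cong (*-identityʳ x) (*-identityʳ x) ⟨
      x * 1# + x * 1#    ≈⟨ distribˡ x 1# 1# ⟨
      x * (1# + 1#)      ≈⟨ *-cong refl 1+1≈0 ⟩
      x * 0#             ≈⟨ zeroʳ x ⟩
      0#                 ∎

    x+[x+y]≈y : ∀ x y → x + (x + y) ≈ y
    x+[x+y]≈y x y = trans (sym (+-assoc x x y)) (trans (+-cong (x+x≈0 x) refl) (+-identityˡ y))

    [x+y]+y≈x : ∀ x y → (x + y) + y ≈ x
    [x+y]+y≈x x y = trans (+-assoc x y y) (trans (+-cong refl (x+x≈0 y)) (+-identityʳ x))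

    x+y≈z⇒x≈y+z : ∀ {x y z} → x + y ≈ z → x ≈ y + z
    x+y≈z⇒x≈y+z {x} {y} {z} x+y≈z = begin
      x              ≈⟨ [x+y]+y≈x x y ⟨
      (x + y) + y    ≈⟨ +-comm _ _ ⟩
      y + (x + y)    ≈⟨ +-cong refl x+y≈z ⟩
      y + z          ∎

    x+y≈0⇒x≈y : ∀ {x y} → x + y ≈ 0# → x ≈ y
    x+y≈0⇒x≈y x+y≈0 = trans (x+y≈z⇒x≈y+z x+y≈0) (+-identityʳ _)

    x≈y⇒x+y≈0 : ∀ {x y} → x ≈ y → x + y ≈ 0#
    x≈y⇒x+y≈0 {x} {y} x≈y = trans (+-cong x≈y refl) (x+x≈0 y)

    [1+2k]·1#≈1# : ∀ k → (1 ℕ.+ 2 ℕ.* k) · 1# ≈ 1#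
    [1+2k]·1#≈1# k = begin
      1# + (k ℕ.+ (k ℕ.+ 0)) · 1#    ≡⟨ ≡.cong (λ j → 1# + (k ℕ.+ j) · 1#) (ℕ.+-identityʳ k) ⟩
      1# + (k ℕ.+ k) · 1#            ≈⟨ +-cong refl (×-homo-+ 1# k k) ⟩
      1# + (k · 1# + k · 1#)         ≈⟨ +-cong refl (x+x≈0 (k · 1#)) ⟩
      1# + 0#                        ≈⟨ +-identityʳ 1# ⟩
      1#                             ∎

    frob : ℕ → Carrier → Carrier
    frob p x = pow x (2 ℕ.^ p)

    private
      [x+y]²≈x²+y² : ∀ x y → (x + y) * (x + y) ≈ x * x + y * y
      [x+y]²≈x²+y² x y = begin
        (x + y) * (x + y)                  ≈⟨ solve 2 (λ x y → ((x :+ y) :* (x :+ y)) ⊜ ((x :* x :+ y :* y) :+ (x :* y :+ x :* y))) refl x y ⟩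
        (x * x + y * y) + (x * y + x * y)  ≈⟨ +-cong refl (x+x≈0 (x * y)) ⟩
        (x * x + y * y) + 0#               ≈⟨ +-identityʳ _ ⟩
        x * x + y * y                      ∎

      frob-suc : ∀ p x → frob (suc p) x ≈ frob p x * frob p x
      frob-suc p x = trans (reflexive (≡.cong (pow x) (≡.cong (2 ℕ.^ p ℕ.+_) (ℕ.+-identityʳ (2 ℕ.^ p)))))
                           (pow-+ x (2 ℕ.^ p) (2 ℕ.^ p))

    frob-+ : ∀ p x y → frob p (x + y) ≈ frob p x + frob p y
    frob-+ zero    x y = distribʳ 1# x y
    frob-+ (suc p) x y = begin
      frob (suc p) (x + y)                              ≈⟨ frob-suc p (x + y) ⟩
      frob p (x + y) * frob p (x + y)                   ≈⟨ *-cong (frob-+ p x y) (frob-+ p x y) ⟩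
      (frob p x + frob p y) * (frob p x + frob p y)     ≈⟨ [x+y]²≈x²+y² _ _ ⟩
      frob p x * frob p x + frob p y * frob p y         ≈⟨ +-cong (frob-suc p x) (frob-suc p y) ⟨
      frob (suc p) x + frob (suc p) y                   ∎

    telescope : ∀ N (g : ℕ → Carrier) → sum {N} (λ i → g (suc (toℕ i)) + g (toℕ i)) ≈ g N + g 0
    telescope zero    g = sym (x+x≈0 (g 0))
    telescope (suc N) g = begin
      (g 1 + g 0) + sum {N} (λ i → g (suc (suc (toℕ i))) + g (suc (toℕ i)))  ≈⟨ +-cong refl (telescope N (λ j → g (suc j))) ⟩
      (g 1 + g 0) + (g (suc N) + g 1)  ≈⟨ solve 3 (λ a b z → ((a :+ z) :+ (b :+ a)) ⊜ ((b :+ z) :+ (a :+ a))) refl (g 1) (g (suc N)) (g 0) ⟩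
      (g (suc N) + g 0) + (g 1 + g 1)  ≈⟨ +-cong refl (x+x≈0 (g 1)) ⟩
      (g (suc N) + g 0) + 0#           ≈⟨ +-identityʳ _ ⟩
      g (suc N) + g 0                  ∎

    span-+ : ∀ {u w x y} → Span u w x → Span u w y → Span u w (x + y)
    span-+ (inj₁ x≈0) s = span-resp refl refl (trans (sym (+-identityˡ _)) (+-cong (sym x≈0) refl)) s
    span-+ s (inj₁ y≈0) = span-resp refl refl (trans (sym (+-identityʳ _)) (+-cong refl (sym y≈0))) s
    span-+ (inj₂ (inj₁ x≈u))          (inj₂ (inj₁ y≈u))          = inj₁ (trans (+-cong x≈u y≈u) (x+x≈0 _))
    span-+ (inj₂ (inj₁ x≈u))          (inj₂ (inj₂ (inj₁ y≈w)))   = inj₂ (inj₂ (inj₂ (+-cong x≈u y≈w)))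
    span-+ (inj₂ (inj₁ x≈u))          (inj₂ (inj₂ (inj₂ y≈u+w))) = inj₂ (inj₂ (inj₁ (trans (+-cong x≈u y≈u+w) (x+[x+y]≈y _ _))))
    span-+ (inj₂ (inj₂ (inj₁ x≈w)))   (inj₂ (inj₁ y≈u))          = inj₂ (inj₂ (inj₂ (trans (+-cong x≈w y≈u) (+-comm _ _))))
    span-+ (inj₂ (inj₂ (inj₁ x≈w)))   (inj₂ (inj₂ (inj₁ y≈w)))   = inj₁ (trans (+-cong x≈w y≈w) (x+x≈0 _))
    span-+ (inj₂ (inj₂ (inj₁ x≈w)))   (inj₂ (inj₂ (inj₂ y≈u+w))) =
      inj₂ (inj₁ (trans (+-cong x≈w (trans y≈u+w (+-comm _ _))) (x+[x+y]≈y _ _)))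
    span-+ (inj₂ (inj₂ (inj₂ x≈u+w))) (inj₂ (inj₁ y≈u))          =
      inj₂ (inj₂ (inj₁ (trans (+-cong (trans x≈u+w (+-comm _ _)) y≈u) ([x+y]+y≈x _ _))))
    span-+ (inj₂ (inj₂ (inj₂ x≈u+w))) (inj₂ (inj₂ (inj₁ y≈w)))   = inj₂ (inj₁ (trans (+-cong x≈u+w y≈w) ([x+y]+y≈x _ _)))
    span-+ (inj₂ (inj₂ (inj₂ x≈u+w))) (inj₂ (inj₂ (inj₂ y≈u+w))) = inj₁ (trans (+-cong x≈u+w y≈u+w) (x+x≈0 _))

    sameSub-from-spans : ∀ {u w u′ w′} → Span u w u′ → Span u w w′ → Span u′ w′ u → Span u′ w′ w →
                         SameSub (u , w) (u′ , w′)
    sameSub-from-spans u′∈ w′∈ u∈ w∈ x = to u∈ w∈ , to u′∈ w′∈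
      where
      to : ∀ {u w u′ w′} → Span u′ w′ u → Span u′ w′ w → Span u w x → Span u′ w′ x
      to _  _  (inj₁ x≈0)                 = inj₁ x≈0
      to u∈ _  (inj₂ (inj₁ x≈u))          = span-resp refl refl (sym x≈u) u∈
      to _  w∈ (inj₂ (inj₂ (inj₁ x≈w)))   = span-resp refl refl (sym x≈w) w∈
      to u∈ w∈ (inj₂ (inj₂ (inj₂ x≈u+w))) = span-resp refl refl (sym x≈u+w) (span-+ u∈ w∈)

    -- ⟨u, w⟩ has only three nonzero vectors, and two distinct ones among them have the third as their sum.
    sameSub-from-⊆ : ∀ {u w u′ w′} → Indep2 u′ w′ → Span u w u′ → Span u w w′ → SameSub (u , w) (u′ , w′)
    sameSub-from-⊆ {u} {w} {u′} {w′} (u′≉0 , w′≉0 , u′+w′≉0) u′∈ w′∈ = sameSub-from-spans u′∈ w′∈ (proj₁ spans) (proj₂ spans)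
      where
      spanned : ∀ {u w u′ w′} → ¬ (u′ ≈ 0#) → ¬ (w′ ≈ 0#) → ¬ (u′ + w′ ≈ 0#) →
                Span u w u′ → Span u w w′ → Span u′ w′ u × Span u′ w′ w
      spanned u′≉0 _ _ (inj₁ u′≈0) _ = ⊥-elim (u′≉0 u′≈0)
      spanned _ w′≉0 _ _ (inj₁ w′≈0) = ⊥-elim (w′≉0 w′≈0)
      spanned _ _ ≉0 (inj₂ (inj₁ u′≈u)) (inj₂ (inj₁ w′≈u)) = ⊥-elim (≉0 (x≈y⇒x+y≈0 (trans u′≈u (sym w′≈u))))
      spanned _ _ _ (inj₂ (inj₁ u′≈u)) (inj₂ (inj₂ (inj₁ w′≈w))) =
        inj₂ (inj₁ (sym u′≈u)) , inj₂ (inj₂ (inj₁ (sym w′≈w)))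
      spanned _ _ _ (inj₂ (inj₁ u′≈u)) (inj₂ (inj₂ (inj₂ w′≈u+w))) =
        inj₂ (inj₁ (sym u′≈u)) , inj₂ (inj₂ (inj₂ (trans (sym (x+[x+y]≈y _ _)) (+-cong (sym u′≈u) (sym w′≈u+w)))))
      spanned _ _ _ (inj₂ (inj₂ (inj₁ u′≈w))) (inj₂ (inj₁ w′≈u)) =
        inj₂ (inj₂ (inj₁ (sym w′≈u))) , inj₂ (inj₁ (sym u′≈w))
      spanned _ _ ≉0 (inj₂ (inj₂ (inj₁ u′≈w))) (inj₂ (inj₂ (inj₁ w′≈w))) = ⊥-elim (≉0 (x≈y⇒x+y≈0 (trans u′≈w (sym w′≈w))))
      spanned _ _ _ (inj₂ (inj₂ (inj₁ u′≈w))) (inj₂ (inj₂ (inj₂ w′≈u+w))) =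
        inj₂ (inj₂ (inj₂ (trans (sym ([x+y]+y≈x _ _)) (trans (+-comm _ _) (+-cong (sym u′≈w) (sym w′≈u+w))))))
        , inj₂ (inj₁ (sym u′≈w))
      spanned _ _ _ (inj₂ (inj₂ (inj₂ u′≈u+w))) (inj₂ (inj₁ w′≈u)) =
        inj₂ (inj₂ (inj₁ (sym w′≈u)))
        , inj₂ (inj₂ (inj₂ (trans (sym (x+[x+y]≈y _ _)) (trans (+-comm _ _) (+-cong (sym u′≈u+w) (sym w′≈u))))))
      spanned _ _ _ (inj₂ (inj₂ (inj₂ u′≈u+w))) (inj₂ (inj₂ (inj₁ w′≈w))) =
        inj₂ (inj₂ (inj₂ (trans (sym ([x+y]+y≈x _ _)) (+-cong (sym u′≈u+w) (sym w′≈w)))))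
        , inj₂ (inj₂ (inj₁ (sym w′≈w)))
      spanned _ _ ≉0 (inj₂ (inj₂ (inj₂ u′≈u+w))) (inj₂ (inj₂ (inj₂ w′≈u+w))) =
        ⊥-elim (≉0 (x≈y⇒x+y≈0 (trans u′≈u+w (sym w′≈u+w))))
      spans : Span u′ w′ u × Span u′ w′ w
      spans = spanned u′≉0 w′≉0 u′+w′≉0 u′∈ w′∈

module PrimitiveField {c ℓ} (R : CommutativeRing c ℓ) (ξ : CommutativeRing.Carrier R)
  (n : ℕ) (F : FieldDefs.IsPrimitiveField R n ξ)
  (m : ℕ) .{{m≢0 : NonZero m}} (m≡2^n∸1 : m ≡ 2 ^ n ∸ 1)
  (Z : Fin m → Fin m) (isZech : FieldDefs.IsZech R m ξ Z) where

  open import Data.Nat as ℕ using (zero; suc; _<_; _%_; _/_)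
  import Data.Nat.Properties as ℕ
  open import Data.Nat.DivMod using (m≡m%n+[m/n]*n; m%n<n; m<n⇒m%n≡m)
  open import Data.Fin using (toℕ; fromℕ<)
  open import Data.Fin.Properties using (toℕ-fromℕ<)
  open import Data.Product using (Σ; _,_)
  open import Data.Sum using (inj₁; inj₂)
  open import Data.Empty using (⊥-elim)
  open import Relation.Nullary using (¬_; yes; no)
  import Relation.Binary.PropositionalEquality as ≡

  open CommutativeRing R
  open FieldDefs R using (pow)
  open FieldDefs.IsPrimitiveField F public using (decEq)
  open FieldDefs.IsPrimitiveField F using (nontrivial; order; injective; surjective)
  open RingLemmas R public
  open ModularArithmetic m
  open import Relation.Binary.Reasoning.Setoid setoid

  ξ^m≈1 : pow ξ m ≈ 1#
  ξ^m≈1 = ≡.subst (λ k → pow ξ k ≈ 1#) (≡.sym m≡2^n∸1) order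

  ξ^i≈ξ^[i%m] : ∀ i → pow ξ i ≈ pow ξ (i % m)
  ξ^i≈ξ^[i%m] i = begin
    pow ξ i                                 ≡⟨ ≡.cong (pow ξ) (m≡m%n+[m/n]*n i m) ⟩
    pow ξ (i % m ℕ.+ i / m ℕ.* m)           ≈⟨ pow-+ ξ (i % m) _ ⟩
    pow ξ (i % m) * pow ξ (i / m ℕ.* m)     ≈⟨ *-cong refl (pow-* ξ (i / m) m) ⟩
    pow ξ (i % m) * pow (pow ξ m) (i / m)   ≈⟨ *-cong refl (trans (pow-cong (i / m) ξ^m≈1) (pow-1# (i / m))) ⟩
    pow ξ (i % m) * 1#                      ≈⟨ *-identityʳ _ ⟩
    pow ξ (i % m)                           ∎

  pow-ξ-cong-≋ : ∀ {i j} → i ≋ j → pow ξ i ≈ pow ξ j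
  pow-ξ-cong-≋ {i} {j} i≋j = trans (ξ^i≈ξ^[i%m] i) (trans (reflexive (≡.cong (pow ξ) i≋j)) (sym (ξ^i≈ξ^[i%m] j)))

  pow-ξ-injective-≋ : ∀ {i j} → pow ξ i ≈ pow ξ j → i ≋ j
  pow-ξ-injective-≋ {i} {j} ξ^i≈ξ^j = injective (i % m) (j % m) (<2^n∸1 (m%n<n i m)) (<2^n∸1 (m%n<n j m))
    (trans (sym (ξ^i≈ξ^[i%m] i)) (trans ξ^i≈ξ^j (ξ^i≈ξ^[i%m] j)))
    where
    <2^n∸1 : ∀ {k} → k < m → k < 2 ^ n ∸ 1
    <2^n∸1 = ≡.subst (_ <_) m≡2^n∸1

  e : Fin m → Carrier
  e a = pow ξ (toℕ a)

  e-injective : ∀ {a b} → e a ≈ e b → a ≡ b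
  e-injective ea≈eb = ≋⇒≡ (pow-ξ-injective-≋ ea≈eb)

  e-cong : ∀ {a b} → a ≡ b → e a ≈ e b
  e-cong ≡.refl = refl

  e-⊕ : ∀ a b → e (a ⊕ b) ≈ e a * e b
  e-⊕ a b = trans (pow-ξ-cong-≋ (toℕ-⊕ a b)) (pow-+ ξ (toℕ a) (toℕ b))

  e-0ₘ : e 0ₘ ≈ 1#
  e-0ₘ = reflexive (≡.cong (pow ξ) toℕ-0ₘ)

  e-⊖ : ∀ a → e (⊖ a) * e a ≈ 1#
  e-⊖ a = trans (sym (e-⊕ (⊖ a) a)) (trans (e-cong (⊖-inverseˡ a)) e-0ₘ)

  e-φ : ∀ p a → e (φ p a) ≈ pow (e a) (2 ^ p)
  e-φ p a = trans (pow-ξ-cong-≋ (toℕ-φ p a)) (pow-* ξ (2 ^ p) (toℕ a))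

  1≉0 : ¬ (1# ≈ 0#)
  1≉0 1≈0 = nontrivial (sym 1≈0)

  e≉0 : ∀ a → ¬ (e a ≈ 0#)
  e≉0 a ea≈0 = 1≉0 (trans (sym (e-⊖ a)) (trans (*-cong refl ea≈0) (zeroʳ _)))

  log : ∀ x → ¬ (x ≈ 0#) → Σ (Fin m) λ a → x ≈ e a
  log x x≉0 with surjective x
  ... | inj₁ x≈0 = ⊥-elim (x≉0 x≈0)
  ... | inj₂ (k , k<2^n∸1 , x≈ξ^k) =
    fromℕ< k<m , trans x≈ξ^k (reflexive (≡.cong (pow ξ) (≡.sym (toℕ-fromℕ< k<m))))
    where
    k<m : k < m
    k<m = ≡.subst (k <_) (≡.sym m≡2^n∸1) k<2^n∸1

  zech : ∀ k → Nonzero k → 1# + e k ≈ e (Z k)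
  zech = isZech

  -- −1 = ξᵏ for some k; k ≠ 0 is impossible since then 1 + ξᵏ = 0 would be a power of ξ.
  1+1≈0 : 1# + 1# ≈ 0#
  1+1≈0 with log (- 1#) -1≉0
    where
    -1≉0 : ¬ (- 1# ≈ 0#)
    -1≉0 -1≈0 = 1≉0 (begin
      1#          ≈⟨ +-identityʳ 1# ⟨
      1# + 0#     ≈⟨ +-cong refl -1≈0 ⟨
      1# + - 1#   ≈⟨ -‿inverseʳ 1# ⟩
      0#          ∎)
  ... | k , -1≈ek with toℕ k ℕ.≟ 0
  ...   | yes k≡0 = trans (+-cong refl (trans (reflexive (≡.cong (pow ξ) (≡.sym k≡0))) (sym -1≈ek))) (-‿inverseʳ 1#)
  ...   | no k≢0  = ⊥-elim (e≉0 (Z k) (trans (sym (zech k k≢0)) (trans (+-cong refl (sym -1≈ek)) (-‿inverseʳ 1#))))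

  open Characteristic2 1+1≈0 public

  0<n : 0 < n
  0<n = positive n m≡2^n∸1
    where
    positive : ∀ k → m ≡ 2 ^ k ∸ 1 → 0 < k
    positive zero    m≡0 = ⊥-elim (ℕ.<⇒≢ 0<m (≡.sym m≡0))
    positive (suc _) _   = ℕ.s≤s ℕ.z≤n

  open CyclotomicClasses n m m≡2^n∸1 0<n using (φ-nonzero)

  Z-nonzero : ∀ {k} → Nonzero k → Nonzero (Z k)
  Z-nonzero {k} k≢0 Zk≡0 = e≉0 k (x+y≈x⇒y≈0 (trans (zech k k≢0) (reflexive (≡.cong (pow ξ) Zk≡0))))

  Z-involutive : ∀ {k} → Nonzero k → Z (Z k) ≡ k
  Z-involutive {k} k≢0 = e-injective (begin
    e (Z (Z k))          ≈⟨ zech (Z k) (Z-nonzero k≢0) ⟨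
    1# + e (Z k)         ≈⟨ +-cong refl (zech k k≢0) ⟨
    1# + (1# + e k)      ≈⟨ x+[x+y]≈y 1# (e k) ⟩
    e k                  ∎)

  Z-injective : ∀ {a b} → Nonzero a → Nonzero b → Z a ≡ Z b → a ≡ b
  Z-injective a≢0 b≢0 Za≡Zb = ≡.trans (≡.sym (Z-involutive a≢0)) (≡.trans (≡.cong Z Za≡Zb) (Z-involutive b≢0))

  -- 1 + ξ⁻ᵏ = ξ⁻ᵏ (1 + ξᵏ)
  Z-⊖ : ∀ {k} → Nonzero k → Z (⊖ k) ≡ Z k ⊕ ⊖ k
  Z-⊖ {k} k≢0 = e-injective (begin
    e (Z (⊖ k))                  ≈⟨ zech (⊖ k) (⊖-nonzero k≢0) ⟨
    1# + e (⊖ k)                 ≈⟨ +-cong (trans (sym (e-⊖ k)) (*-comm _ _)) (sym (*-identityˡ _)) ⟩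
    e k * e (⊖ k) + 1# * e (⊖ k) ≈⟨ distribʳ (e (⊖ k)) (e k) 1# ⟨
    (e k + 1#) * e (⊖ k)         ≈⟨ *-cong (trans (+-comm _ _) (zech k k≢0)) refl ⟩
    e (Z k) * e (⊖ k)            ≈⟨ e-⊕ (Z k) (⊖ k) ⟨
    e (Z k ⊕ ⊖ k)                ∎)

  -- the Frobenius map x ↦ x^(2^p) fixes 1 and is additive
  Z-φ : ∀ p {k} → Nonzero k → Z (φ p k) ≡ φ p (Z k)
  Z-φ p {k} k≢0 = e-injective (begin
    e (Z (φ p k))                ≈⟨ zech (φ p k) (φ-nonzero p k≢0) ⟨
    1# + e (φ p k)               ≈⟨ +-cong (sym (pow-1# (2 ^ p))) (e-φ p k) ⟩
    frob p 1# + frob p (e k)     ≈⟨ frob-+ p 1# (e k) ⟨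
    frob p (1# + e k)            ≈⟨ pow-cong (2 ^ p) (zech k k≢0) ⟩
    frob p (e (Z k))             ≈⟨ e-φ p (Z k) ⟨
    e (φ p (Z k))                ∎)

  e-+ : ∀ a {x} → Nonzero x → e a + e (a ⊕ x) ≈ e (a ⊕ Z x)
  e-+ a {x} x≢0 = begin
    e a + e (a ⊕ x)          ≈⟨ +-cong (sym (*-identityʳ (e a))) (e-⊕ a x) ⟩
    e a * 1# + e a * e x     ≈⟨ distribˡ (e a) 1# (e x) ⟨
    e a * (1# + e x)         ≈⟨ *-cong refl (zech x x≢0) ⟩
    e a * e (Z x)            ≈⟨ e-⊕ a (Z x) ⟨
    e (a ⊕ Z x)              ∎

  *-cancelˡ-≉0 : ∀ {x y} → ¬ (x ≈ 0#) → x * y ≈ 0# → y ≈ 0#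
  *-cancelˡ-≉0 {x} {y} x≉0 xy≈0 with log x x≉0
  ... | k , x≈ek = begin
    y                      ≈⟨ *-identityˡ y ⟨
    1# * y                 ≈⟨ *-cong (e-⊖ k) refl ⟨
    (e (⊖ k) * e k) * y    ≈⟨ *-assoc _ _ _ ⟩
    e (⊖ k) * (e k * y)    ≈⟨ *-cong refl (*-cong x≈ek refl) ⟨
    e (⊖ k) * (x * y)      ≈⟨ *-cong refl xy≈0 ⟩
    e (⊖ k) * 0#           ≈⟨ zeroʳ _ ⟩
    0#                     ∎

  -- (w + 1) ∑ wⁱ telescopes to wᵐ + 1 = 0
  ∑-geometric : ∀ w → pow w m ≈ 1# → ¬ (w ≈ 1#) → sum {m} (λ i → pow w (toℕ i)) ≈ 0#
  ∑-geometric w wᵐ≈1 w≉1 = *-cancelˡ-≉0 w+1≉0 (begin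
    (w + 1#) * sum {m} (λ i → pow w (toℕ i))              ≈⟨ *-distribˡ-sum {m} (w + 1#) (λ i → pow w (toℕ i)) ⟩
    sum {m} (λ i → (w + 1#) * pow w (toℕ i))              ≈⟨ sum-cong-≋ {m} (λ i → trans (distribʳ _ w 1#) (+-cong refl (*-identityˡ _))) ⟩
    sum {m} (λ i → pow w (suc (toℕ i)) + pow w (toℕ i))   ≈⟨ telescope m (pow w) ⟩
    pow w m + 1#                                          ≈⟨ +-cong wᵐ≈1 refl ⟩
    1# + 1#                                               ≈⟨ 1+1≈0 ⟩
    0#                                                    ∎)
    where
    w+1≉0 : ¬ (w + 1# ≈ 0#)
    w+1≉0 w+1≈0 = w≉1 (x+y≈0⇒x≈y w+1≈0)

  ∑ξ^[ik]≈0 : ∀ k → 0 < k → k < m → sum {m} (λ i → pow ξ (toℕ i ℕ.* k)) ≈ 0#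
  ∑ξ^[ik]≈0 k 0<k k<m = trans (sum-cong-≋ {m} (λ i → pow-* ξ (toℕ i) k)) (∑-geometric (pow ξ k) ξᵏ^m≈1 ξᵏ≉1)
    where
    ξᵏ^m≈1 : pow (pow ξ k) m ≈ 1#
    ξᵏ^m≈1 = begin
      pow (pow ξ k) m    ≈⟨ pow-* ξ m k ⟨
      pow ξ (m ℕ.* k)    ≡⟨ ≡.cong (pow ξ) (ℕ.*-comm m k) ⟩
      pow ξ (k ℕ.* m)    ≈⟨ pow-* ξ k m ⟩
      pow (pow ξ m) k    ≈⟨ pow-cong k ξ^m≈1 ⟩
      pow 1# k           ≈⟨ pow-1# k ⟩
      1#                 ∎
    ξᵏ≉1 : ¬ (pow ξ k ≈ 1#)
    ξᵏ≉1 ξᵏ≈1 = ℕ.<⇒≢ 0<k (≡.sym (≡.trans (≡.sym (m<n⇒m%n≡m k<m)) (≡.trans (pow-ξ-injective-≋ ξᵏ≈1) (m<n⇒m%n≡m 0<m))))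

module ZechOrbits {c ℓ} (R : CommutativeRing c ℓ) (ξ : CommutativeRing.Carrier R)
  (n : ℕ) (F : FieldDefs.IsPrimitiveField R n ξ)
  (m : ℕ) .{{m≢0 : NonZero m}} (m≡2^n∸1 : m ≡ 2 ^ n ∸ 1)
  (Z : Fin m → Fin m) (isZech : FieldDefs.IsZech R m ξ Z)
  (q : ℕ) (n≡1+2q : n ≡ 1 ℕ.+ 2 ℕ.* q) where

  import Data.Nat.Properties as ℕ
  open import Data.List using (List; []; _∷_)
  open import Data.List.Membership.Propositional using (_∈_)
  open import Data.List.Relation.Unary.Any using (here; there)
  open import Data.List.Relation.Unary.All using (_∷_; [])
  open import Data.List.Relation.Unary.AllPairs using (_∷_; [])
  open import Data.List.Relation.Unary.Unique.Propositional using (Unique)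
  open import Relation.Nullary using (¬_)
  open import Data.Product using (∃; _×_; _,_)
  open import Data.Nat.Divisibility using (_∣_; divides; ∣-trans; n∣m*n; *-monoˡ-∣)
  open import Relation.Binary.PropositionalEquality as ≡ using (_≢_)

  open ModularArithmetic m
  open PrimitiveField R ξ n F m m≡2^n∸1 Z isZech public
  open CyclotomicClasses n m m≡2^n∸1 0<n public
  open CommutativeRing R
  open FieldDefs R using (pow)
  open ZM m Z using (ΓList)
  import Relation.Binary.Reasoning.Setoid as SetoidReasoning
  private
    module ≈-Reasoning = SetoidReasoning setoid

  -- For odd n, 3 ∤ 2ⁿ − 1, so there is no element of multiplicative order 3.
  ¬x²≈1+x : ∀ {k} → Nonzero k → ¬ (e k * e k ≈ 1# + e k)
  ¬x²≈1+x {k} k≢0 x²≈1+x = Nonzero⇒≢0ₘ k≢0 (⊕-triple≡0ₘ⇒≡0ₘ q n≡1+2q (e-injective (begin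
    e (k ⊕ k ⊕ k)           ≈⟨ e-⊕ (k ⊕ k) k ⟩
    e (k ⊕ k) * e k         ≈⟨ *-cong (e-⊕ k k) refl ⟩
    (e k * e k) * e k       ≈⟨ *-cong x²≈1+x refl ⟩
    (1# + e k) * e k        ≈⟨ distribʳ (e k) 1# (e k) ⟩
    1# * e k + e k * e k    ≈⟨ +-cong (*-identityˡ (e k)) x²≈1+x ⟩
    e k + (1# + e k)        ≈⟨ trans (+-comm _ _) ([x+y]+y≈x 1# (e k)) ⟩
    1#                      ≈⟨ e-0ₘ ⟨
    e 0ₘ                    ∎)))
    where open ≈-Reasoning

  Z≢id : ∀ {k} → Nonzero k → Z k ≢ k
  Z≢id {k} k≢0 Zk≡k = 1≉0 (x+y≈x⇒y≈0 (trans (+-comm (e k) 1#) (trans (zech k k≢0) (e-cong Zk≡k))))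

  ⊖≢id : ∀ {k} → Nonzero k → ⊖ k ≢ k
  ⊖≢id {k} k≢0 ⊖k≡k = Nonzero⇒≢0ₘ k≢0 (⊕-self≡0ₘ⇒≡0ₘ (≡.trans (≡.cong (_⊕ k) (≡.sym ⊖k≡k)) (⊖-inverseˡ k)))

  Z≢φ1 : ∀ {k} → Nonzero k → Z k ≢ φ 1 k
  Z≢φ1 {k} k≢0 Zk≡φ1k = ¬x²≈1+x k≢0 (begin
    e k * e k         ≈⟨ *-cong refl (*-identityʳ (e k)) ⟨
    pow (e k) 2       ≈⟨ e-φ 1 k ⟨
    e (φ 1 k)         ≈⟨ e-cong Zk≡φ1k ⟨
    e (Z k)           ≈⟨ zech k k≢0 ⟨
    1# + e k          ∎)
    where open ≈-Reasoning

  Z≢⊖ : ∀ {k} → Nonzero k → Z k ≢ ⊖ k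
  Z≢⊖ {k} k≢0 Zk≡⊖k = ¬x²≈1+x k≢0 (trans (x+y≈z⇒x≈y+z x²+x≈1) (+-comm _ _))
    where
    x²+x≈1 : e k * e k + e k ≈ 1#
    x²+x≈1 = begin
      e k * e k + e k          ≈⟨ +-cong refl (*-identityˡ (e k)) ⟨
      e k * e k + 1# * e k     ≈⟨ distribʳ (e k) (e k) 1# ⟨
      (e k + 1#) * e k         ≈⟨ *-cong (trans (+-comm _ _) (zech k k≢0)) refl ⟩
      e (Z k) * e k            ≈⟨ *-cong (e-cong Zk≡⊖k) refl ⟩
      e (⊖ k) * e k            ≈⟨ e-⊖ k ⟩
      1#                       ∎
      where open ≈-Reasoning

  Z⊕Z≢id : ∀ {k} → Nonzero k → Z k ⊕ Z k ≢ k
  Z⊕Z≢id {k} k≢0 2Zk≡k = Z≢φ1 (Z-nonzero k≢0) (≡.trans (Z-involutive k≢0) (≡.trans (≡.sym 2Zk≡k) (⊕-self (Z k))))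

  private
    2y⊖k≡0⇒2y≡k : ∀ {y k} → y ⊕ y ⊕ ⊖ k ≡ 0ₘ → y ⊕ y ≡ k
    2y⊖k≡0⇒2y≡k {y} {k} eq = ≡.trans (⊖-unique _ _ eq) (⊖-involutive k)

    y≡⊖[y⊖k]⇒2y≡k : ∀ {y k} → y ≡ ⊖ (y ⊕ ⊖ k) → y ⊕ y ≡ k
    y≡⊖[y⊖k]⇒2y≡k {y} {k} eq = 2y⊖k≡0⇒2y≡k {y} (≡.trans (⊕-assoc y y (⊖ k))
      (≡.trans (≡.cong (_⊕ (y ⊕ ⊖ k)) eq) (⊖-inverseˡ _)))

    y⊖k≡⊖y⇒2y≡k : ∀ {y k} → y ⊕ ⊖ k ≡ ⊖ y → y ⊕ y ≡ k
    y⊖k≡⊖y⇒2y≡k {y} {k} eq = 2y⊖k≡0⇒2y≡k {y} (≡.trans (⊕-assoc y y (⊖ k)) (≡.trans (≡.cong (y ⊕_) (⊕-comm y (⊖ k)))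
      (≡.trans (≡.sym (⊕-assoc y (⊖ k) y)) (≡.trans (≡.cong (_⊕ y) eq) (⊖-inverseˡ y)))))

  Γ-unique : ∀ {k} → Nonzero k → Unique (ΓList k)
  Γ-unique {k} k≢0 =
      (γ₀≢γ₁ ∷ γ₀≢γ₂ ∷ γ₀≢γ₃ ∷ γ₀≢γ₄ ∷ γ₀≢γ₅ ∷ [])
    ∷ (γ₁≢γ₂ ∷ γ₁≢γ₃ ∷ γ₁≢γ₄ ∷ γ₁≢γ₅ ∷ [])
    ∷ (γ₂≢γ₃ ∷ γ₂≢γ₄ ∷ γ₂≢γ₅ ∷ [])
    ∷ (γ₃≢γ₄ ∷ γ₃≢γ₅ ∷ [])
    ∷ (γ₄≢γ₅ ∷ [])
    ∷ [] ∷ []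
    where
    ⊖k≢0 : Nonzero (⊖ k)
    ⊖k≢0 = ⊖-nonzero k≢0
    γ₀≢γ₁ : k ≢ Z k
    γ₀≢γ₁ eq = Z≢id k≢0 (≡.sym eq)
    γ₀≢γ₂ : k ≢ Z (⊖ k)
    γ₀≢γ₂ eq = Z≢⊖ k≢0 (≡.trans (≡.cong Z eq) (Z-involutive ⊖k≢0))
    γ₀≢γ₃ : k ≢ ⊖ Z (⊖ k)
    γ₀≢γ₃ eq = Z≢id ⊖k≢0 (≡.sym (≡.trans (≡.cong ⊖_ eq) (⊖-involutive _)))
    γ₀≢γ₄ : k ≢ ⊖ Z k
    γ₀≢γ₄ eq = Z≢⊖ k≢0 (≡.sym (≡.trans (≡.cong ⊖_ eq) (⊖-involutive _)))
    γ₀≢γ₅ : k ≢ ⊖ k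
    γ₀≢γ₅ eq = ⊖≢id k≢0 (≡.sym eq)
    γ₁≢γ₂ : Z k ≢ Z (⊖ k)
    γ₁≢γ₂ eq = ⊖≢id k≢0 (≡.sym (Z-injective k≢0 ⊖k≢0 eq))
    γ₁≢γ₃ : Z k ≢ ⊖ Z (⊖ k)
    γ₁≢γ₃ eq = Z⊕Z≢id k≢0 (y≡⊖[y⊖k]⇒2y≡k (≡.trans eq (≡.cong ⊖_ (Z-⊖ k≢0))))
    γ₁≢γ₄ : Z k ≢ ⊖ Z k
    γ₁≢γ₄ eq = ⊖≢id (Z-nonzero k≢0) (≡.sym eq)
    γ₁≢γ₅ : Z k ≢ ⊖ k
    γ₁≢γ₅ = Z≢⊖ k≢0
    γ₂≢γ₃ : Z (⊖ k) ≢ ⊖ Z (⊖ k)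
    γ₂≢γ₃ eq = ⊖≢id (Z-nonzero ⊖k≢0) (≡.sym eq)
    γ₂≢γ₄ : Z (⊖ k) ≢ ⊖ Z k
    γ₂≢γ₄ eq = Z⊕Z≢id k≢0 (y⊖k≡⊖y⇒2y≡k (≡.trans (≡.sym (Z-⊖ k≢0)) eq))
    γ₂≢γ₅ : Z (⊖ k) ≢ ⊖ k
    γ₂≢γ₅ = Z≢id ⊖k≢0
    γ₃≢γ₄ : ⊖ Z (⊖ k) ≢ ⊖ Z k
    γ₃≢γ₄ eq = γ₁≢γ₂ (≡.sym (⊖-injective eq))
    γ₃≢γ₅ : ⊖ Z (⊖ k) ≢ ⊖ k
    γ₃≢γ₅ eq = γ₀≢γ₂ (≡.sym (⊖-injective eq))
    γ₄≢γ₅ : ⊖ Z k ≢ ⊖ k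
    γ₄≢γ₅ eq = Z≢id k≢0 (⊖-injective eq)

  pattern γ₀ p = here p
  pattern γ₁ p = there (here p)
  pattern γ₂ p = there (there (here p))
  pattern γ₃ p = there (there (there (here p)))
  pattern γ₄ p = there (there (there (there (here p))))
  pattern γ₅ p = there (there (there (there (there (here p)))))

  Γ-nonzero : ∀ {X y} → Nonzero X → y ∈ ΓList X → Nonzero y
  Γ-nonzero X≢0 (γ₀ ≡.refl) = X≢0
  Γ-nonzero X≢0 (γ₁ ≡.refl) = Z-nonzero X≢0
  Γ-nonzero X≢0 (γ₂ ≡.refl) = Z-nonzero (⊖-nonzero X≢0)
  Γ-nonzero X≢0 (γ₃ ≡.refl) = ⊖-nonzero (Z-nonzero (⊖-nonzero X≢0))
  Γ-nonzero X≢0 (γ₄ ≡.refl) = ⊖-nonzero (Z-nonzero X≢0)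
  Γ-nonzero X≢0 (γ₅ ≡.refl) = ⊖-nonzero X≢0

  -- (Z ∘ ⊖)³ = id
  Z⊖Z≡⊖Z⊖ : ∀ {w} → Nonzero w → Z (⊖ Z w) ≡ ⊖ Z (⊖ w)
  Z⊖Z≡⊖Z⊖ {w} w≢0 = begin
    Z (⊖ Z w)               ≡⟨ Z-⊖ (Z-nonzero w≢0) ⟩
    Z (Z w) ⊕ ⊖ Z w         ≡⟨ ≡.cong (_⊕ ⊖ Z w) (Z-involutive w≢0) ⟩
    w ⊕ ⊖ Z w               ≡⟨ ⊕-comm w _ ⟩
    ⊖ Z w ⊕ w               ≡⟨ ≡.cong (⊖ Z w ⊕_) (⊖-involutive w) ⟨
    ⊖ Z w ⊕ ⊖ ⊖ w           ≡⟨ ⊖-⊕-distrib (Z w) (⊖ w) ⟩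
    ⊖ (Z w ⊕ ⊖ w)           ≡⟨ ≡.cong ⊖_ (Z-⊖ w≢0) ⟨
    ⊖ Z (⊖ w)               ∎
    where open ≡.≡-Reasoning

  Γ-self : ∀ X → X ∈ ΓList X
  Γ-self X = γ₀ ≡.refl

  Γ-⊖-closed : ∀ {X y} → y ∈ ΓList X → ⊖ y ∈ ΓList X
  Γ-⊖-closed (γ₀ ≡.refl) = γ₅ ≡.refl
  Γ-⊖-closed (γ₁ ≡.refl) = γ₄ ≡.refl
  Γ-⊖-closed (γ₂ ≡.refl) = γ₃ ≡.refl
  Γ-⊖-closed (γ₃ ≡.refl) = γ₂ (⊖-involutive _)
  Γ-⊖-closed (γ₄ ≡.refl) = γ₁ (⊖-involutive _)
  Γ-⊖-closed (γ₅ ≡.refl) = γ₀ (⊖-involutive _)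

  Γ-Z-closed : ∀ {X y} → Nonzero X → y ∈ ΓList X → Z y ∈ ΓList X
  Γ-Z-closed X≢0 (γ₀ ≡.refl) = γ₁ ≡.refl
  Γ-Z-closed X≢0 (γ₁ ≡.refl) = γ₀ (Z-involutive X≢0)
  Γ-Z-closed X≢0 (γ₂ ≡.refl) = γ₅ (Z-involutive (⊖-nonzero X≢0))
  Γ-Z-closed {X} X≢0 (γ₃ ≡.refl) =
    γ₄ (≡.trans (Z⊖Z≡⊖Z⊖ (⊖-nonzero X≢0)) (≡.cong (λ w → ⊖ Z w) (⊖-involutive X)))
  Γ-Z-closed X≢0 (γ₄ ≡.refl) = γ₃ (Z⊖Z≡⊖Z⊖ X≢0)
  Γ-Z-closed X≢0 (γ₅ ≡.refl) = γ₂ ≡.refl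

  Γ-trans : ∀ {X y z} → Nonzero X → y ∈ ΓList X → z ∈ ΓList y → z ∈ ΓList X
  Γ-trans X≢0 y∈ (γ₀ ≡.refl) = y∈
  Γ-trans X≢0 y∈ (γ₁ ≡.refl) = Γ-Z-closed X≢0 y∈
  Γ-trans X≢0 y∈ (γ₂ ≡.refl) = Γ-Z-closed X≢0 (Γ-⊖-closed y∈)
  Γ-trans X≢0 y∈ (γ₃ ≡.refl) = Γ-⊖-closed (Γ-Z-closed X≢0 (Γ-⊖-closed y∈))
  Γ-trans X≢0 y∈ (γ₄ ≡.refl) = Γ-⊖-closed (Γ-Z-closed X≢0 y∈)
  Γ-trans X≢0 y∈ (γ₅ ≡.refl) = Γ-⊖-closed y∈

  Γ-sym : ∀ {X y} → Nonzero X → y ∈ ΓList X → X ∈ ΓList y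
  Γ-sym X≢0 (γ₀ ≡.refl) = γ₀ ≡.refl
  Γ-sym X≢0 (γ₁ ≡.refl) = γ₁ (≡.sym (Z-involutive X≢0))
  Γ-sym {X} X≢0 (γ₂ ≡.refl) = γ₄ (≡.sym (≡.trans (≡.cong ⊖_ (Z-involutive (⊖-nonzero X≢0))) (⊖-involutive X)))
  Γ-sym {X} X≢0 (γ₃ ≡.refl) = γ₃ (≡.sym (≡.trans (≡.cong (λ w → ⊖ Z w) (⊖-involutive _))
    (≡.trans (≡.cong ⊖_ (Z-involutive (⊖-nonzero X≢0))) (⊖-involutive X))))
  Γ-sym X≢0 (γ₄ ≡.refl) = γ₂ (≡.sym (≡.trans (≡.cong Z (⊖-involutive _)) (Z-involutive X≢0)))
  Γ-sym {X} X≢0 (γ₅ ≡.refl) = γ₅ (≡.sym (⊖-involutive X))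

  φ-Z : ∀ p {k} → Nonzero k → φ p (Z k) ≡ Z (φ p k)
  φ-Z p k≢0 = ≡.sym (Z-φ p k≢0)

  Γ-φ : ∀ p {X y} → Nonzero X → y ∈ ΓList X → φ p y ∈ ΓList (φ p X)
  Γ-φ p X≢0 (γ₀ ≡.refl) = γ₀ ≡.refl
  Γ-φ p X≢0 (γ₁ ≡.refl) = γ₁ (φ-Z p X≢0)
  Γ-φ p {X} X≢0 (γ₂ ≡.refl) = γ₂ (≡.trans (φ-Z p (⊖-nonzero X≢0)) (≡.cong Z (φ-⊖ p X)))
  Γ-φ p {X} X≢0 (γ₃ ≡.refl) = γ₃ (≡.trans (φ-⊖ p _)
    (≡.cong ⊖_ (≡.trans (φ-Z p (⊖-nonzero X≢0)) (≡.cong Z (φ-⊖ p X)))))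
  Γ-φ p X≢0 (γ₄ ≡.refl) = γ₄ (≡.trans (φ-⊖ p _) (≡.cong ⊖_ (φ-Z p X≢0)))
  Γ-φ p {X} X≢0 (γ₅ ≡.refl) = γ₅ (φ-⊖ p X)

  Γ-φ⁻¹ : ∀ p {x y} → Nonzero x → y ∈ ΓList (φ p x) → ∃ λ r → r ∈ ΓList x × y ≡ φ p r
  Γ-φ⁻¹ p {x} {y} x≢0 y∈ = φ (inverse-exponent p) y
    , ≡.subst (λ v → φ (inverse-exponent p) y ∈ ΓList v) (φ-inverseˡ p x)
        (Γ-φ (inverse-exponent p) (φ-nonzero p x≢0) y∈)
    , ≡.sym (φ-inverseʳ p y)

  private
    module Iterates (d : ℕ) (X : Fin m) where
      Zφ⊖ : ∀ {y} → Nonzero (⊖ y) → φ d (Z (⊖ y)) ≡ Z (⊖ φ d y)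
      Zφ⊖ {y} ⊖y≢0 = ≡.trans (φ-Z d ⊖y≢0) (≡.cong Z (φ-⊖ d y))
      ⊖Zφ : ∀ {y} → Nonzero y → φ d (⊖ Z y) ≡ ⊖ Z (φ d y)
      ⊖Zφ {y} y≢0 = ≡.trans (φ-⊖ d (Z y)) (≡.cong ⊖_ (φ-Z d y≢0))
      order2 : φ d (φ d X) ≡ X → size X ∣ 6 ℕ.* d
      order2 φ²X≡X = ∣-trans (φ-fixed⇒size∣ X (2 ℕ.* d) (≡.trans (≡.sym twice) φ²X≡X)) (*-monoˡ-∣ d (divides {2} {6} 3 ≡.refl))
        where
        twice : φ d (φ d X) ≡ φ (2 ℕ.* d) X
        twice = ≡.trans (φ-φ d d X) (≡.cong (λ e → φ (d ℕ.+ e) X) (≡.sym (ℕ.+-identityʳ d)))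
      order3 : φ d (φ d (φ d X)) ≡ X → size X ∣ 6 ℕ.* d
      order3 φ³X≡X = ∣-trans (φ-fixed⇒size∣ X (3 ℕ.* d) (≡.trans (≡.sym thrice) φ³X≡X)) (*-monoˡ-∣ d (divides {3} {6} 2 ≡.refl))
        where
        thrice : φ d (φ d (φ d X)) ≡ φ (3 ℕ.* d) X
        thrice = ≡.trans (≡.cong (φ d) (φ-φ d d X))
          (≡.trans (φ-φ d (d ℕ.+ d) X) (≡.cong (λ e → φ (d ℕ.+ (d ℕ.+ e)) X) (≡.sym (ℕ.+-identityʳ d))))

  -- Z and ⊖ generate a group of order 6 acting on Γ(X), and φ d commutes with it; if φ d moves X
  -- to g X then φ (k d) X = gᵏ X = X for the order k ∈ {1, 2, 3} of g.
  φ∈Γ⇒size∣6d : ∀ d {X} → Nonzero X → φ d X ∈ ΓList X → size X ∣ 6 ℕ.* d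
  φ∈Γ⇒size∣6d d {X} X≢0 (γ₀ φdX≡X) = ∣-trans (φ-fixed⇒size∣ X d φdX≡X) (n∣m*n 6)
  φ∈Γ⇒size∣6d d {X} X≢0 (γ₁ φdX≡ZX) = order2 (begin
    φ d (φ d X)        ≡⟨ ≡.cong (φ d) φdX≡ZX ⟩
    φ d (Z X)          ≡⟨ φ-Z d X≢0 ⟩
    Z (φ d X)          ≡⟨ ≡.cong Z φdX≡ZX ⟩
    Z (Z X)            ≡⟨ Z-involutive X≢0 ⟩
    X                  ∎)
    where
    open ≡.≡-Reasoning
    open Iterates d X
  φ∈Γ⇒size∣6d d {X} X≢0 (γ₂ φdX≡Z⊖X) = order3 (begin
    φ d (φ d (φ d X))          ≡⟨ ≡.cong (λ v → φ d (φ d v)) φdX≡Z⊖X ⟩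
    φ d (φ d (Z (⊖ X)))        ≡⟨ ≡.cong (φ d) (Zφ⊖ (⊖-nonzero X≢0)) ⟩
    φ d (Z (⊖ φ d X))          ≡⟨ ≡.cong (λ v → φ d (Z (⊖ v))) φdX≡Z⊖X ⟩
    φ d (Z (⊖ Z (⊖ X)))        ≡⟨ Zφ⊖ (⊖-nonzero (Z-nonzero (⊖-nonzero X≢0))) ⟩
    Z (⊖ φ d (Z (⊖ X)))        ≡⟨ ≡.cong (λ v → Z (⊖ v)) (Zφ⊖ (⊖-nonzero X≢0)) ⟩
    Z (⊖ Z (⊖ φ d X))          ≡⟨ ≡.cong (λ v → Z (⊖ Z (⊖ v))) φdX≡Z⊖X ⟩
    Z (⊖ Z (⊖ Z (⊖ X)))        ≡⟨ ≡.cong (λ v → Z (⊖ v)) (Z⊖Z≡⊖Z⊖ (⊖-nonzero X≢0)) ⟩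
    Z (⊖ ⊖ Z (⊖ ⊖ X))          ≡⟨ ≡.cong Z (⊖-involutive _) ⟩
    Z (Z (⊖ ⊖ X))              ≡⟨ Z-involutive (⊖-nonzero (⊖-nonzero X≢0)) ⟩
    ⊖ ⊖ X                      ≡⟨ ⊖-involutive X ⟩
    X                          ∎)
    where
    open ≡.≡-Reasoning
    open Iterates d X
  φ∈Γ⇒size∣6d d {X} X≢0 (γ₃ φdX≡⊖Z⊖X) = order2 (begin
    φ d (φ d X)            ≡⟨ ≡.cong (φ d) φdX≡⊖Z⊖X ⟩
    φ d (⊖ Z (⊖ X))        ≡⟨ φ-⊖ d _ ⟩
    ⊖ φ d (Z (⊖ X))        ≡⟨ ≡.cong ⊖_ (Zφ⊖ (⊖-nonzero X≢0)) ⟩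
    ⊖ Z (⊖ φ d X)          ≡⟨ ≡.cong (λ v → ⊖ Z (⊖ v)) φdX≡⊖Z⊖X ⟩
    ⊖ Z (⊖ ⊖ Z (⊖ X))      ≡⟨ ≡.cong (λ v → ⊖ Z v) (⊖-involutive _) ⟩
    ⊖ Z (Z (⊖ X))          ≡⟨ ≡.cong ⊖_ (Z-involutive (⊖-nonzero X≢0)) ⟩
    ⊖ ⊖ X                  ≡⟨ ⊖-involutive X ⟩
    X                      ∎)
    where
    open ≡.≡-Reasoning
    open Iterates d X
  φ∈Γ⇒size∣6d d {X} X≢0 (γ₄ φdX≡⊖ZX) = order3 (begin
    φ d (φ d (φ d X))          ≡⟨ ≡.cong (λ v → φ d (φ d v)) φdX≡⊖ZX ⟩
    φ d (φ d (⊖ Z X))          ≡⟨ ≡.cong (φ d) (⊖Zφ X≢0) ⟩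
    φ d (⊖ Z (φ d X))          ≡⟨ ≡.cong (λ v → φ d (⊖ Z v)) φdX≡⊖ZX ⟩
    φ d (⊖ Z (⊖ Z X))          ≡⟨ ⊖Zφ (⊖-nonzero (Z-nonzero X≢0)) ⟩
    ⊖ Z (φ d (⊖ Z X))          ≡⟨ ≡.cong (λ v → ⊖ Z v) (⊖Zφ X≢0) ⟩
    ⊖ Z (⊖ Z (φ d X))          ≡⟨ ≡.cong (λ v → ⊖ Z (⊖ Z v)) φdX≡⊖ZX ⟩
    ⊖ Z (⊖ Z (⊖ Z X))          ≡⟨ ≡.cong ⊖_ (Z⊖Z≡⊖Z⊖ (⊖-nonzero (Z-nonzero X≢0))) ⟩
    ⊖ ⊖ Z (⊖ ⊖ Z X)            ≡⟨ ⊖-involutive _ ⟩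
    Z (⊖ ⊖ Z X)                ≡⟨ ≡.cong Z (⊖-involutive _) ⟩
    Z (Z X)                    ≡⟨ Z-involutive X≢0 ⟩
    X                          ∎)
    where
    open ≡.≡-Reasoning
    open Iterates d X
  φ∈Γ⇒size∣6d d {X} X≢0 (γ₅ φdX≡⊖X) = order2 (begin
    φ d (φ d X)        ≡⟨ ≡.cong (φ d) φdX≡⊖X ⟩
    φ d (⊖ X)          ≡⟨ φ-⊖ d X ⟩
    ⊖ φ d X            ≡⟨ ≡.cong ⊖_ φdX≡⊖X ⟩
    ⊖ ⊖ X              ≡⟨ ⊖-involutive X ⟩
    X                  ∎)
    where
    open ≡.≡-Reasoning
    open Iterates d X

module FieldAutomorphisms {c ℓ} (R : CommutativeRing c ℓ) (ξ : CommutativeRing.Carrier R)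
  (n : ℕ) (F : FieldDefs.IsPrimitiveField R n ξ)
  (m : ℕ) .{{m≢0 : NonZero m}} (m≡2^n∸1 : m ≡ 2 ^ n ∸ 1)
  (Z : Fin m → Fin m) (isZech : FieldDefs.IsZech R m ξ Z) (1<m : 1 < m) where

  open import Data.Nat as ℕ using (zero; suc; _≤_; _%_; s≤s; z≤n)
  import Data.Nat.Properties as ℕ
  open import Data.Nat.DivMod using (m<n⇒m%n≡m)
  open import Data.Nat.Combinatorics using (_C_; nC1≡n; k>n⇒nCk≡0; nCk+nC[k+1]≡[n+1]C[k+1])
  open import Data.Fin using (toℕ)
  open import Data.Fin.Properties using (toℕ<n)
  open import Data.Product using (Σ; _,_; proj₁; proj₂)
  open import Data.Empty using (⊥-elim)
  open import Relation.Nullary using (¬_; yes; no)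
  import Relation.Binary.PropositionalEquality as ≡

  open CommutativeRing R
  open FieldDefs R using (pow; IsAutomorphism)
  open ModularArithmetic m
  open PrimitiveField R ξ n F m m≡2^n∸1 Z isZech
  open NatFacts using (odd-part; 2^k∸1-odd)
  open import Relation.Binary.Reasoning.Setoid setoid

  private
    1≤m : 1 ≤ m
    1≤m = 0<m

    m-odd : Σ ℕ λ k → m ≡ 1 ℕ.+ 2 ℕ.* k
    m-odd = let (k , 2^n∸1≡1+2k) = 2^k∸1-odd n 0<n in k , ≡.trans m≡2^n∸1 2^n∸1≡1+2k

  -- The discrete Fourier transform over ⟨ξ⟩ extracts the coefficient of Xʲ of a polynomial of degree < m;
  -- applied to (X + 1)ᵉ it yields the binomial coefficient.
  coefficient : ℕ → ℕ → Carrier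
  coefficient j e = sum {m} λ i → pow ξ (toℕ i ℕ.* (m ∸ j)) * pow (pow ξ (toℕ i) + 1#) e

  private
    previous : ℕ → ℕ
    previous zero    = m ∸ 1
    previous (suc j) = j

    ξ^[i[m∸j]]*ξ^i : ∀ j → j ≤ m → ∀ i → pow ξ (i ℕ.* (m ∸ j)) * pow ξ i ≈ pow ξ (i ℕ.* (m ∸ previous j))
    ξ^[i[m∸j]]*ξ^i zero _ i = begin
      pow ξ (i ℕ.* m) * pow ξ i               ≈⟨ *-cong (trans (pow-* ξ i m) (trans (pow-cong i ξ^m≈1) (pow-1# i))) refl ⟩
      1# * pow ξ i                            ≈⟨ *-identityˡ _ ⟩
      pow ξ i                                 ≡⟨ ≡.cong (pow ξ) (≡.sym (ℕ.*-identityʳ i)) ⟩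
      pow ξ (i ℕ.* 1)                         ≡⟨ ≡.cong (λ v → pow ξ (i ℕ.* v)) (≡.sym (ℕ.m∸[m∸n]≡n 1≤m)) ⟩
      pow ξ (i ℕ.* (m ∸ (m ∸ 1)))             ∎
    ξ^[i[m∸j]]*ξ^i (suc j) 1+j≤m i = begin
      pow ξ (i ℕ.* (m ∸ suc j)) * pow ξ i     ≈⟨ pow-+ ξ (i ℕ.* (m ∸ suc j)) i ⟨
      pow ξ (i ℕ.* (m ∸ suc j) ℕ.+ i)         ≡⟨ ≡.cong (pow ξ) (≡.trans (ℕ.+-comm _ i) (≡.sym (ℕ.*-suc i (m ∸ suc j)))) ⟩
      pow ξ (i ℕ.* suc (m ∸ suc j))           ≡⟨ ≡.cong (λ v → pow ξ (i ℕ.* v)) (≡.sym (ℕ.+-∸-assoc 1 1+j≤m)) ⟩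
      pow ξ (i ℕ.* (m ∸ j))                   ∎

    coefficient-suc : ∀ j → j ≤ m → ∀ e → coefficient j (suc e) ≈ coefficient (previous j) e + coefficient j e
    coefficient-suc j j≤m e = begin
      coefficient j (suc e)
        ≈⟨ sum-cong-≋ {m} (λ i → split (pow ξ (toℕ i ℕ.* (m ∸ j))) (pow ξ (toℕ i)) (pow (pow ξ (toℕ i) + 1#) e)) ⟩
      sum {m} (λ i → (pow ξ (toℕ i ℕ.* (m ∸ j)) * pow ξ (toℕ i)) * pow (pow ξ (toℕ i) + 1#) e
                     + pow ξ (toℕ i ℕ.* (m ∸ j)) * pow (pow ξ (toℕ i) + 1#) e)
        ≈⟨ ∑-distrib-+ {m} _ _ ⟩
      sum {m} (λ i → (pow ξ (toℕ i ℕ.* (m ∸ j)) * pow ξ (toℕ i)) * pow (pow ξ (toℕ i) + 1#) e) + coefficient j e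
        ≈⟨ +-cong (sum-cong-≋ {m} (λ i → *-cong (ξ^[i[m∸j]]*ξ^i j j≤m (toℕ i)) refl)) refl ⟩
      coefficient (previous j) e + coefficient j e ∎
      where
      split : ∀ a x p → a * ((x + 1#) * p) ≈ (a * x) * p + a * p
      split a x p = trans (*-cong refl (trans (distribʳ p x 1#) (+-cong refl (*-identityˡ p))))
                          (trans (distribˡ a (x * p) p) (+-cong (sym (*-assoc a x p)) refl))

  coefficient≈binomial : ∀ e → e < m → ∀ j → j < m → coefficient j e ≈ (e C j) · 1#
  coefficient≈binomial zero _ zero _ = begin
    sum {m} (λ i → pow ξ (toℕ i ℕ.* (m ∸ 0)) * 1#)
      ≈⟨ sum-cong-≋ {m} (λ i → trans (*-identityʳ _) (trans (pow-* ξ (toℕ i) m) (trans (pow-cong (toℕ i) ξ^m≈1) (pow-1# (toℕ i))))) ⟩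
    sum {m} (λ _ → 1#)      ≈⟨ sum-replicate m ⟩
    m · 1#                  ≡⟨ ≡.cong (_· 1#) (proj₂ m-odd) ⟩
    (1 ℕ.+ 2 ℕ.* proj₁ m-odd) · 1#   ≈⟨ [1+2k]·1#≈1# (proj₁ m-odd) ⟩
    1#                      ≈⟨ +-identityʳ 1# ⟨
    1 · 1#                  ∎
  coefficient≈binomial zero _ (suc j) 1+j<m = trans (sum-cong-≋ {m} (λ i → *-identityʳ _))
    (∑ξ^[ik]≈0 (m ∸ suc j) (ℕ.m<n⇒0<n∸m 1+j<m) (ℕ.∸-monoʳ-< {m} (s≤s z≤n) (ℕ.<⇒≤ 1+j<m)))
  coefficient≈binomial (suc e) 1+e<m zero _ = begin
    coefficient 0 (suc e)                           ≈⟨ coefficient-suc 0 z≤n e ⟩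
    coefficient (m ∸ 1) e + coefficient 0 e         ≈⟨ +-cong (coefficient≈binomial e e<m (m ∸ 1) (ℕ.∸-monoʳ-< {m} (s≤s z≤n) 1≤m))
                                                              (coefficient≈binomial e e<m 0 0<m) ⟩
    (e C (m ∸ 1)) · 1# + 1 · 1#                     ≡⟨ ≡.cong (λ v → v · 1# + 1 · 1#) (k>n⇒nCk≡0 e<m∸1) ⟩
    0# + 1 · 1#                                     ≈⟨ +-identityˡ _ ⟩
    1 · 1#                                          ∎
    where
    e<m : e < m
    e<m = ℕ.<-trans (ℕ.n<1+n e) 1+e<m
    e<m∸1 : e < m ∸ 1
    e<m∸1 = ℕ.<-≤-trans (ℕ.n<1+n e) (ℕ.≤-pred (ℕ.≤-trans 1+e<m (ℕ.≤-reflexive (≡.sym (ℕ.suc-pred m)))))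
  coefficient≈binomial (suc e) 1+e<m (suc j) 1+j<m = begin
    coefficient (suc j) (suc e)                     ≈⟨ coefficient-suc (suc j) (ℕ.<⇒≤ 1+j<m) e ⟩
    coefficient j e + coefficient (suc j) e         ≈⟨ +-cong (coefficient≈binomial e e<m j (ℕ.<-trans (ℕ.n<1+n j) 1+j<m))
                                                              (coefficient≈binomial e e<m (suc j) 1+j<m) ⟩
    (e C j) · 1# + (e C suc j) · 1#                 ≈⟨ ×-homo-+ 1# (e C j) (e C suc j) ⟨
    (e C j ℕ.+ e C suc j) · 1#                      ≡⟨ ≡.cong (_· 1#) (nCk+nC[k+1]≡[n+1]C[k+1] e j) ⟩
    (suc e C suc j) · 1#                            ∎
    where
    e<m : e < m
    e<m = ℕ.<-trans (ℕ.n<1+n e) 1+e<m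

  private
    frob-≈0 : ∀ r {z} → frob r z ≈ 0# → z ≈ 0#
    frob-≈0 r {z} frz≈0 with decEq z 0#
    ... | yes z≈0 = z≈0
    ... | no z≉0  = let (k , z≈ek) = log z z≉0 in
      ⊥-elim (e≉0 (φ r k) (trans (e-φ r k) (trans (pow-cong (2 ^ r) (sym z≈ek)) frz≈0)))

    frob-injective : ∀ r {x y} → frob r x ≈ frob r y → x ≈ y
    frob-injective r {x} {y} frx≈fry = x+y≈0⇒x≈y (frob-≈0 r (trans (frob-+ r x y) (x≈y⇒x+y≈0 frx≈fry)))

  -- Comparing the coefficients of X in (X + 1)ᵒ and Xᵒ + 1 for odd 1 < o < m gives o · 1 = 0.
  additive-odd-power⇒1 : ∀ k → 1 ℕ.+ 2 ℕ.* k < m →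
    (∀ y → pow (y + 1#) (1 ℕ.+ 2 ℕ.* k) ≈ pow y (1 ℕ.+ 2 ℕ.* k) + 1#) → k ≡ 0
  additive-odd-power⇒1 zero    _   _        = ≡.refl
  additive-odd-power⇒1 (suc k) o<m additive = ⊥-elim (1≉0 (begin
    1#                                     ≈⟨ [1+2k]·1#≈1# (suc k) ⟨
    o · 1#                                 ≡⟨ ≡.cong (_· 1#) (≡.sym (nC1≡n o)) ⟩
    (o C 1) · 1#                           ≈⟨ coefficient≈binomial o o<m 1 1<m ⟨
    coefficient 1 o                        ≈⟨ sum-cong-≋ {m} (λ i → summand (toℕ i)) ⟩
    sum {m} (λ i → pow ξ (toℕ i ℕ.* (o ∸ 1)) + pow ξ (toℕ i ℕ.* (m ∸ 1)))
                                           ≈⟨ ∑-distrib-+ {m} _ _ ⟩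
    sum {m} (λ i → pow ξ (toℕ i ℕ.* (o ∸ 1))) + sum {m} (λ i → pow ξ (toℕ i ℕ.* (m ∸ 1)))
                                           ≈⟨ +-cong (∑ξ^[ik]≈0 (o ∸ 1) (s≤s z≤n) (ℕ.≤-<-trans (ℕ.m∸n≤m o 1) o<m))
                                                     (∑ξ^[ik]≈0 (m ∸ 1) (ℕ.m<n⇒0<n∸m 1<m) (ℕ.∸-monoʳ-< {m} (s≤s z≤n) 1≤m)) ⟩
    0# + 0#                                ≈⟨ +-identityʳ 0# ⟩
    0#                                     ∎))
    where
    o = 1 ℕ.+ 2 ℕ.* suc k
    exponents : ∀ i → i ℕ.* (m ∸ 1) ℕ.+ o ℕ.* i ≋ i ℕ.* (o ∸ 1)
    exponents i = ≡.trans (≡.cong (_% m) rearranged) (+-cong-≋ (*m≋0 i) ≡.refl)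
      where
      rearranged : i ℕ.* (m ∸ 1) ℕ.+ o ℕ.* i ≡ i ℕ.* m ℕ.+ i ℕ.* (o ∸ 1)
      rearranged = ≡.trans (≡.cong (i ℕ.* (m ∸ 1) ℕ.+_) (≡.trans (ℕ.*-comm o i) (ℕ.*-distribˡ-+ i 1 (o ∸ 1))))
        (≡.trans (≡.sym (ℕ.+-assoc (i ℕ.* (m ∸ 1)) (i ℕ.* 1) _))
        (≡.cong (ℕ._+ i ℕ.* (o ∸ 1)) (≡.trans (≡.sym (ℕ.*-distribˡ-+ i (m ∸ 1) 1))
          (≡.cong (i ℕ.*_) (ℕ.m∸n+n≡m 1≤m)))))
    summand : ∀ i → pow ξ (i ℕ.* (m ∸ 1)) * pow (pow ξ i + 1#) o ≈ pow ξ (i ℕ.* (o ∸ 1)) + pow ξ (i ℕ.* (m ∸ 1))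
    summand i = begin
      pow ξ (i ℕ.* (m ∸ 1)) * pow (pow ξ i + 1#) o                ≈⟨ *-cong refl (additive (pow ξ i)) ⟩
      pow ξ (i ℕ.* (m ∸ 1)) * (pow (pow ξ i) o + 1#)              ≈⟨ distribˡ _ _ _ ⟩
      pow ξ (i ℕ.* (m ∸ 1)) * pow (pow ξ i) o + pow ξ (i ℕ.* (m ∸ 1)) * 1#
                                                                  ≈⟨ +-cong (*-cong refl (sym (pow-* ξ o i))) (*-identityʳ _) ⟩
      pow ξ (i ℕ.* (m ∸ 1)) * pow ξ (o ℕ.* i) + pow ξ (i ℕ.* (m ∸ 1))
                                                                  ≈⟨ +-cong (pow-+ ξ (i ℕ.* (m ∸ 1)) (o ℕ.* i)) refl ⟨
      pow ξ (i ℕ.* (m ∸ 1) ℕ.+ o ℕ.* i) + pow ξ (i ℕ.* (m ∸ 1))   ≈⟨ +-cong (pow-ξ-cong-≋ (exponents i)) refl ⟩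
      pow ξ (i ℕ.* (o ∸ 1)) + pow ξ (i ℕ.* (m ∸ 1))               ∎

  additive-power⇒2^r : ∀ E → 0 < E → E < m → (∀ y → pow (y + 1#) E ≈ pow y E + 1#) → Σ ℕ λ r → E ≡ 2 ^ r
  additive-power⇒2^r E 0<E E<m additive with odd-part E 0<E
  ... | r , k , E≡2^r[1+2k] = r , ≡.trans E≡2^r[1+2k]
        (≡.trans (≡.cong (λ j → 2 ^ r ℕ.* (1 ℕ.+ 2 ℕ.* j)) (additive-odd-power⇒1 k o<m additive-odd)) (ℕ.*-identityʳ (2 ^ r)))
    where
    o = 1 ℕ.+ 2 ℕ.* k
    o<m : o < m
    o<m = ℕ.≤-<-trans (≡.subst (o ≤_) (≡.sym E≡2^r[1+2k]) (ℕ.m≤n*m o (2 ^ r) {{ℕ.>-nonZero (ℕ.m^n>0 2 r)}})) E<m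
    yᴱ≈frob : ∀ y → pow y E ≈ frob r (pow y o)
    yᴱ≈frob y = trans (reflexive (≡.cong (pow y) E≡2^r[1+2k])) (pow-* y (2 ^ r) o)
    additive-odd : ∀ y → pow (y + 1#) o ≈ pow y o + 1#
    additive-odd y = frob-injective r (begin
      frob r (pow (y + 1#) o)          ≈⟨ yᴱ≈frob (y + 1#) ⟨
      pow (y + 1#) E                   ≈⟨ additive y ⟩
      pow y E + 1#                     ≈⟨ +-cong (yᴱ≈frob y) (sym (pow-1# (2 ^ r))) ⟩
      frob r (pow y o) + frob r 1#     ≈⟨ frob-+ r _ _ ⟨
      frob r (pow y o + 1#)            ∎)

  module _ {σ : Carrier → Carrier} (σ-aut : IsAutomorphism σ) where
    open IsAutomorphism σ-aut

    private
      σ-0# : σ 0# ≈ 0#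
      σ-0# = x+y≈x⇒y≈0 (trans (sym (+-hom 0# 0#)) (cong-σ (+-identityˡ 0#)))

      σ-pow : ∀ x k → σ (pow x k) ≈ pow (σ x) k
      σ-pow x zero    = 1-hom
      σ-pow x (suc k) = trans (*-hom x (pow x k)) (*-cong refl (σ-pow x k))

      ξ≉0 : ¬ (ξ ≈ 0#)
      ξ≉0 ξ≈0 = 1≉0 (trans (sym ξ^m≈1) (trans (pow-cong m ξ≈0) (pow-0# 0<m)))

      E : ℕ
      E = toℕ (proj₁ (log (σ ξ) λ σξ≈0 → ξ≉0 (inj (trans σξ≈0 (sym σ-0#)))))

      σξ≈ξᴱ : σ ξ ≈ pow ξ E
      σξ≈ξᴱ = proj₂ (log (σ ξ) λ σξ≈0 → ξ≉0 (inj (trans σξ≈0 (sym σ-0#))))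

      E<m : E < m
      E<m = toℕ<n _

      0<E : 0 < E
      0<E = ℕ.n≢0⇒n>0 λ E≡0 → ℕ.1+n≢0 (≡.trans (≡.sym (m<n⇒m%n≡m 1<m))
        (≡.trans (pow-ξ-injective-≋ (ξ¹≈ξ⁰ E≡0)) (m<n⇒m%n≡m 0<m)))
        where
        ξ¹≈ξ⁰ : E ≡ 0 → pow ξ 1 ≈ pow ξ 0
        ξ¹≈ξ⁰ E≡0 = trans (*-identityʳ ξ) (inj (trans σξ≈ξᴱ (trans (reflexive (≡.cong (pow ξ) E≡0)) (sym 1-hom))))

      σ≈[_]ᴱ : ∀ y → σ y ≈ pow y E
      σ≈[ y ]ᴱ with decEq y 0#
      ... | yes y≈0 = trans (cong-σ y≈0) (trans σ-0# (trans (sym (pow-0# 0<E)) (pow-cong E (sym y≈0))))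
      ... | no y≉0  = let (k , y≈ek) = log y y≉0 in begin
        σ y                          ≈⟨ cong-σ y≈ek ⟩
        σ (pow ξ (toℕ k))            ≈⟨ σ-pow ξ (toℕ k) ⟩
        pow (σ ξ) (toℕ k)            ≈⟨ pow-cong (toℕ k) σξ≈ξᴱ ⟩
        pow (pow ξ E) (toℕ k)        ≈⟨ pow-* ξ (toℕ k) E ⟨
        pow ξ (toℕ k ℕ.* E)          ≡⟨ ≡.cong (pow ξ) (ℕ.*-comm (toℕ k) E) ⟩
        pow ξ (E ℕ.* toℕ k)          ≈⟨ pow-* ξ E (toℕ k) ⟩
        pow (pow ξ (toℕ k)) E        ≈⟨ pow-cong E y≈ek ⟨
        pow y E                      ∎

    automorphism⇒frobenius : Σ ℕ λ r → σ ξ ≈ pow ξ (2 ^ r)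
    automorphism⇒frobenius =
      let (r , E≡2^r) = additive-power⇒2^r E 0<E E<m additive in r , trans σξ≈ξᴱ (reflexive (≡.cong (pow ξ) E≡2^r))
      where
      additive : ∀ y → pow (y + 1#) E ≈ pow y E + 1#
      additive y = trans (sym σ≈[ y + 1# ]ᴱ) (trans (+-hom y 1#) (+-cong σ≈[ y ]ᴱ 1-hom))

    automorphism⇒φ : Σ ℕ λ r → ∀ x → σ (e x) ≈ e (φ r x)
    automorphism⇒φ = r , λ x → begin
      σ (pow ξ (toℕ x))              ≈⟨ σ-pow ξ (toℕ x) ⟩
      pow (σ ξ) (toℕ x)              ≈⟨ pow-cong (toℕ x) σξ≈ξ^2^r ⟩
      pow (pow ξ (2 ^ r)) (toℕ x)    ≈⟨ pow-* ξ (toℕ x) (2 ^ r) ⟨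
      pow ξ (toℕ x ℕ.* 2 ^ r)        ≡⟨ ≡.cong (pow ξ) (ℕ.*-comm (toℕ x) (2 ^ r)) ⟩
      pow ξ (2 ^ r ℕ.* toℕ x)        ≈⟨ pow-* ξ (2 ^ r) (toℕ x) ⟩
      pow (e x) (2 ^ r)              ≈⟨ e-φ r x ⟨
      e (φ r x)                      ∎
      where
      r = proj₁ automorphism⇒frobenius
      σξ≈ξ^2^r : σ ξ ≈ pow ξ (2 ^ r)
      σξ≈ξ^2^r = proj₂ automorphism⇒frobenius

module GammaBlocks {c ℓ} (R : CommutativeRing c ℓ) (ξ : CommutativeRing.Carrier R)
  (n : ℕ) (F : FieldDefs.IsPrimitiveField R n ξ)
  (m : ℕ) .{{m≢0 : NonZero m}} (m≡2^n∸1 : m ≡ 2 ^ n ∸ 1)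
  (Z : Fin m → Fin m) (isZech : FieldDefs.IsZech R m ξ Z)
  (primes≡1[6] : ∀ p → Prime p → p ∣ n → p % 6 ≡ 1)
  (pairs : ZM.PairHypothesis m Z) where

  open import Data.Nat as ℕ using (suc; _<_; _/_)
  import Data.Nat.Properties as ℕ
  open import Data.Fin using (toℕ) renaming (_≟_ to _≟F_)
  open import Data.Fin.Patterns using (0F; 1F; 2F)
  open import Data.List using (List; map; filter; allFin; deduplicate; length; lookup)
  open import Data.List.Membership.Propositional using (_∈_)
  open import Data.List.Membership.Propositional.Properties
    using (∈-++⁺ˡ; ∈-++⁺ʳ; ∈-++⁻; ∈-map⁺; ∈-map⁻; ∈-filter⁺; ∈-filter⁻; ∈-allFin; ∈-deduplicate⁺; ∈-deduplicate⁻; ∈-lookup)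
  import Data.List.Relation.Unary.Any as Any
  open import Data.List.Relation.Unary.Any.Properties using (lookup-index)
  open import Data.List.Relation.Unary.Unique.Propositional using (Unique)
  import Data.List.Relation.Unary.Unique.Propositional.Properties as Unique
  import Data.List.Relation.Unary.Unique.DecPropositional.Properties as DecUnique
  open import Data.Product using (Σ; ∃; _×_; _,_; proj₁; proj₂)
  open import Data.Product.Properties using (≡-dec)
  open import Data.Sum using (inj₁; inj₂; [_,_]′)
  open import Data.Empty using (⊥; ⊥-elim)
  open import Relation.Nullary using (Dec; yes; no; ¬?)
  open import Relation.Binary.PropositionalEquality as ≡ using (_≢_; refl)

  open ModularArithmetic m
  open ListFacts
  open NatFacts using (odd-of-primes≡1[6]; divisor-coprime-to-6)
  open ZechOrbits R ξ n F m m≡2^n∸1 Z isZech (proj₁ (odd-of-primes≡1[6] primes≡1[6])) (proj₂ (odd-of-primes≡1[6] primes≡1[6])) public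
  open ZM m Z using (ΓList; CΓ; Cos; Nt; block; pieceOf; GammaPartition)

  Triple : Set
  Triple = Fin m × Fin m × Fin m

  component : Triple → Fin 3 → Fin m
  component (a , b , c) 0F = a
  component (a , b , c) 1F = b
  component (a , b , c) 2F = c

  ∈-block⁺ : ∀ T j {y} → y ∈ ΓList (component T j) → y ∈ block T
  ∈-block⁺ (a , b , c) 0F y∈ = ∈-++⁺ˡ y∈
  ∈-block⁺ (a , b , c) 1F y∈ = ∈-++⁺ʳ (ΓList a) (∈-++⁺ˡ y∈)
  ∈-block⁺ (a , b , c) 2F y∈ = ∈-++⁺ʳ (ΓList a) (∈-++⁺ʳ (ΓList b) y∈)

  ∈-block⁻ : ∀ T {y} → y ∈ block T → Σ (Fin 3) λ j → y ∈ ΓList (component T j)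
  ∈-block⁻ (a , b , c) y∈ with ∈-++⁻ (ΓList a) y∈
  ... | inj₁ y∈a = 0F , y∈a
  ... | inj₂ y∈bc with ∈-++⁻ (ΓList b) y∈bc
  ...   | inj₁ y∈b = 1F , y∈b
  ...   | inj₂ y∈c = 2F , y∈c

  block-position-unique : ∀ T → Unique (block T) → ∀ j₁ j₂ {y} →
    y ∈ ΓList (component T j₁) → y ∈ ΓList (component T j₂) → j₁ ≡ j₂
  block-position-unique (a , b , c) !abc = λ where
    0F 0F _  _  → refl
    1F 1F _  _  → refl
    2F 2F _  _  → refl
    0F 1F y₁ y₂ → ⊥-elim (Unique-++-disjoint !abc y₁ (∈-++⁺ˡ y₂))
    0F 2F y₁ y₂ → ⊥-elim (Unique-++-disjoint !abc y₁ (∈-++⁺ʳ (ΓList b) y₂))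
    1F 0F y₁ y₂ → ⊥-elim (Unique-++-disjoint !abc y₂ (∈-++⁺ˡ y₁))
    2F 0F y₁ y₂ → ⊥-elim (Unique-++-disjoint !abc y₂ (∈-++⁺ʳ (ΓList b) y₁))
    1F 2F y₁ y₂ → ⊥-elim (Unique-++-disjoint (Unique-++ʳ (ΓList a) !abc) y₁ y₂)
    2F 1F y₁ y₂ → ⊥-elim (Unique-++-disjoint (Unique-++ʳ (ΓList a) !abc) y₂ y₁)

  Γ-⊖⁻ : ∀ {x y} → Nonzero x → y ∈ ΓList (⊖ x) → y ∈ ΓList x
  Γ-⊖⁻ x≢0 y∈ = Γ-trans x≢0 (γ₅ refl) y∈

  Γ-⊖⁺ : ∀ {x y} → Nonzero x → y ∈ ΓList x → y ∈ ΓList (⊖ x)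
  Γ-⊖⁺ {x} x≢0 y∈ = Γ-trans (⊖-nonzero x≢0) (γ₅ (≡.sym (⊖-involutive x))) y∈

  φ∈CΓ : ∀ {X r} p → r ∈ ΓList X → CΓ X (φ p r)
  φ∈CΓ {r = r} p r∈ = r , r∈ , ∈-CList⁺ p r

  CΓ-self : ∀ X → CΓ X X
  CΓ-self X = ≡.subst (CΓ X) (φ-zero X) (φ∈CΓ 0 (Γ-self X))

  module SizeClass (t : ℕ) (1<t : 1 < t) where

    Index : Set
    Index = Fin (Nt t / 18)

    pair : Index → Fin m × Fin m
    pair = proj₁ (pairs t 1<t)

    piece : Index → Fin 3 → Fin m
    piece i = pieceOf (pair i)

    piece-covers : ∀ s → Cos t s → ∃ λ ij → CΓ (piece (proj₁ ij) (proj₂ ij)) s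
    piece-covers = proj₁ (proj₂ (pairs t 1<t))

    piece-within : ∀ i j s → CΓ (piece i j) s → size s ≡ t
    piece-within i j = proj₁ (proj₂ (proj₂ (pairs t 1<t))) (i , j)

    piece-disjoint : ∀ i j i′ j′ s → CΓ (piece i j) s → CΓ (piece i′ j′) s → (i , j) ≡ (i′ , j′)
    piece-disjoint i j i′ j′ = proj₂ (proj₂ (proj₂ (pairs t 1<t))) (i , j) (i′ , j′)

    size-piece : ∀ i j → size (piece i j) ≡ t
    size-piece i j = piece-within i j _ (CΓ-self (piece i j))

    piece-nonzero : ∀ i j → Nonzero (piece i j)
    piece-nonzero i j = ≢0ₘ⇒Nonzero λ piece≡0ₘ → ℕ.<⇒≱ 1<t
      (≡.subst (ℕ._≤ 1) (≡.trans (≡.cong size (≡.sym piece≡0ₘ)) (size-piece i j)) size-0ₘ≤1)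

    triple : Index → ℕ → Triple
    triple i p = φ p (piece i 0F) , φ p (piece i 1F) , φ p (⊖ piece i 2F)

    ∈Γ-component⁻ : ∀ i p j {y} → y ∈ ΓList (component (triple i p) j) → ∃ λ r → r ∈ ΓList (piece i j) × y ≡ φ p r
    ∈Γ-component⁻ i p 0F y∈ = Γ-φ⁻¹ p (piece-nonzero i 0F) y∈
    ∈Γ-component⁻ i p 1F y∈ = Γ-φ⁻¹ p (piece-nonzero i 1F) y∈
    ∈Γ-component⁻ i p 2F y∈ = Γ-φ⁻¹ p c≢0
      (Γ-⊖⁻ (φ-nonzero p c≢0) (≡.subst (λ v → _ ∈ ΓList v) (φ-⊖ p _) y∈))
      where c≢0 = piece-nonzero i 2F

    ∈Γ-component⁺ : ∀ i p j {r} → r ∈ ΓList (piece i j) → φ p r ∈ ΓList (component (triple i p) j)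
    ∈Γ-component⁺ i p 0F r∈ = Γ-φ p (piece-nonzero i 0F) r∈
    ∈Γ-component⁺ i p 1F r∈ = Γ-φ p (piece-nonzero i 1F) r∈
    ∈Γ-component⁺ i p 2F r∈ = ≡.subst (λ v → _ ∈ ΓList v) (≡.sym (φ-⊖ p _))
      (Γ-⊖⁺ (φ-nonzero p c≢0) (Γ-φ p c≢0 r∈))
      where c≢0 = piece-nonzero i 2F

    ∈-triple⁻ : ∀ i p {y} → y ∈ block (triple i p) → Σ (Fin 3) λ j → ∃ λ r → r ∈ ΓList (piece i j) × y ≡ φ p r
    ∈-triple⁻ i p y∈ = let (j , y∈Γ) = ∈-block⁻ (triple i p) y∈ in j , ∈Γ-component⁻ i p j y∈Γ

    ∈-triple⁺ : ∀ i p j {r} → r ∈ ΓList (piece i j) → φ p r ∈ block (triple i p)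
    ∈-triple⁺ i p j r∈ = ∈-block⁺ (triple i p) j (∈Γ-component⁺ i p j r∈)

    ∈-triple⇒CΓ : ∀ i p {y} → y ∈ block (triple i p) → Σ (Fin 3) λ j → CΓ (piece i j) y
    ∈-triple⇒CΓ i p y∈ with ∈-triple⁻ i p y∈
    ... | j , r , r∈ , refl = j , φ∈CΓ p r∈

    ∈-triple⇒size : ∀ i p {y} → y ∈ block (triple i p) → size y ≡ t
    ∈-triple⇒size i p y∈ = let (j , y∈CΓ) = ∈-triple⇒CΓ i p y∈ in piece-within i j _ y∈CΓ

    ∈-triple⇒nonzero : ∀ i p {y} → y ∈ block (triple i p) → Nonzero y
    ∈-triple⇒nonzero i p y∈ with ∈-triple⁻ i p y∈
    ... | j , r , r∈ , refl = φ-nonzero p (Γ-nonzero (piece-nonzero i j) r∈)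

    triple-unique : ∀ i p → Unique (block (triple i p))
    triple-unique i p = Unique.++⁺ (Γ-unique (nonzero 0F))
        (Unique.++⁺ (Γ-unique (nonzero 1F)) (Γ-unique (nonzero 2F))
          λ (y∈₁ , y∈₂) → distinct 1F 2F (λ ()) y∈₁ y∈₂)
        λ (y∈₀ , y∈₁₂) → [ distinct 0F 1F (λ ()) y∈₀ , distinct 0F 2F (λ ()) y∈₀ ]′
                           (∈-++⁻ (ΓList (component (triple i p) 1F)) y∈₁₂)
      where
      nonzero : ∀ j → Nonzero (component (triple i p) j)
      nonzero 0F = φ-nonzero p (piece-nonzero i 0F)
      nonzero 1F = φ-nonzero p (piece-nonzero i 1F)
      nonzero 2F = φ-nonzero p (⊖-nonzero (piece-nonzero i 2F))
      distinct : ∀ j₁ j₂ → j₁ ≢ j₂ → ∀ {y} → y ∈ ΓList (component (triple i p) j₁) →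
                 y ∈ ΓList (component (triple i p) j₂) → ⊥
      distinct j₁ j₂ j₁≢j₂ y∈₁ y∈₂ with ∈Γ-component⁻ i p j₁ y∈₁ | ∈Γ-component⁻ i p j₂ y∈₂
      ... | r₁ , r₁∈ , refl | r₂ , r₂∈ , y≡ = j₁≢j₂ (≡.cong proj₂
        (piece-disjoint i j₁ i j₂ _ (φ∈CΓ p r₁∈) (≡.subst (CΓ (piece i j₂)) (≡.sym y≡) (φ∈CΓ p r₂∈))))

    triple-sum≡0ₘ : ∀ i p → let (a , b , c) = triple i p in a ⊕ b ⊕ c ≡ 0ₘ
    triple-sum≡0ₘ i p = begin
      φ p a ⊕ φ p b ⊕ φ p (⊖ (a ⊕ b))   ≡⟨ ≡.cong (_⊕ φ p (⊖ (a ⊕ b))) (φ-⊕ p a b) ⟨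
      φ p (a ⊕ b) ⊕ φ p (⊖ (a ⊕ b))     ≡⟨ φ-⊕ p (a ⊕ b) (⊖ (a ⊕ b)) ⟨
      φ p (a ⊕ b ⊕ ⊖ (a ⊕ b))           ≡⟨ ≡.cong (φ p) (⊖-inverseʳ (a ⊕ b)) ⟩
      φ p 0ₘ                             ≡⟨ φ-0ₘ p ⟩
      0ₘ                                 ∎
      where
      open ≡.≡-Reasoning
      a = proj₁ (pair i)
      b = proj₂ (pair i)

    triple-nonzero : ∀ i p j → Nonzero (component (triple i p) j)
    triple-nonzero i p 0F = φ-nonzero p (piece-nonzero i 0F)
    triple-nonzero i p 1F = φ-nonzero p (piece-nonzero i 1F)
    triple-nonzero i p 2F = φ-nonzero p (⊖-nonzero (piece-nonzero i 2F))

    -- If y = 2ᵖ r = 2ᵖ′ r′ with r, r′ ∈ Γ(X), then 2ᵈ (d = p′ − p) moves X inside Γ(X), so size X ∣ 6d,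
    -- hence size X ∣ d as size X ∣ n is prime to 6; all pieces of the pair have size t, so 2ᵈ fixes each.
    triple-determined : ∀ {i j r p i′ p′ y} → r ∈ ΓList (piece i j) → y ≡ φ p r → y ∈ block (triple i′ p′) →
                        triple i p ≡ triple i′ p′
    triple-determined {i} {j} {r} {p} {i′} {p′} {y} r∈ y≡φpr y∈ with ∈-triple⁻ i′ p′ y∈
    ... | j′ , r′ , r′∈ , y≡φp′r′
      with piece-disjoint i j i′ j′ y (≡.subst (CΓ (piece i j)) (≡.sym y≡φpr) (φ∈CΓ p r∈))
                                      (≡.subst (CΓ (piece i′ j′)) (≡.sym y≡φp′r′) (φ∈CΓ p′ r′∈))
    ...   | refl = ≡.cong₂ _,_ (same-shift 0F) (≡.cong₂ _,_ (same-shift 1F)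
                     (≡.trans (φ-⊖ p _) (≡.trans (≡.cong ⊖_ (same-shift 2F)) (≡.sym (φ-⊖ p′ _)))))
      where
      X = piece i j
      X≢0 : Nonzero X
      X≢0 = piece-nonzero i j
      d = inverse-exponent p ℕ.+ p′
      r≡φdr′ : r ≡ φ d r′
      r≡φdr′ = ≡.trans (≡.sym (φ-inverseˡ p r))
        (≡.trans (≡.cong (φ (inverse-exponent p)) (≡.trans (≡.sym y≡φpr) y≡φp′r′)) (φ-φ (inverse-exponent p) p′ r′))
      φdX∈ΓX : φ d X ∈ ΓList X
      φdX∈ΓX = Γ-trans X≢0 r∈ (Γ-sym (φ-nonzero d X≢0) (≡.subst (_∈ ΓList (φ d X)) (≡.sym r≡φdr′) (Γ-φ d X≢0 r′∈)))
      φd-fixes : ∀ j″ → φ d (piece i j″) ≡ piece i j″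
      φd-fixes j″ = φ-fixed-transfer d (≡.trans (size-piece i j) (≡.sym (size-piece i j″)))
        (size∣⇒φ-fixed X d (divisor-coprime-to-6 primes≡1[6] (size∣n X) (φ∈Γ⇒size∣6d d X≢0 φdX∈ΓX)))
      same-shift : ∀ j″ → φ p (piece i j″) ≡ φ p′ (piece i j″)
      same-shift j″ = begin
        φ p x                                   ≡⟨ ≡.cong (φ p) (φd-fixes j″) ⟨
        φ p (φ d x)                             ≡⟨ ≡.cong (φ p) (φ-φ (inverse-exponent p) p′ x) ⟨
        φ p (φ (inverse-exponent p) (φ p′ x))   ≡⟨ φ-inverseʳ p (φ p′ x) ⟩
        φ p′ x                                  ∎
        where
        open ≡.≡-Reasoning
        x = piece i j″

    record Witness (y : Fin m) : Set where
      field
        index    : Index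
        position : Fin 3
        rep      : Fin m
        rep∈     : rep ∈ ΓList (piece index position)
        shift    : ℕ
        y≡       : y ≡ φ shift rep

    witness : ∀ y → size y ≡ t → Witness y
    witness y size≡t with piece-covers y size≡t
    ... | (i , j) , r , r∈ , y∈C with ∈-CList⁻ y∈C
    ...   | p , y≡ = record { index = i ; position = j ; rep = r ; rep∈ = r∈ ; shift = p ; y≡ = y≡ }

    canonical-triple : ∀ y → size y ≡ t → Triple
    canonical-triple y size≡t = let w = witness y size≡t in triple (Witness.index w) (Witness.shift w)

    ∈-canonical-triple : ∀ y (size≡t : size y ≡ t) → y ∈ block (canonical-triple y size≡t)
    ∈-canonical-triple y size≡t = let w = witness y size≡t in ≡.subst (_∈ block (canonical-triple y size≡t))
      (≡.sym (Witness.y≡ w)) (∈-triple⁺ (Witness.index w) (Witness.shift w) (Witness.position w) (Witness.rep∈ w))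

    canonical-triple-unique : ∀ y (size≡t : size y ≡ t) {i p} → y ∈ block (triple i p) → canonical-triple y size≡t ≡ triple i p
    canonical-triple-unique y size≡t {i} {p} y∈ = let w = witness y size≡t in
      triple-determined {Witness.index w} {Witness.position w} {Witness.rep w} {Witness.shift w} {i} {p} (Witness.rep∈ w) (Witness.y≡ w) y∈

  open SizeClass using (Index; triple; triple-sum≡0ₘ; triple-nonzero; triple-unique; piece-nonzero; ∈-triple⁺)

  IsShiftedTriple : Triple → Set
  IsShiftedTriple T = Σ ℕ λ t → Σ (1 < t) λ 1<t → Σ (Index t 1<t) λ i → Σ ℕ λ p → T ≡ triple t 1<t i p

  private
    canonical-triple-irrelevant : ∀ {t₁ t₂} y → t₁ ≡ t₂ → (1<t₁ : 1 < t₁) (1<t₂ : 1 < t₂) (s₁ : size y ≡ t₁) (s₂ : size y ≡ t₂) →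
      SizeClass.canonical-triple t₁ 1<t₁ y s₁ ≡ SizeClass.canonical-triple t₂ 1<t₂ y s₂
    canonical-triple-irrelevant y refl 1<t₁ 1<t₂ s₁ s₂ rewrite ℕ.<-irrelevant 1<t₁ 1<t₂ | ℕ.≡-irrelevant s₁ s₂ = refl

    -- (0, 0, 0) is a junk value: 0 lies in no block.
    triple-of′ : ∀ y → Dec (y ≡ 0ₘ) → Triple
    triple-of′ y (yes _)    = 0ₘ , 0ₘ , 0ₘ
    triple-of′ y (no y≢0ₘ) = SizeClass.canonical-triple (size y) (1<size y y≢0ₘ) y refl

  triple-of : Fin m → Triple
  triple-of y = triple-of′ y (y ≟F 0ₘ)

  triple-of-shifted : ∀ y → y ≢ 0ₘ → IsShiftedTriple (triple-of y) × y ∈ block (triple-of y)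
  triple-of-shifted y y≢0ₘ with y ≟F 0ₘ
  ... | yes y≡0ₘ  = ⊥-elim (y≢0ₘ y≡0ₘ)
  ... | no y≢0ₘ′ = let w = SizeClass.witness (size y) (1<size y y≢0ₘ′) y refl in
    (size y , 1<size y y≢0ₘ′ , SizeClass.Witness.index w , SizeClass.Witness.shift w , refl) ,
    SizeClass.∈-canonical-triple (size y) (1<size y y≢0ₘ′) y refl

  triple-of-unique : ∀ t (1<t : 1 < t) i p {y} → y ∈ block (triple t 1<t i p) → triple-of y ≡ triple t 1<t i p
  triple-of-unique t 1<t i p {y} y∈ with y ≟F 0ₘ
  ... | yes refl  = ⊥-elim (SizeClass.∈-triple⇒nonzero t 1<t i p y∈ toℕ-0ₘ)
  ... | no y≢0ₘ = ≡.trans (canonical-triple-irrelevant y size≡t (1<size y y≢0ₘ) 1<t refl size≡t)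
                          (SizeClass.canonical-triple-unique t 1<t y size≡t {i} {p} y∈)
    where size≡t = SizeClass.∈-triple⇒size t 1<t i p y∈

  _≟T_ : (T U : Triple) → Dec (T ≡ U)
  _≟T_ = ≡-dec _≟F_ (≡-dec _≟F_ _≟F_)

  triples : List Triple
  triples = deduplicate _≟T_ (map triple-of (filter (λ s → ¬? (s ≟F 0ₘ)) (allFin m)))

  triples-unique : Unique triples
  triples-unique = DecUnique.deduplicate-! _≟T_ _

  triple-of∈triples : ∀ y → y ≢ 0ₘ → triple-of y ∈ triples
  triple-of∈triples y y≢0ₘ = ∈-deduplicate⁺ _≟T_ (∈-map⁺ triple-of (∈-filter⁺ (λ s → ¬? (s ≟F 0ₘ)) (∈-allFin y) y≢0ₘ))

  ∈-triples⇒shifted : ∀ {T} → T ∈ triples → IsShiftedTriple T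
  ∈-triples⇒shifted T∈ with ∈-map⁻ triple-of (∈-deduplicate⁻ _≟T_ _ T∈)
  ... | y , y∈ , refl = proj₁ (triple-of-shifted y (proj₂ (∈-filter⁻ (λ s → ¬? (s ≟F 0ₘ)) {xs = allFin m} y∈)))

  ∈-triples-unique : ∀ {T y} → T ∈ triples → y ∈ block T → triple-of y ≡ T
  ∈-triples-unique T∈ y∈ with ∈-triples⇒shifted T∈
  ... | t , 1<t , i , p , refl = triple-of-unique t 1<t i p y∈

  record GammaTriple (T : Triple) : Set where
    field
      nonzero : ∀ j → Nonzero (component T j)
      sum≡0ₘ  : proj₁ T ⊕ proj₁ (proj₂ T) ⊕ proj₂ (proj₂ T) ≡ 0ₘ
      unique  : Unique (block T)

  ∈-triples⇒gamma : ∀ {T} → T ∈ triples → GammaTriple T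
  ∈-triples⇒gamma T∈ with ∈-triples⇒shifted T∈
  ... | t , 1<t , i , p , refl = record
    { nonzero = triple-nonzero t 1<t i p ; sum≡0ₘ = triple-sum≡0ₘ t 1<t i p ; unique = triple-unique t 1<t i p }

  gammaPartition : GammaPartition
  gammaPartition = length triples , lookup triples , sum≡0 , unique , cover , nonzero , disjoint
    where
    sum≡0 : ∀ i → let (a , b , c) = lookup triples i in (toℕ a ℕ.+ toℕ b ℕ.+ toℕ c) % m ≡ 0
    sum≡0 i = let (a , b , c) = lookup triples i in begin
      (toℕ a ℕ.+ toℕ b ℕ.+ toℕ c) % m     ≡⟨ +-cong-≋ (toℕ-⊕ a b) refl ⟨
      (toℕ (a ⊕ b) ℕ.+ toℕ c) % m         ≡⟨ toℕ-⊕ (a ⊕ b) c ⟨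
      toℕ (a ⊕ b ⊕ c) % m                 ≡⟨ ≡.cong (λ v → toℕ v % m) (GammaTriple.sum≡0ₘ (∈-triples⇒gamma (∈-lookup i))) ⟩
      toℕ 0ₘ % m                          ≡⟨ toℕ%m 0ₘ ⟩
      toℕ 0ₘ                              ≡⟨ toℕ-0ₘ ⟩
      0                                   ∎
      where open ≡.≡-Reasoning
    unique : ∀ i → Unique (block (lookup triples i))
    unique i = GammaTriple.unique (∈-triples⇒gamma (∈-lookup i))
    cover : ∀ s → toℕ s ≢ 0 → ∃ λ i → s ∈ block (lookup triples i)
    cover s s≢0 = Any.index T∈ , ≡.subst (λ T → s ∈ block T) (lookup-index T∈) (proj₂ (triple-of-shifted s (Nonzero⇒≢0ₘ s≢0)))
      where T∈ = triple-of∈triples s (Nonzero⇒≢0ₘ s≢0)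
    nonzero : ∀ i s → s ∈ block (lookup triples i) → toℕ s ≢ 0
    nonzero i s s∈ with ∈-block⁻ (lookup triples i) s∈
    ... | j , s∈Γ = Γ-nonzero (GammaTriple.nonzero (∈-triples⇒gamma (∈-lookup i)) j) s∈Γ
    disjoint : ∀ i j s → s ∈ block (lookup triples i) → s ∈ block (lookup triples j) → i ≡ j
    disjoint i j s s∈ᵢ s∈ⱼ = lookup-injective triples-unique
      (≡.trans (≡.sym (∈-triples-unique (∈-lookup i) s∈ᵢ)) (∈-triples-unique (∈-lookup j) s∈ⱼ))

  φ-triple : ℕ → Triple → Triple
  φ-triple r (a , b , c) = φ r a , φ r b , φ r c

  φ-triple-∈-triples : ∀ r {T} → T ∈ triples → φ-triple r T ∈ triples
  φ-triple-∈-triples r T∈ with ∈-triples⇒shifted T∈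
  ... | t , 1<t , i , p , refl = ≡.subst (_∈ triples) triple-of-y≡ (triple-of∈triples y (Nonzero⇒≢0ₘ y≢0))
    where
    X = SizeClass.piece t 1<t i 0F
    y = φ (r ℕ.+ p) X
    y≢0 : Nonzero y
    y≢0 = φ-nonzero (r ℕ.+ p) (piece-nonzero t 1<t i 0F)
    triple-of-y≡ : triple-of y ≡ φ-triple r (triple t 1<t i p)
    triple-of-y≡ = ≡.trans (triple-of-unique t 1<t i (r ℕ.+ p) (∈-triple⁺ t 1<t i (r ℕ.+ p) 0F (Γ-self X)))
      (≡.sym (≡.cong₂ _,_ (φ-φ r p _) (≡.cong₂ _,_ (φ-φ r p _) (φ-φ r p _))))

module TriangleDesign {c ℓ} (R : CommutativeRing c ℓ) (ξ : CommutativeRing.Carrier R)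
  (n : ℕ) (F : FieldDefs.IsPrimitiveField R n ξ)
  (m : ℕ) .{{m≢0 : NonZero m}} (m≡2^n∸1 : m ≡ 2 ^ n ∸ 1)
  (Z : Fin m → Fin m) (isZech : FieldDefs.IsZech R m ξ Z)
  (primes≡1[6] : ∀ p → Prime p → p ∣ n → p % 6 ≡ 1)
  (pairs : ZM.PairHypothesis m Z) (1<m : 1 < m) where

  import Data.Nat as ℕ
  import Data.Nat.Properties as ℕ
  open import Data.Fin using (toℕ)
  open import Data.Fin.Patterns using (0F; 1F; 2F)
  open import Data.List using (List; []; _∷_; length; lookup; allFin; cartesianProduct; filter)
  open import Data.List.Membership.Propositional using (_∈_)
  open import Data.List.Membership.Propositional.Properties using (∈-lookup; ∈-allFin; ∈-cartesianProduct⁺; ∈-cartesianProduct⁻)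
  open import Data.List.Relation.Unary.Any using (here; there)
  import Data.List.Relation.Unary.Any as Any
  open import Data.List.Properties using (filter-≐)
  open import Data.List.Relation.Unary.Any.Properties using (lookup-index)
  open import Data.List.Relation.Unary.Unique.Propositional using (Unique)
  import Data.List.Relation.Unary.Unique.Propositional.Properties as Unique
  open import Data.List.Relation.Unary.Unique.Propositional.Properties using (Unique[x∷xs]⇒x∉xs)
  open import Data.Product using (Σ; ∃; _×_; _,_; proj₁; proj₂)
  open import Data.Product.Properties using (×-≡,≡→≡)
  open import Data.Sum using (inj₁; inj₂)
  open import Data.Empty using (⊥-elim)
  open import Relation.Nullary using (¬_)
  open import Relation.Binary.PropositionalEquality as ≡ using (_≢_)

  open CommutativeRing R
  open FieldDefs R using (pow; Span; SameSub; Indep2; Indep3; subsOf; InTri; SameTri; IsTriangleDesign;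
                          Covers; Covers?; countCover; IsBalanced; Invariant; mapTri; IsAutomorphism; DesignConclusion)
  open ModularArithmetic m
  open ListFacts
  open GammaBlocks R ξ n F m m≡2^n∸1 Z isZech primes≡1[6] pairs
  open FieldAutomorphisms R ξ n F m m≡2^n∸1 Z isZech 1<m using (automorphism⇒φ)
  open ZM m Z using (ΓList)
  import Relation.Binary.Reasoning.Setoid as SetoidReasoning
  module ≈-Reasoning = SetoidReasoning setoid

  Triangle : Set c
  Triangle = Carrier × Carrier × Carrier

  -- The triangle of the triple (a, b, c) rotated by λ₀ has vertices ξ^λ₀, ξ^(λ₀+a), ξ^(λ₀+a+b); its sides are
  -- the 2-subspaces ⟨ξᵖ, ξ^(p+x)⟩ for x = a, b, c, since a + b + c = 0.
  triangle : Triple → Fin m → Triangle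
  triangle (a , b , c) λ₀ = e λ₀ , e (λ₀ ⊕ a) , e (λ₀ ⊕ a ⊕ b)

  offset : Triple → Fin 3 → Fin m
  offset (a , b , c) 0F = 0ₘ
  offset (a , b , c) 1F = a
  offset (a , b , c) 2F = a ⊕ b

  side : Fin m → Fin m → Carrier × Carrier
  side p x = e p , e (p ⊕ x)

  triangle-sides : ∀ T → GammaTriple T → ∀ λ₀ j → SameSub (subsOf (triangle T λ₀) j) (side (λ₀ ⊕ offset T j) (component T j))
  triangle-sides (a , b , c) _ λ₀ 0F =
    sameSub-≈ (e-cong (≡.sym (⊕-identityʳ λ₀))) (e-cong (≡.cong (_⊕ a) (≡.sym (⊕-identityʳ λ₀))))
  triangle-sides (a , b , c) _ λ₀ 1F = sameSub-≈ refl refl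
  triangle-sides (a , b , c) γ λ₀ 2F = sameSub-≈ (e-cong (⊕-assoc λ₀ a b)) (e-cong (begin
    λ₀                       ≡⟨ ⊕-identityʳ λ₀ ⟨
    λ₀ ⊕ 0ₘ                  ≡⟨ ≡.cong (λ₀ ⊕_) (GammaTriple.sum≡0ₘ γ) ⟨
    λ₀ ⊕ (a ⊕ b ⊕ c)         ≡⟨ ⊕-assoc λ₀ (a ⊕ b) c ⟨
    λ₀ ⊕ (a ⊕ b) ⊕ c         ∎))
    where open ≡.≡-Reasoning

  triangle-independent : ∀ T → GammaTriple T → ∀ λ₀ → Indep3 (triangle T λ₀)
  triangle-independent (a , b , c) γ λ₀ =
      e≉0 λ₀ , e≉0 (λ₀ ⊕ a) , e≉0 (λ₀ ⊕ a ⊕ b)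
    , (λ u+v≈0 → e≉0 (λ₀ ⊕ Z a) (trans (sym (e-+ λ₀ a≢0)) u+v≈0))
    , (λ v+w≈0 → e≉0 (λ₀ ⊕ a ⊕ Z b) (trans (sym (e-+ (λ₀ ⊕ a) b≢0)) v+w≈0))
    , (λ u+w≈0 → e≉0 (λ₀ ⊕ Z (a ⊕ b))
        (trans (sym (e-+ λ₀ a⊕b≢0)) (trans (+-cong refl (e-cong (≡.sym (⊕-assoc λ₀ a b)))) u+w≈0)))
    , u+v+w≉0
    where
    a≢0 : Nonzero a
    a≢0 = GammaTriple.nonzero γ 0F
    b≢0 : Nonzero b
    b≢0 = GammaTriple.nonzero γ 1F
    a⊕b≢0 : Nonzero (a ⊕ b)
    a⊕b≢0 = ≡.subst Nonzero (≡.sym (⊖-unique (a ⊕ b) c (GammaTriple.sum≡0ₘ γ))) (⊖-nonzero (GammaTriple.nonzero γ 2F))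
    -- u + v + w = 0 would force Z a = a + b, i.e. b = Z (⊖ a) ∈ Γ(a), against the disjointness of Γ(a) and Γ(b)
    u+v+w≉0 : ¬ (e λ₀ + e (λ₀ ⊕ a) + e (λ₀ ⊕ a ⊕ b) ≈ 0#)
    u+v+w≉0 u+v+w≈0 with block-position-unique (a , b , c) (GammaTriple.unique γ) 0F 1F (γ₂ b≡Z⊖a) (γ₀ ≡.refl)
      where
      Za≡a⊕b : Z a ≡ a ⊕ b
      Za≡a⊕b = ⊕-cancelˡ λ₀ _ _ (≡.trans (e-injective (x+y≈0⇒x≈y (trans (+-cong (sym (e-+ λ₀ a≢0)) refl) u+v+w≈0)))
                                          (⊕-assoc λ₀ a b))
      b≡Z⊖a : b ≡ Z (⊖ a)
      b≡Z⊖a = ≡.sym (≡.trans (Z-⊖ a≢0) (≡.trans (≡.cong (_⊕ ⊖ a) Za≡a⊕b)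
        (≡.trans (≡.cong (_⊕ ⊖ a) (⊕-comm a b)) (≡.trans (⊕-assoc b a (⊖ a)) (≡.trans (≡.cong (b ⊕_) (⊖-inverseʳ a)) (⊕-identityʳ b))))))
    ... | ()

  -- The nonzero vectors of the side ⟨ξᵖ, ξ^(p+x)⟩ are ξ^(p+o) for the offsets o ∈ {0, x, Z x}.
  data Offset (x : Fin m) : Fin m → Set where
    offset-0  : Offset x 0ₘ
    offset-x  : Offset x x
    offset-Zx : Offset x (Z x)

  ∈-side⁻ : ∀ p {x v} → Nonzero x → ¬ (v ≈ 0#) → Span (e p) (e (p ⊕ x)) v → ∃ λ o → Offset x o × v ≈ e (p ⊕ o)
  ∈-side⁻ p x≢0 v≉0 (inj₁ v≈0)                 = ⊥-elim (v≉0 v≈0)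
  ∈-side⁻ p x≢0 v≉0 (inj₂ (inj₁ v≈ep))         = 0ₘ , offset-0 , trans v≈ep (e-cong (≡.sym (⊕-identityʳ p)))
  ∈-side⁻ p x≢0 v≉0 (inj₂ (inj₂ (inj₁ v≈ep⊕x))) = _ , offset-x , v≈ep⊕x
  ∈-side⁻ p x≢0 v≉0 (inj₂ (inj₂ (inj₂ v≈sum)))  = _ , offset-Zx , trans v≈sum (e-+ p x≢0)

  ∈-side⁺ : ∀ p {x o} → Nonzero x → Offset x o → Span (e p) (e (p ⊕ x)) (e (p ⊕ o))
  ∈-side⁺ p x≢0 offset-0  = inj₂ (inj₁ (e-cong (⊕-identityʳ p)))
  ∈-side⁺ p x≢0 offset-x  = inj₂ (inj₂ (inj₁ refl))
  ∈-side⁺ p x≢0 offset-Zx = inj₂ (inj₂ (inj₂ (sym (e-+ p x≢0))))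

  private
    Zx⊖x≡Z⊖x : ∀ {x} → Nonzero x → Z x ⊕ ⊖ x ≡ Z (⊖ x)
    Zx⊖x≡Z⊖x x≢0 = ≡.sym (Z-⊖ x≢0)

    x⊖Zx≡⊖Z⊖x : ∀ {x} → Nonzero x → x ⊕ ⊖ Z x ≡ ⊖ Z (⊖ x)
    x⊖Zx≡⊖Z⊖x {x} x≢0 = begin
      x ⊕ ⊖ Z x            ≡⟨ ⊕-comm x _ ⟩
      ⊖ Z x ⊕ x            ≡⟨ ≡.cong (⊖ Z x ⊕_) (⊖-involutive x) ⟨
      ⊖ Z x ⊕ ⊖ ⊖ x        ≡⟨ ⊖-⊕-distrib (Z x) (⊖ x) ⟩
      ⊖ (Z x ⊕ ⊖ x)        ≡⟨ ≡.cong ⊖_ (Z-⊖ x≢0) ⟨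
      ⊖ Z (⊖ x)            ∎
      where open ≡.≡-Reasoning

    o⊖0≡o : ∀ o → o ⊕ ⊖ 0ₘ ≡ o
    o⊖0≡o o = ≡.trans (≡.cong (o ⊕_) ⊖-0ₘ) (⊕-identityʳ o)

    x∉Γ-tail : ∀ {x y} → Nonzero x → y ∈ (Z x ∷ Z (⊖ x) ∷ ⊖ Z (⊖ x) ∷ ⊖ Z x ∷ ⊖ x ∷ []) → x ≢ y
    x∉Γ-tail x≢0 y∈ ≡.refl = Unique[x∷xs]⇒x∉xs (Γ-unique x≢0) y∈

    o⊖o≢y : ∀ {o y} → Nonzero y → y ≢ o ⊕ ⊖ o
    o⊖o≢y {o} y≢0 y≡ = Nonzero⇒≢0ₘ y≢0 (≡.trans y≡ (⊖-inverseʳ o))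

  offset-difference : ∀ {x y o₁ o₂} → Nonzero x → Nonzero y → Offset x o₁ → Offset x o₂ → y ≡ o₂ ⊕ ⊖ o₁ →
                      y ∈ ΓList x × (x ≡ y → o₁ ≡ 0ₘ)
  offset-difference x≢0 y≢0 offset-0  offset-0  y≡ = ⊥-elim (o⊖o≢y y≢0 y≡)
  offset-difference x≢0 y≢0 offset-x  offset-x  y≡ = ⊥-elim (o⊖o≢y y≢0 y≡)
  offset-difference x≢0 y≢0 offset-Zx offset-Zx y≡ = ⊥-elim (o⊖o≢y y≢0 y≡)
  offset-difference x≢0 y≢0 offset-0  offset-x  y≡ = γ₀ (≡.trans y≡ (o⊖0≡o _)) , λ _ → ≡.refl
  offset-difference x≢0 y≢0 offset-0  offset-Zx y≡ = γ₁ (≡.trans y≡ (o⊖0≡o _)) , λ _ → ≡.refl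
  offset-difference x≢0 y≢0 offset-x  offset-0  y≡ = let y≡⊖x = ≡.trans y≡ (⊕-identityˡ _) in
    γ₅ y≡⊖x , λ x≡y → ⊥-elim (x∉Γ-tail x≢0 (there (there (there (there (here y≡⊖x))))) x≡y)
  offset-difference x≢0 y≢0 offset-x  offset-Zx y≡ = let y≡Z⊖x = ≡.trans y≡ (Zx⊖x≡Z⊖x x≢0) in
    γ₂ y≡Z⊖x , λ x≡y → ⊥-elim (x∉Γ-tail x≢0 (there (here y≡Z⊖x)) x≡y)
  offset-difference x≢0 y≢0 offset-Zx offset-0  y≡ = let y≡⊖Zx = ≡.trans y≡ (⊕-identityˡ _) in
    γ₄ y≡⊖Zx , λ x≡y → ⊥-elim (x∉Γ-tail x≢0 (there (there (there (here y≡⊖Zx)))) x≡y)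
  offset-difference x≢0 y≢0 offset-Zx offset-x  y≡ = let y≡⊖Z⊖x = ≡.trans y≡ (x⊖Zx≡⊖Z⊖x x≢0) in
    γ₃ y≡⊖Z⊖x , λ x≡y → ⊥-elim (x∉Γ-tail x≢0 (there (there (here y≡⊖Z⊖x))) x≡y)

  Γ-difference : ∀ {x k} → Nonzero x → k ∈ ΓList x → Σ (Fin m) λ o₁ → Σ (Fin m) λ o₂ → Offset x o₁ × Offset x o₂ × k ≡ o₂ ⊕ ⊖ o₁
  Γ-difference x≢0 (γ₀ ≡.refl) = _ , _ , offset-0  , offset-x  , ≡.sym (o⊖0≡o _)
  Γ-difference x≢0 (γ₁ ≡.refl) = _ , _ , offset-0  , offset-Zx , ≡.sym (o⊖0≡o _)
  Γ-difference x≢0 (γ₂ ≡.refl) = _ , _ , offset-x  , offset-Zx , ≡.sym (Zx⊖x≡Z⊖x x≢0)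
  Γ-difference x≢0 (γ₃ ≡.refl) = _ , _ , offset-Zx , offset-x  , ≡.sym (x⊖Zx≡⊖Z⊖x x≢0)
  Γ-difference x≢0 (γ₄ ≡.refl) = _ , _ , offset-Zx , offset-0  , ≡.sym (⊕-identityˡ _)
  Γ-difference x≢0 (γ₅ ≡.refl) = _ , _ , offset-x  , offset-0  , ≡.sym (⊕-identityˡ _)

  side-independent : ∀ p {x} → Nonzero x → Indep2 (e p) (e (p ⊕ x))
  side-independent p x≢0 = e≉0 p , e≉0 (p ⊕ _) , λ sum≈0 → e≉0 (p ⊕ Z _) (trans (sym (e-+ p x≢0)) sum≈0)

  sides-same⇒Γ : ∀ p q {x y} → Nonzero x → Nonzero y → SameSub (side p x) (side q y) → y ∈ ΓList x × (x ≡ y → p ≡ q)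
  sides-same⇒Γ p q {x} {y} x≢0 y≢0 same
    with ∈-side⁻ p x≢0 (e≉0 q) (proj₂ (same (e q)) (inj₂ (inj₁ refl)))
       | ∈-side⁻ p x≢0 (e≉0 (q ⊕ y)) (proj₂ (same (e (q ⊕ y))) (inj₂ (inj₂ (inj₁ refl))))
  ... | o₁ , off₁ , eq≈ | o₂ , off₂ , eq⊕y≈ =
    let (y∈ , o₁≡0ₘ) = offset-difference x≢0 y≢0 off₁ off₂ y≡o₂⊖o₁
    in y∈ , λ x≡y → ≡.sym (≡.trans q≡p⊕o₁ (≡.trans (≡.cong (p ⊕_) (o₁≡0ₘ x≡y)) (⊕-identityʳ p)))
    where
    q≡p⊕o₁ : q ≡ p ⊕ o₁
    q≡p⊕o₁ = e-injective eq≈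
    y≡o₂⊖o₁ : y ≡ o₂ ⊕ ⊖ o₁
    y≡o₂⊖o₁ = ⊕-solveʳ (⊕-cancelˡ p _ _ (≡.trans (≡.sym (⊕-assoc p o₁ y))
      (≡.trans (≡.cong (_⊕ y) (≡.sym q≡p⊕o₁)) (e-injective eq⊕y≈))))

  Γ⇒sides-same : ∀ P {x k} → Nonzero x → Nonzero k → k ∈ ΓList x → Σ (Fin m) λ Q → SameSub (side P k) (side Q x)
  Γ⇒sides-same P {x} {k} x≢0 k≢0 k∈ with Γ-difference x≢0 k∈
  ... | o₁ , o₂ , off₁ , off₂ , k≡o₂⊖o₁ = Q , sameSub-sym (sameSub-from-⊆ (side-independent P k≢0)
        (≡.subst (λ v → Span (e Q) (e (Q ⊕ x)) (e v)) Q⊕o₁≡P (∈-side⁺ Q x≢0 off₁))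
        (≡.subst (λ v → Span (e Q) (e (Q ⊕ x)) (e v)) Q⊕o₂≡P⊕k (∈-side⁺ Q x≢0 off₂)))
    where
    open ≡.≡-Reasoning
    Q = P ⊕ ⊖ o₁
    Q⊕o₁≡P : Q ⊕ o₁ ≡ P
    Q⊕o₁≡P = ⊖-cancelʳ P o₁
    Q⊕o₂≡P⊕k : Q ⊕ o₂ ≡ P ⊕ k
    Q⊕o₂≡P⊕k = begin
      P ⊕ ⊖ o₁ ⊕ o₂       ≡⟨ ⊕-assoc P (⊖ o₁) o₂ ⟩
      P ⊕ (⊖ o₁ ⊕ o₂)     ≡⟨ ≡.cong (P ⊕_) (⊕-comm (⊖ o₁) o₂) ⟩
      P ⊕ (o₂ ⊕ ⊖ o₁)     ≡⟨ ≡.cong (P ⊕_) k≡o₂⊖o₁ ⟨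
      P ⊕ k               ∎

  placements : List (Triple × Fin m)
  placements = cartesianProduct triples (allFin m)

  placements-unique : Unique placements
  placements-unique = Unique.cartesianProduct⁺ triples-unique (Unique.allFin⁺ m)

  placed : Triple × Fin m → Triangle
  placed (T , λ₀) = triangle T λ₀

  K : ℕ
  K = length placements

  design : Fin K → Triangle
  design i = placed (lookup placements i)

  placement-index : ∀ {T} λ₀ → T ∈ triples → Σ (Fin K) λ i → lookup placements i ≡ (T , λ₀)
  placement-index λ₀ T∈ = Any.index T,λ₀∈ , ≡.sym (lookup-index T,λ₀∈)
    where T,λ₀∈ = ∈-cartesianProduct⁺ T∈ (∈-allFin λ₀)

  placement-triple∈ : ∀ i → proj₁ (lookup placements i) ∈ triples
  placement-triple∈ i = proj₁ (∈-cartesianProduct⁻ triples (allFin m) (∈-lookup i))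

  design-independent : ∀ i → Indep3 (design i)
  design-independent i = let (T , λ₀) = lookup placements i in
    triangle-independent T (∈-triples⇒gamma (placement-triple∈ i)) λ₀

  independent⇒side : ∀ {u w} → Indep2 u w → Σ (Fin m) λ P → Σ (Fin m) λ k → Nonzero k × SameSub (u , w) (side P k)
  independent⇒side {u} {w} (u≉0 , w≉0 , u+w≉0) = P , k , ≢0ₘ⇒Nonzero k≢0ₘ ,
    sameSub-≈ u≈eP (trans w≈eW (e-cong (≡.sym (⊕-⊖-cancel P W))))
    where
    P = proj₁ (log u u≉0)
    u≈eP : u ≈ e P
    u≈eP = proj₂ (log u u≉0)
    W = proj₁ (log w w≉0)
    w≈eW : w ≈ e W
    w≈eW = proj₂ (log w w≉0)
    k = W ⊕ ⊖ P
    k≢0ₘ : k ≢ 0ₘ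
    k≢0ₘ k≡0ₘ = u+w≉0 (x≈y⇒x+y≈0 (trans u≈eP (trans (e-cong P≡W) (sym w≈eW))))
      where
      P≡W : P ≡ W
      P≡W = ≡.trans (≡.sym (⊕-identityʳ P)) (≡.trans (≡.cong (P ⊕_) (≡.sym k≡0ₘ)) (⊕-⊖-cancel P W))

  -- The side ⟨ξᴾ, ξ^(P+k)⟩ lies on a rotation of the triangle of the triple whose block contains k.
  side-covered : ∀ P {k} → Nonzero k → ∃ λ i → InTri (side P k) (design i)
  side-covered P {k} k≢0 = proj₁ ix , ≡.subst (λ x → InTri (side P k) (placed x)) (≡.sym (proj₂ ix)) (j , on-side)
    where
    k≢0ₘ : k ≢ 0ₘ
    k≢0ₘ = Nonzero⇒≢0ₘ k≢0
    T = triple-of k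
    T∈ : T ∈ triples
    T∈ = triple-of∈triples k k≢0ₘ
    γ : GammaTriple T
    γ = ∈-triples⇒gamma T∈
    j : Fin 3
    j = proj₁ (∈-block⁻ T (proj₂ (triple-of-shifted k k≢0ₘ)))
    k∈Γ : k ∈ ΓList (component T j)
    k∈Γ = proj₂ (∈-block⁻ T (proj₂ (triple-of-shifted k k≢0ₘ)))
    x = component T j
    Q = proj₁ (Γ⇒sides-same P (GammaTriple.nonzero γ j) k≢0 k∈Γ)
    λ₀ = Q ⊕ ⊖ offset T j
    ix = placement-index λ₀ T∈
    on-side : SameSub (side P k) (subsOf (triangle T λ₀) j)
    on-side = sameSub-trans (proj₂ (Γ⇒sides-same P (GammaTriple.nonzero γ j) k≢0 k∈Γ))
      (sameSub-trans (sameSub-≈ (e-cong (≡.sym (⊖-cancelʳ Q (offset T j)))) (e-cong (≡.cong (_⊕ x) (≡.sym (⊖-cancelʳ Q (offset T j))))))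
      (sameSub-sym (triangle-sides T γ λ₀ j)))

  design-covers : ∀ u w → Indep2 u w → ∃ λ i → InTri (u , w) (design i)
  design-covers u w u,w-independent =
    let (P , k , k≢0 , u,w≡side) = independent⇒side u,w-independent
        (i , j , side≡) = side-covered P k≢0
    in i , j , sameSub-trans u,w≡side side≡

  -- Two sides of placed triangles that coincide have differences in the same Γ-class, hence come from the
  -- same triple and the same component, and then the rotations agree.
  design-unique : ∀ u w → Indep2 u w → ∀ i₁ i₂ → InTri (u , w) (design i₁) → InTri (u , w) (design i₂) → i₁ ≡ i₂
  design-unique u w _ i₁ i₂ (j₁ , on₁) (j₂ , on₂) = lookup-injective placements-unique (×-≡,≡→≡ (T₁≡T₂ , λ₁≡λ₂))
    where
    T₁ = proj₁ (lookup placements i₁)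
    λ₁ = proj₂ (lookup placements i₁)
    T₂ = proj₁ (lookup placements i₂)
    λ₂ = proj₂ (lookup placements i₂)
    good₁ : GammaTriple T₁
    good₁ = ∈-triples⇒gamma (placement-triple∈ i₁)
    good₂ : GammaTriple T₂
    good₂ = ∈-triples⇒gamma (placement-triple∈ i₂)
    x₁ = component T₁ j₁
    x₂ = component T₂ j₂
    same : SameSub (side (λ₁ ⊕ offset T₁ j₁) x₁) (side (λ₂ ⊕ offset T₂ j₂) x₂)
    same = sameSub-trans (sameSub-sym (sameSub-trans on₁ (triangle-sides T₁ good₁ λ₁ j₁)))
                         (sameSub-trans on₂ (triangle-sides T₂ good₂ λ₂ j₂))
    classified : x₂ ∈ ΓList x₁ × (x₁ ≡ x₂ → λ₁ ⊕ offset T₁ j₁ ≡ λ₂ ⊕ offset T₂ j₂)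
    classified = sides-same⇒Γ _ _ (GammaTriple.nonzero good₁ j₁) (GammaTriple.nonzero good₂ j₂) same
    T₁≡T₂ : T₁ ≡ T₂
    T₁≡T₂ = ≡.trans (≡.sym (∈-triples-unique (placement-triple∈ i₁) (∈-block⁺ T₁ j₁ (proj₁ classified))))
                    (∈-triples-unique (placement-triple∈ i₂) (∈-block⁺ T₂ j₂ (Γ-self x₂)))
    j₁≡j₂ : j₁ ≡ j₂
    j₁≡j₂ = block-position-unique T₁ (GammaTriple.unique good₁) j₁ j₂ (proj₁ classified)
              (≡.subst (λ T → x₂ ∈ ΓList (component T j₂)) (≡.sym T₁≡T₂) (Γ-self x₂))
    λ₁≡λ₂ : λ₁ ≡ λ₂
    λ₁≡λ₂ = ⊕-cancelʳ (offset T₁ j₁) λ₁ λ₂ (≡.trans (proj₂ classified (≡.cong₂ component T₁≡T₂ j₁≡j₂))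
              (≡.cong (λ₂ ⊕_) (≡.cong₂ offset (≡.sym T₁≡T₂) (≡.sym j₁≡j₂))))

  infix 4 _≈△_
  _≈△_ : Triangle → Triangle → Set ℓ
  (x₁ , x₂ , x₃) ≈△ (y₁ , y₂ , y₃) = x₁ ≈ y₁ × x₂ ≈ y₂ × x₃ ≈ y₃

  private
    sides-≈ : ∀ {X Y} → X ≈△ Y → ∀ j → proj₁ (subsOf X j) ≈ proj₁ (subsOf Y j) × proj₂ (subsOf X j) ≈ proj₂ (subsOf Y j)
    sides-≈ (x₁≈y₁ , x₂≈y₂ , x₃≈y₃) 0F = x₁≈y₁ , x₂≈y₂
    sides-≈ (x₁≈y₁ , x₂≈y₂ , x₃≈y₃) 1F = x₂≈y₂ , x₃≈y₃
    sides-≈ (x₁≈y₁ , x₂≈y₂ , x₃≈y₃) 2F = x₃≈y₃ , x₁≈y₁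

  ≈△⇒sameTri : ∀ {X Y} → X ≈△ Y → SameTri X Y
  ≈△⇒sameTri X≈Y = (λ j → j , let (u≈ , w≈) = sides-≈ X≈Y j in sameSub-≈ u≈ w≈)
                 , (λ j → j , let (u≈ , w≈) = sides-≈ X≈Y j in sameSub-≈ (sym u≈) (sym w≈))

  covers-resp : ∀ {X Y v w} → X ≈△ Y → v ≈ w → Covers X v → Covers Y w
  covers-resp X≈Y v≈w (j , v∈) = j , let (u≈ , w≈) = sides-≈ X≈Y j in span-resp u≈ w≈ v≈w v∈

  covers-scale : ∀ s X {v} → Covers X v → Covers (mapTri (s *_) X) (s * v)
  covers-scale s (x₁ , x₂ , x₃) (0F , v∈) = 0F , span-scale s v∈
  covers-scale s (x₁ , x₂ , x₃) (1F , v∈) = 1F , span-scale s v∈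
  covers-scale s (x₁ , x₂ , x₃) (2F , v∈) = 2F , span-scale s v∈

  covers-unscale : ∀ k X {v} → Covers (mapTri (e k *_) X) (e k * v) → Covers X v
  covers-unscale k X {v} cov = covers-resp (cancel _ , cancel _ , cancel _) (cancel v) (covers-scale (e (⊖ k)) _ cov)
    where
    cancel : ∀ y → e (⊖ k) * (e k * y) ≈ y
    cancel y = trans (sym (*-assoc _ _ _)) (trans (*-cong (e-⊖ k) refl) (*-identityˡ y))

  rotate : Fin m → Triple × Fin m → Triple × Fin m
  rotate k (T , λ₀) = T , λ₀ ⊕ k

  rotate-∈ : ∀ k {x} → x ∈ placements → rotate k x ∈ placements
  rotate-∈ k {T , λ₀} x∈ = ∈-cartesianProduct⁺ (proj₁ (∈-cartesianProduct⁻ triples (allFin m) x∈)) (∈-allFin (λ₀ ⊕ k))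

  rotate-onto : ∀ k {y} → y ∈ placements → ∃ λ x → x ∈ placements × rotate k x ≡ y
  rotate-onto k {T , λ₀} y∈ = (T , λ₀ ⊕ ⊖ k)
    , ∈-cartesianProduct⁺ (proj₁ (∈-cartesianProduct⁻ triples (allFin m) y∈)) (∈-allFin _) , ≡.cong (T ,_) (⊖-cancelʳ λ₀ k)

  rotate-injective : ∀ k {x y} → rotate k x ≡ rotate k y → x ≡ y
  rotate-injective k {T , λ₀} {T′ , λ₀′} eq = ×-≡,≡→≡ (≡.cong proj₁ eq , ⊕-cancelʳ k λ₀ λ₀′ (≡.cong proj₂ eq))

  placed-rotate : ∀ k x → placed (rotate k x) ≈△ mapTri (e k *_) (placed x)
  placed-rotate k ((a , b , c) , λ₀) =
      trans (e-⊕ λ₀ k) (*-comm _ _)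
    , trans (e-cong (shuffle a)) (e-⊕ k (λ₀ ⊕ a))
    , trans (e-cong (≡.trans (≡.cong (_⊕ b) (shuffle a)) (⊕-assoc k (λ₀ ⊕ a) b))) (e-⊕ k (λ₀ ⊕ a ⊕ b))
    where
    shuffle : ∀ y → λ₀ ⊕ k ⊕ y ≡ k ⊕ (λ₀ ⊕ y)
    shuffle y = ≡.trans (≡.cong (_⊕ y) (⊕-comm λ₀ k)) (⊕-assoc k λ₀ y)

  invariant-under : ∀ f (g : Triple × Fin m → Triple × Fin m) → (∀ {x} → x ∈ placements → g x ∈ placements) →
    (∀ {y} → y ∈ placements → ∃ λ x → x ∈ placements × g x ≡ y) → (∀ x → mapTri f (placed x) ≈△ placed (g x)) →
    Invariant f K design
  invariant-under f g g-∈ g-onto f≈g = forward , backward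
    where
    forward : ∀ i → ∃ λ j → SameTri (mapTri f (design i)) (design j)
    forward i with ∈-cartesianProduct⁻ triples (allFin m) (g-∈ (∈-lookup {xs = placements} i))
    ... | T∈ , _ = let (j , lookup≡) = placement-index (proj₂ (g (lookup placements i))) T∈ in
      j , ≡.subst (λ x → SameTri (mapTri f (design i)) (placed x)) (≡.sym lookup≡) (≈△⇒sameTri (f≈g (lookup placements i)))
    backward : ∀ j → ∃ λ i → SameTri (mapTri f (design i)) (design j)
    backward j with g-onto (∈-lookup {xs = placements} j)
    ... | x , x∈ , gx≡ = let (i , lookup≡) = placement-index (proj₂ x) (proj₁ (∈-cartesianProduct⁻ triples (allFin m) x∈)) in
      i , ≡.subst₂ (λ x′ y → SameTri (mapTri f (placed x′)) (placed y)) (≡.sym lookup≡) gx≡ (≈△⇒sameTri (f≈g x))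

  multiplication-invariant : ∀ λ′ → ¬ (λ′ ≈ 0#) → Invariant (λ′ *_) K design
  multiplication-invariant λ′ λ′≉0 = invariant-under (λ′ *_) (rotate k) (rotate-∈ k) (rotate-onto k) λ x →
    let (x₁ , x₂ , x₃) = placed-rotate k x in
    trans (*-cong λ′≈ek refl) (sym x₁) , trans (*-cong λ′≈ek refl) (sym x₂) , trans (*-cong λ′≈ek refl) (sym x₃)
    where
    k = proj₁ (log λ′ λ′≉0)
    λ′≈ek : λ′ ≈ e k
    λ′≈ek = proj₂ (log λ′ λ′≉0)

  automorphism-invariant : ∀ σ → IsAutomorphism σ → Invariant σ K design
  automorphism-invariant σ σ-aut = invariant-under σ frobenius frobenius-∈ frobenius-onto σ≈frobenius
    where
    r = proj₁ (automorphism⇒φ σ-aut)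
    frobenius : Triple × Fin m → Triple × Fin m
    frobenius (T , λ₀) = φ-triple r T , φ r λ₀
    frobenius-∈ : ∀ {x} → x ∈ placements → frobenius x ∈ placements
    frobenius-∈ x∈ = ∈-cartesianProduct⁺ (φ-triple-∈-triples r (proj₁ (∈-cartesianProduct⁻ triples (allFin m) x∈))) (∈-allFin _)
    frobenius-onto : ∀ {y} → y ∈ placements → ∃ λ x → x ∈ placements × frobenius x ≡ y
    frobenius-onto {(a , b , c) , λ₀} y∈ = (φ-triple r⁻¹ (a , b , c) , φ r⁻¹ λ₀) ,
      ∈-cartesianProduct⁺ (φ-triple-∈-triples r⁻¹ (proj₁ (∈-cartesianProduct⁻ triples (allFin m) y∈))) (∈-allFin _) ,
      ≡.cong₂ _,_ (≡.cong₂ _,_ (φ-inverseʳ r a) (≡.cong₂ _,_ (φ-inverseʳ r b) (φ-inverseʳ r c))) (φ-inverseʳ r λ₀)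
      where r⁻¹ = inverse-exponent r
    σ-e : ∀ x → σ (e x) ≈ e (φ r x)
    σ-e = proj₂ (automorphism⇒φ σ-aut)
    σ≈frobenius : ∀ x → mapTri σ (placed x) ≈△ placed (frobenius x)
    σ≈frobenius ((a , b , c) , λ₀) = σ-e λ₀ , trans (σ-e (λ₀ ⊕ a)) (e-cong (φ-⊕ r λ₀ a))
      , trans (σ-e (λ₀ ⊕ a ⊕ b)) (e-cong (≡.trans (φ-⊕ r (λ₀ ⊕ a) b) (≡.cong (_⊕ φ r b) (φ-⊕ r λ₀ a))))

  -- ξᵏ · placed x covers ξᵏ exactly when placed x covers 1, and rotating permutes the placements.
  balanced : IsBalanced decEq K design
  balanced = count 1# , λ v v≉0 → ≡.trans (length-filter-lookup (λ x → Covers? decEq (placed x) v) placements) (count-const v v≉0)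
    where
    count : Carrier → ℕ
    count v = length (filter (λ x → Covers? decEq (placed x) v) placements)
    count-const : ∀ v → ¬ (v ≈ 0#) → count v ≡ count 1#
    count-const v v≉0 = ≡.trans
      (≡.sym (length-filter-permute (λ x → Covers? decEq (placed x) v) (rotate k) placements placements-unique
        (rotate-injective k) (rotate-∈ k) (rotate-onto k)))
      (≡.cong length (filter-≐ (λ x → Covers? decEq (placed (rotate k x)) v) (λ x → Covers? decEq (placed x) 1#)
        ((λ {x} cov → covers-unscale k (placed x) (covers-resp (placed-rotate k x) v≈ek*1 cov))
        , λ {x} cov → covers-resp (placed-sym k x) (sym v≈ek*1) (covers-scale (e k) (placed x) cov))
        placements))
      where
      k = proj₁ (log v v≉0)
      v≈ek*1 : v ≈ e k * 1#
      v≈ek*1 = trans (proj₂ (log v v≉0)) (sym (*-identityʳ _))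
      placed-sym : ∀ k x → mapTri (e k *_) (placed x) ≈△ placed (rotate k x)
      placed-sym k x = let (x₁ , x₂ , x₃) = placed-rotate k x in sym x₁ , sym x₂ , sym x₃

  designConclusion : DesignConclusion decEq
  designConclusion = K , design , (design-independent , design-covers , design-unique) , balanced
                   , multiplication-invariant , automorphism-invariant

proposition6 : (n : ℕ) → 1 < n → (∀ p → Prime p → p ∣ n → p % 6 ≡ 1) →
    ∀ {c ℓ : Level} (R : CommutativeRing c ℓ) (ξ : CommutativeRing.Carrier R) →
    (F : FieldDefs.IsPrimitiveField R n ξ) →
    (m : ℕ) .{{_ : NonZero m}} → m ≡ 2 ^ n ∸ 1 →
    (Z : Fin m → Fin m) → FieldDefs.IsZech R m ξ Z →
    ZM.PairHypothesis m Z →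
    ZM.GammaPartition m Z × FieldDefs.DesignConclusion R (FieldDefs.IsPrimitiveField.decEq F)
proposition6 n 1<n primes≡1[6] R ξ F m m≡2^n∸1 Z isZech pairs =
    GammaBlocks.gammaPartition R ξ n F m m≡2^n∸1 Z isZech primes≡1[6] pairs
  , TriangleDesign.designConclusion R ξ n F m m≡2^n∸1 Z isZech primes≡1[6] pairs 1<m
  where
  1<m : 1 < m
  1<m = ≡.subst (1 <_) (≡.sym m≡2^n∸1) (ℕ.≤-trans (ℕ.s≤s (ℕ.s≤s ℕ.z≤n)) (ℕ.∸-monoˡ-≤ 1 (ℕ.^-monoʳ-≤ 2 1<n)))
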